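{- Let $p$ be prime and let $n$ be an integer with $3\leq n\leq p+1$. Let $\ell_1,\dots,\ell_n$ be $n$ lines of $\mathrm{PG}(2,p)$ through a common point $P$. Then $\mathcal C(2,p)$ contains odd codewords on the lines $\ell_1,\dots,\ell_n$ which cannot be written as linear combinations of codewords whose support is covered by fewer than $n$ lines through $P$.
   Context: $\mathcal C(2,p)$ is the $\mathbb F_p$-span of the characteristic functions (value $1$ on the line, $0$ elsewhere) of the lines of $\mathrm{PG}(2,p)$, as functions from points to $\mathbb F_p$; the support of $c$ is the set of points where $c\neq0$. A codeword $c$ is an odd codeword on the lines $\ell_1,\dots,\ell_n$ through $P$ if its support is contained in $\bigcup_i\ell_i$ and for no $\ell_i$ is $c$ constant on $\ell_i\setminus\{P\}$. -}

module Defs where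

open import Data.Nat using (ℕ; zero; suc; _+_; _*_; _<_; NonZero)
open import Data.Nat.DivMod using (_%_)
open import Data.Fin using (Fin; toℕ)
open import Data.Product using (Σ; _×_; _,_; proj₁; ∃)
open import Data.Sum using (_⊎_)
open import Data.Bool using (if_then_else_)
open import Relation.Nullary using (¬_)
open import Relation.Nullary.Decidable using (⌊_⌋)
open import Relation.Binary.PropositionalEquality using (_≡_; _≢_)
import Data.Nat as ℕ

module PG (p : ℕ) .{{_ : NonZero p}} where

  Triple : Set
  Triple = Fin p × Fin p × Fin p

  -- Normalised representative of a projective point: the first nonzero
  -- coordinate equals 1 (so every 1-dim subspace of F_p^3 has exactly one).
  Normalised : Triple → Set
  Normalised (x , y , z) =
    (toℕ x ≡ 1)
    ⊎ (toℕ x ≡ 0 × toℕ y ≡ 1)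
    ⊎ (toℕ x ≡ 0 × toℕ y ≡ 0 × toℕ z ≡ 1)

  Point : Set
  Point = Σ Triple Normalised

  -- Lines of PG(2,p), given by normalised dual coordinates [a,b,c]:
  -- the line is { (x,y,z) : a x + b y + c z = 0 }.
  Line : Set
  Line = Σ Triple Normalised

  value : Line → Point → ℕ
  value ((a , b , c) , _) ((x , y , z) , _) =
    (toℕ a * toℕ x + toℕ b * toℕ y + toℕ c * toℕ z) % p

  _∈L_ : Point → Line → Set
  Q ∈L L = value L Q ≡ 0

  -- Functions from points to F_p, represented by ℕ-valued functions whose
  -- values are read modulo p.
  Fun : Set
  Fun = Point → ℕ

  _≈_ : Fun → Fun → Set
  f ≈ g = ∀ Q → f Q % p ≡ g Q % p

  χ : Line → Fun
  χ L Q = if ⌊ value L Q ℕ.≟ 0 ⌋ then 1 else 0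

  data Span (S : Fun → Set) : Fun → Set where
    gen  : ∀ {f} → S f → Span S f
    zer  : Span S (λ _ → 0)
    add  : ∀ {f g} → Span S f → Span S g → Span S (λ Q → f Q + g Q)
    smul : ∀ {f} (a : ℕ) → Span S f → Span S (λ Q → a * f Q)
    resp : ∀ {f g} → f ≈ g → Span S f → Span S g

  IsLineChar : Fun → Set
  IsLineChar f = Σ Line λ L → f ≈ χ L

  InCode : Fun → Set
  InCode = Span IsLineChar

  InSupport : Fun → Point → Set
  InSupport c Q = ¬ (c Q % p ≡ 0)

  _≢P_ : Point → Point → Set
  Q ≢P P = proj₁ Q ≢ proj₁ P

  ConstantOffP : Fun → Point → Line → Set
  ConstantOffP c P L =
    ∀ Q R → Q ∈L L → R ∈L L → Q ≢P P → R ≢P P → c Q % p ≡ c R % p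

  OddCodeword : (n : ℕ) → Point → (Fin n → Line) → Fun → Set
  OddCodeword n P ℓ c =
    InCode c
    × (∀ Q → InSupport c Q → Σ (Fin n) λ i → Q ∈L ℓ i)
    × (∀ i → ¬ ConstantOffP c P (ℓ i))

  CoveredByFewer : ℕ → Point → Fun → Set
  CoveredByFewer n P c =
    InCode c
    × Σ ℕ λ k → k < n × Σ (Fin k → Line) λ m →
        (∀ j → P ∈L m j)
        × (∀ Q → InSupport c Q → Σ (Fin k) λ j → Q ∈L m j)

{-# OPTIONS --safe #-}
module Submission where

-- Choose coordinates in which P is the vertical direction, ℓ 0 is the line at infinity and
-- ℓ 1 is the vertical x = 0, and let a₁, …, aⱼ be the verticals x = a missing from the ℓ i.
-- Starting from the indicator of the x-axis, apply for each aᵢ the difference operator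
-- f (x , y) ↦ f (x , y - s x - 1) - f (x , y) with s = -1/aᵢ: the result c is a codeword
-- vanishing on every x = aᵢ, hence off the lines ℓ i.
--
-- For any codeword, the falling moment M (a) = Σ_y y (y - 1) ⋯ (y - j + 1) c (a , y) along
-- x = a is a polynomial in a of degree ≤ j whose top coefficient is a power moment of c
-- along ℓ 0. For our c, M (0) = j! ≠ 0 while M vanishes at a₁, …, aⱼ; if c were constant on
-- some ℓ i ∖ {P}, M would gain the root a (i > 0) or lose its top coefficient (i = 0), and
-- so vanish. A codeword covered by k < n lines through P has M vanishing at the verticals
-- outside the cover: at least p - k + 1 of them if ℓ 0 is in the cover, and otherwise at
-- least p - k together with the top coefficient. As j ≤ p + 1 - n ≤ p - k, M vanishes
-- identically; by linearity M (0) = 0 on the span of such codewords, which thus misses c.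

open import Defs
open import Data.Nat using (ℕ; suc; NonZero)
open import Data.Nat.Primality using (Prime)
open import Data.Fin using (Fin)
open import Data.Product using (proj₁)
open import Function using (_∘_)
open import Function.Definitions using (Injective)
open import Relation.Binary.PropositionalEquality using (_≡_; _≢_)

module Vector where
  import Level
  open import Level using (Level)
  open import Algebra.Bundles.Raw using (RawRing)
  open import Data.Nat using (ℕ)
  open import Data.Integer using (ℤ; _+_; _*_; -_; _-_; 0ℤ; 1ℤ; +-*-rawRing)
  open import Data.Integer.Solver using (module +-*-Solver)
  open import Relation.Binary.PropositionalEquality
  open import Data.Product using (_×_; _,_)

  -- Vectors of length three over a raw ring; instantiated both with ℤ and with the
  -- solver's polynomial expressions, so that vector identities over ℤ are proved by
  -- normalising the corresponding expressions.
  module ThreeVectors {c ℓ : Level} (R : RawRing c ℓ) where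
    open RawRing R using (Carrier) renaming (_+_ to _⊕_; _*_ to _⊛_; -_ to ⊝_)

    infixl 6 _+ᵛ_ _-ᵛ_ _⊖_
    infixl 7 _*ᵛ_
    infix 8 _∙_
    infixr 9 _⨯_

    _⊖_ : Carrier → Carrier → Carrier
    a ⊖ b = a ⊕ ⊝ b

    record Vec3 : Set c where
      constructor vec
      field vx vy vz : Carrier

    _+ᵛ_ : Vec3 → Vec3 → Vec3
    vec a b c +ᵛ vec x y z = vec (a ⊕ x) (b ⊕ y) (c ⊕ z)

    _-ᵛ_ : Vec3 → Vec3 → Vec3
    vec a b c -ᵛ vec x y z = vec (a ⊖ x) (b ⊖ y) (c ⊖ z)

    _*ᵛ_ : Carrier → Vec3 → Vec3
    k *ᵛ vec x y z = vec (k ⊛ x) (k ⊛ y) (k ⊛ z)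

    _∙_ : Vec3 → Vec3 → Carrier
    vec a b c ∙ vec x y z = a ⊛ x ⊕ b ⊛ y ⊕ c ⊛ z

    _⨯_ : Vec3 → Vec3 → Vec3
    vec a₁ a₂ a₃ ⨯ vec b₁ b₂ b₃ = vec (a₂ ⊛ b₃ ⊖ a₃ ⊛ b₂) (a₃ ⊛ b₁ ⊖ a₁ ⊛ b₃) (a₁ ⊛ b₂ ⊖ a₂ ⊛ b₁)

    triple : Vec3 → Vec3 → Vec3 → Carrier
    triple s t o = s ∙ (t ⨯ o)

  open +-*-Solver
  private
    expressions : ℕ → RawRing Level.zero Level.zero
    expressions n = record
      { Carrier = Polynomial n ; _≈_ = _≡_ ; _+_ = _:+_ ; _*_ = _:*_ ; -_ = :-_ ; 0# = con 0ℤ ; 1# = con 1ℤ }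

    module E {n : ℕ} = ThreeVectors (expressions n)

  open ThreeVectors +-*-rawRing public hiding (_⊖_)

  vec-≡ : ∀ {a b c a′ b′ c′} → a ≡ a′ → b ≡ b′ → c ≡ c′ → vec a b c ≡ vec a′ b′ c′
  vec-≡ refl refl refl = refl

  ∙-comm : ∀ a b → a ∙ b ≡ b ∙ a
  ∙-comm (vec a₁ a₂ a₃) (vec b₁ b₂ b₃) = solve 6 (λ a₁ a₂ a₃ b₁ b₂ b₃ →
    E.vec a₁ a₂ a₃ E.∙ E.vec b₁ b₂ b₃ := E.vec b₁ b₂ b₃ E.∙ E.vec a₁ a₂ a₃) refl a₁ a₂ a₃ b₁ b₂ b₃

  ∙-*ʳ : ∀ l k q → l ∙ (k *ᵛ q) ≡ k * (l ∙ q)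
  ∙-*ʳ (vec l₁ l₂ l₃) k (vec q₁ q₂ q₃) = solve 7 (λ l₁ l₂ l₃ k q₁ q₂ q₃ →
    E.vec l₁ l₂ l₃ E.∙ (k E.*ᵛ E.vec q₁ q₂ q₃) := k :* (E.vec l₁ l₂ l₃ E.∙ E.vec q₁ q₂ q₃)) refl l₁ l₂ l₃ k q₁ q₂ q₃

  ∙-*ˡ : ∀ k q l → (k *ᵛ q) ∙ l ≡ k * (q ∙ l)
  ∙-*ˡ k (vec q₁ q₂ q₃) (vec l₁ l₂ l₃) = solve 7 (λ l₁ l₂ l₃ k q₁ q₂ q₃ →
    (k E.*ᵛ E.vec q₁ q₂ q₃) E.∙ E.vec l₁ l₂ l₃ := k :* (E.vec q₁ q₂ q₃ E.∙ E.vec l₁ l₂ l₃)) refl l₁ l₂ l₃ k q₁ q₂ q₃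

  ∙-⨯-selfˡ : ∀ a b → a ∙ (a ⨯ b) ≡ 0ℤ
  ∙-⨯-selfˡ (vec a₁ a₂ a₃) (vec b₁ b₂ b₃) = solve 6 (λ a₁ a₂ a₃ b₁ b₂ b₃ →
    E.vec a₁ a₂ a₃ E.∙ (E.vec a₁ a₂ a₃ E.⨯ E.vec b₁ b₂ b₃) := con 0ℤ) refl a₁ a₂ a₃ b₁ b₂ b₃

  ∙-⨯-selfʳ : ∀ a b → b ∙ (a ⨯ b) ≡ 0ℤ
  ∙-⨯-selfʳ (vec a₁ a₂ a₃) (vec b₁ b₂ b₃) = solve 6 (λ a₁ a₂ a₃ b₁ b₂ b₃ →
    E.vec b₁ b₂ b₃ E.∙ (E.vec a₁ a₂ a₃ E.⨯ E.vec b₁ b₂ b₃) := con 0ℤ) refl a₁ a₂ a₃ b₁ b₂ b₃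

  ⨯-⨯-expand : ∀ a b c → (a ⨯ b) ⨯ c ≡ (a ∙ c) *ᵛ b -ᵛ (b ∙ c) *ᵛ a
  ⨯-⨯-expand (vec a₁ a₂ a₃) (vec b₁ b₂ b₃) (vec c₁ c₂ c₃) = vec-≡
    (solve 9 (λ a₁ a₂ a₃ b₁ b₂ b₃ c₁ c₂ c₃ → let a = E.vec a₁ a₂ a₃; b = E.vec b₁ b₂ b₃; c = E.vec c₁ c₂ c₃ in
       E.Vec3.vx ((a E.⨯ b) E.⨯ c) := E.Vec3.vx ((a E.∙ c) E.*ᵛ b E.-ᵛ (b E.∙ c) E.*ᵛ a)) refl a₁ a₂ a₃ b₁ b₂ b₃ c₁ c₂ c₃)
    (solve 9 (λ a₁ a₂ a₃ b₁ b₂ b₃ c₁ c₂ c₃ → let a = E.vec a₁ a₂ a₃; b = E.vec b₁ b₂ b₃; c = E.vec c₁ c₂ c₃ in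
       E.Vec3.vy ((a E.⨯ b) E.⨯ c) := E.Vec3.vy ((a E.∙ c) E.*ᵛ b E.-ᵛ (b E.∙ c) E.*ᵛ a)) refl a₁ a₂ a₃ b₁ b₂ b₃ c₁ c₂ c₃)
    (solve 9 (λ a₁ a₂ a₃ b₁ b₂ b₃ c₁ c₂ c₃ → let a = E.vec a₁ a₂ a₃; b = E.vec b₁ b₂ b₃; c = E.vec c₁ c₂ c₃ in
       E.Vec3.vz ((a E.⨯ b) E.⨯ c) := E.Vec3.vz ((a E.∙ c) E.*ᵛ b E.-ᵛ (b E.∙ c) E.*ᵛ a)) refl a₁ a₂ a₃ b₁ b₂ b₃ c₁ c₂ c₃)

  cramer : ∀ s t o q → triple s t o *ᵛ q ≡ (q ∙ (t ⨯ o)) *ᵛ s +ᵛ (q ∙ (o ⨯ s)) *ᵛ t +ᵛ (q ∙ (s ⨯ t)) *ᵛ o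
  cramer (vec s₁ s₂ s₃) (vec t₁ t₂ t₃) (vec o₁ o₂ o₃) (vec q₁ q₂ q₃) = vec-≡
    (solve 12 (λ s₁ s₂ s₃ t₁ t₂ t₃ o₁ o₂ o₃ q₁ q₂ q₃ → let s = E.vec s₁ s₂ s₃; t = E.vec t₁ t₂ t₃; o = E.vec o₁ o₂ o₃; q = E.vec q₁ q₂ q₃ in
       E.Vec3.vx (E.triple s t o E.*ᵛ q) := E.Vec3.vx ((q E.∙ (t E.⨯ o)) E.*ᵛ s E.+ᵛ (q E.∙ (o E.⨯ s)) E.*ᵛ t E.+ᵛ (q E.∙ (s E.⨯ t)) E.*ᵛ o))
       refl s₁ s₂ s₃ t₁ t₂ t₃ o₁ o₂ o₃ q₁ q₂ q₃)
    (solve 12 (λ s₁ s₂ s₃ t₁ t₂ t₃ o₁ o₂ o₃ q₁ q₂ q₃ → let s = E.vec s₁ s₂ s₃; t = E.vec t₁ t₂ t₃; o = E.vec o₁ o₂ o₃; q = E.vec q₁ q₂ q₃ in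
       E.Vec3.vy (E.triple s t o E.*ᵛ q) := E.Vec3.vy ((q E.∙ (t E.⨯ o)) E.*ᵛ s E.+ᵛ (q E.∙ (o E.⨯ s)) E.*ᵛ t E.+ᵛ (q E.∙ (s E.⨯ t)) E.*ᵛ o))
       refl s₁ s₂ s₃ t₁ t₂ t₃ o₁ o₂ o₃ q₁ q₂ q₃)
    (solve 12 (λ s₁ s₂ s₃ t₁ t₂ t₃ o₁ o₂ o₃ q₁ q₂ q₃ → let s = E.vec s₁ s₂ s₃; t = E.vec t₁ t₂ t₃; o = E.vec o₁ o₂ o₃; q = E.vec q₁ q₂ q₃ in
       E.Vec3.vz (E.triple s t o E.*ᵛ q) := E.Vec3.vz ((q E.∙ (t E.⨯ o)) E.*ᵛ s E.+ᵛ (q E.∙ (o E.⨯ s)) E.*ᵛ t E.+ᵛ (q E.∙ (s E.⨯ t)) E.*ᵛ o))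
       refl s₁ s₂ s₃ t₁ t₂ t₃ o₁ o₂ o₃ q₁ q₂ q₃)

  triple-⨯ : ∀ l m t k → triple (l ⨯ m) t (k ⨯ m) ≡ (t ∙ m) * (m ∙ (k ⨯ l)) - (t ∙ k) * ((l ⨯ m) ∙ m)
  triple-⨯ (vec l₁ l₂ l₃) (vec m₁ m₂ m₃) (vec t₁ t₂ t₃) (vec k₁ k₂ k₃) =
    solve 12 (λ l₁ l₂ l₃ m₁ m₂ m₃ t₁ t₂ t₃ k₁ k₂ k₃ → let l = E.vec l₁ l₂ l₃; m = E.vec m₁ m₂ m₃; t = E.vec t₁ t₂ t₃; k = E.vec k₁ k₂ k₃ in
      E.triple (l E.⨯ m) t (k E.⨯ m) := (t E.∙ m) :* (m E.∙ (k E.⨯ l)) :- (t E.∙ k) :* ((l E.⨯ m) E.∙ m))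
      refl l₁ l₂ l₃ m₁ m₂ m₃ t₁ t₂ t₃ k₁ k₂ k₃

  triple-swap₁₃ : ∀ s t o → triple o t s ≡ - triple s t o
  triple-swap₁₃ (vec s₁ s₂ s₃) (vec t₁ t₂ t₃) (vec o₁ o₂ o₃) =
    solve 9 (λ s₁ s₂ s₃ t₁ t₂ t₃ o₁ o₂ o₃ → let s = E.vec s₁ s₂ s₃; t = E.vec t₁ t₂ t₃; o = E.vec o₁ o₂ o₃ in
      E.triple o t s := :- E.triple s t o) refl s₁ s₂ s₃ t₁ t₂ t₃ o₁ o₂ o₃

  ∙-combination : ∀ l a s b t c o → l ∙ (a *ᵛ s +ᵛ b *ᵛ t +ᵛ c *ᵛ o) ≡ a * (l ∙ s) + b * (l ∙ t) + c * (l ∙ o)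
  ∙-combination (vec l₁ l₂ l₃) a (vec s₁ s₂ s₃) b (vec t₁ t₂ t₃) c (vec o₁ o₂ o₃) =
    solve 15 (λ l₁ l₂ l₃ a s₁ s₂ s₃ b t₁ t₂ t₃ c o₁ o₂ o₃ → let l = E.vec l₁ l₂ l₃; s = E.vec s₁ s₂ s₃; t = E.vec t₁ t₂ t₃; o = E.vec o₁ o₂ o₃ in
      l E.∙ (a E.*ᵛ s E.+ᵛ b E.*ᵛ t E.+ᵛ c E.*ᵛ o) := a :* (l E.∙ s) :+ b :* (l E.∙ t) :+ c :* (l E.∙ o))
      refl l₁ l₂ l₃ a s₁ s₂ s₃ b t₁ t₂ t₃ c o₁ o₂ o₃

  ∙-affine : ∀ l o x s y t → l ∙ (o +ᵛ x *ᵛ s +ᵛ y *ᵛ t) ≡ l ∙ o + x * (l ∙ s) + y * (l ∙ t)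
  ∙-affine (vec l₁ l₂ l₃) (vec o₁ o₂ o₃) x (vec s₁ s₂ s₃) y (vec t₁ t₂ t₃) =
    solve 14 (λ l₁ l₂ l₃ o₁ o₂ o₃ x s₁ s₂ s₃ y t₁ t₂ t₃ → let l = E.vec l₁ l₂ l₃; s = E.vec s₁ s₂ s₃; t = E.vec t₁ t₂ t₃; o = E.vec o₁ o₂ o₃ in
      l E.∙ (o E.+ᵛ x E.*ᵛ s E.+ᵛ y E.*ᵛ t) := l E.∙ o :+ x :* (l E.∙ s) :+ y :* (l E.∙ t))
      refl l₁ l₂ l₃ o₁ o₂ o₃ x s₁ s₂ s₃ y t₁ t₂ t₃

  ∙-+*ᵛ : ∀ l s z t → l ∙ (s +ᵛ z *ᵛ t) ≡ l ∙ s + z * (l ∙ t)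
  ∙-+*ᵛ (vec l₁ l₂ l₃) (vec s₁ s₂ s₃) z (vec t₁ t₂ t₃) =
    solve 10 (λ l₁ l₂ l₃ s₁ s₂ s₃ z t₁ t₂ t₃ → let l = E.vec l₁ l₂ l₃; s = E.vec s₁ s₂ s₃; t = E.vec t₁ t₂ t₃ in
      l E.∙ (s E.+ᵛ z E.*ᵛ t) := l E.∙ s :+ z :* (l E.∙ t)) refl l₁ l₂ l₃ s₁ s₂ s₃ z t₁ t₂ t₃

  affine-coordinates : ∀ s t o x y →
    (o +ᵛ x *ᵛ s +ᵛ y *ᵛ t) ∙ (t ⨯ o) ≡ x * triple s t o ×
    (o +ᵛ x *ᵛ s +ᵛ y *ᵛ t) ∙ (o ⨯ s) ≡ y * triple s t o ×
    (o +ᵛ x *ᵛ s +ᵛ y *ᵛ t) ∙ (s ⨯ t) ≡ triple s t o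
  affine-coordinates (vec s₁ s₂ s₃) (vec t₁ t₂ t₃) (vec o₁ o₂ o₃) x y =
    solve 11 (λ s₁ s₂ s₃ t₁ t₂ t₃ o₁ o₂ o₃ x y → let s = E.vec s₁ s₂ s₃; t = E.vec t₁ t₂ t₃; o = E.vec o₁ o₂ o₃ in
      (o E.+ᵛ x E.*ᵛ s E.+ᵛ y E.*ᵛ t) E.∙ (t E.⨯ o) := x :* E.triple s t o) refl s₁ s₂ s₃ t₁ t₂ t₃ o₁ o₂ o₃ x y ,
    solve 11 (λ s₁ s₂ s₃ t₁ t₂ t₃ o₁ o₂ o₃ x y → let s = E.vec s₁ s₂ s₃; t = E.vec t₁ t₂ t₃; o = E.vec o₁ o₂ o₃ in
      (o E.+ᵛ x E.*ᵛ s E.+ᵛ y E.*ᵛ t) E.∙ (o E.⨯ s) := y :* E.triple s t o) refl s₁ s₂ s₃ t₁ t₂ t₃ o₁ o₂ o₃ x y ,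
    solve 11 (λ s₁ s₂ s₃ t₁ t₂ t₃ o₁ o₂ o₃ x y → let s = E.vec s₁ s₂ s₃; t = E.vec t₁ t₂ t₃; o = E.vec o₁ o₂ o₃ in
      (o E.+ᵛ x E.*ᵛ s E.+ᵛ y E.*ᵛ t) E.∙ (s E.⨯ t) := E.triple s t o) refl s₁ s₂ s₃ t₁ t₂ t₃ o₁ o₂ o₃ x y

  +*ᵛ-∙-t⨯o : ∀ s t o z → (s +ᵛ z *ᵛ t) ∙ (t ⨯ o) ≡ triple s t o
  +*ᵛ-∙-t⨯o (vec s₁ s₂ s₃) (vec t₁ t₂ t₃) (vec o₁ o₂ o₃) z =
    solve 10 (λ s₁ s₂ s₃ t₁ t₂ t₃ o₁ o₂ o₃ z → let s = E.vec s₁ s₂ s₃; t = E.vec t₁ t₂ t₃; o = E.vec o₁ o₂ o₃ in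
      (s E.+ᵛ z E.*ᵛ t) E.∙ (t E.⨯ o) := E.triple s t o) refl s₁ s₂ s₃ t₁ t₂ t₃ o₁ o₂ o₃ z

  dual-combination-∙ : ∀ s t o m b q →
    (m *ᵛ (t ⨯ o) -ᵛ o ⨯ s +ᵛ b *ᵛ (s ⨯ t)) ∙ q ≡ m * (q ∙ (t ⨯ o)) - q ∙ (o ⨯ s) + b * (q ∙ (s ⨯ t))
  dual-combination-∙ (vec s₁ s₂ s₃) (vec t₁ t₂ t₃) (vec o₁ o₂ o₃) m b (vec q₁ q₂ q₃) =
    solve 14 (λ s₁ s₂ s₃ t₁ t₂ t₃ o₁ o₂ o₃ m b q₁ q₂ q₃ → let s = E.vec s₁ s₂ s₃; t = E.vec t₁ t₂ t₃; o = E.vec o₁ o₂ o₃; q = E.vec q₁ q₂ q₃ in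
      (m E.*ᵛ (t E.⨯ o) E.-ᵛ o E.⨯ s E.+ᵛ b E.*ᵛ (s E.⨯ t)) E.∙ q := m :* (q E.∙ (t E.⨯ o)) :- q E.∙ (o E.⨯ s) :+ b :* (q E.∙ (s E.⨯ t)))
      refl s₁ s₂ s₃ t₁ t₂ t₃ o₁ o₂ o₃ m b q₁ q₂ q₃

  dual-combination-∙-t : ∀ s t o m b → (m *ᵛ (t ⨯ o) -ᵛ o ⨯ s +ᵛ b *ᵛ (s ⨯ t)) ∙ t ≡ - triple s t o
  dual-combination-∙-t (vec s₁ s₂ s₃) (vec t₁ t₂ t₃) (vec o₁ o₂ o₃) m b =
    solve 11 (λ s₁ s₂ s₃ t₁ t₂ t₃ o₁ o₂ o₃ m b → let s = E.vec s₁ s₂ s₃; t = E.vec t₁ t₂ t₃; o = E.vec o₁ o₂ o₃ in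
      (m E.*ᵛ (t E.⨯ o) E.-ᵛ o E.⨯ s E.+ᵛ b E.*ᵛ (s E.⨯ t)) E.∙ t := :- E.triple s t o)
      refl s₁ s₂ s₃ t₁ t₂ t₃ o₁ o₂ o₃ m b

  triple-affine : ∀ s t o x y → triple s t (o +ᵛ x *ᵛ s +ᵛ y *ᵛ t) ≡ triple s t o
  triple-affine (vec s₁ s₂ s₃) (vec t₁ t₂ t₃) (vec o₁ o₂ o₃) x y =
    solve 11 (λ s₁ s₂ s₃ t₁ t₂ t₃ o₁ o₂ o₃ x y → let s = E.vec s₁ s₂ s₃; t = E.vec t₁ t₂ t₃; o = E.vec o₁ o₂ o₃ in
      E.triple s t (o E.+ᵛ x E.*ᵛ s E.+ᵛ y E.*ᵛ t) := E.triple s t o) refl s₁ s₂ s₃ t₁ t₂ t₃ o₁ o₂ o₃ x y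

module Modular (p : ℕ) .{{_ : NonZero p}} (prime : Prime p) where
  open import Data.Nat as ℕ using (ℕ; zero; suc; NonZero; z≤n; s≤s; _∸_)
  open import Function using (_∘_)
  open import Data.Nat.Primality using (Prime; euclidsLemma; prime⇒nonTrivial)
  open import Data.Nat.Coprimality using (coprime-Bézout; prime⇒coprime)
  open import Data.Nat.GCD using (module Bézout)
  import Data.Nat.Properties as ℕ
  import Data.Nat.DivMod as ℕ
  import Data.Nat.Divisibility as ℕ
  open import Data.Integer using (ℤ; +_; _+_; _*_; -_; _-_; ∣_∣; 0ℤ; 1ℤ; _%ℕ_; _/ℕ_)
  import Data.Integer.Properties as ℤ
  import Data.Integer.DivMod as ℤ
  open import Data.Integer.Divisibility.Signed using (_∣_; divides; _∣?_; ∣m∣n⇒∣m+n; ∣m⇒∣-m; ∣n⇒∣m*n; ∣m⇒∣m*n; ∣ᵤ⇒∣; ∣⇒∣ᵤ)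
  open import Data.Integer.Tactic.RingSolver using (solve-∀)
  open import Data.Sum using (_⊎_; inj₁; inj₂; [_,_])
  open import Data.Empty using (⊥-elim)
  open import Relation.Nullary using (¬_; Dec; yes; no; map′)
  open import Relation.Binary.Bundles using (Setoid)
  open import Relation.Binary.Structures using (IsEquivalence)
  open import Relation.Binary.PropositionalEquality hiding ([_])
  open import Data.Product using (Σ; _,_; proj₁; proj₂)
  import Relation.Binary.Reasoning.Setoid as SetoidReasoning

  infix 4 _≋_ _≉_ _≋?_

  -- Congruence modulo p; a record rather than a synonym so that a and b stay inferable.
  record _≋_ (a b : ℤ) : Set where
    constructor mk≋
    field p∣a-b : + p ∣ a - b
  open _≋_ public

  _≉_ : ℤ → ℤ → Set
  a ≉ b = ¬ a ≋ b

  ≋-refl : ∀ {a} → a ≋ a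
  ≋-refl {a} = mk≋ (divides 0ℤ (ℤ.+-inverseʳ a))

  ≡⇒≋ : ∀ {a b} → a ≡ b → a ≋ b
  ≡⇒≋ refl = ≋-refl

  ≋-sym : ∀ {a b} → a ≋ b → b ≋ a
  ≋-sym {a} {b} (mk≋ d) = mk≋ (subst (+ p ∣_) (swap a b) (∣m⇒∣-m d))
    where swap : ∀ a b → - (a - b) ≡ b - a
          swap = solve-∀

  ≋-trans : ∀ {a b c} → a ≋ b → b ≋ c → a ≋ c
  ≋-trans {a} {b} {c} (mk≋ d) (mk≋ e) =
    mk≋ (subst (+ p ∣_) (ℤ.+-minus-telescope a b c) (∣m∣n⇒∣m+n d e))

  ≋-isEquivalence : IsEquivalence _≋_
  ≋-isEquivalence = record { refl = ≋-refl ; sym = ≋-sym ; trans = ≋-trans }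

  ≋-setoid : Setoid _ _
  ≋-setoid = record { isEquivalence = ≋-isEquivalence }

  module ≋-Reasoning = SetoidReasoning ≋-setoid

  +-cong : ∀ {a a′ b b′} → a ≋ a′ → b ≋ b′ → a + b ≋ a′ + b′
  +-cong {a} {a′} {b} {b′} (mk≋ d) (mk≋ e) = mk≋ (subst (+ p ∣_) (regroup a a′ b b′) (∣m∣n⇒∣m+n d e))
    where regroup : ∀ a a′ b b′ → (a - a′) + (b - b′) ≡ (a + b) - (a′ + b′)
          regroup = solve-∀

  -‿cong : ∀ {a a′} → a ≋ a′ → - a ≋ - a′
  -‿cong {a} {a′} (mk≋ d) = mk≋ (subst (+ p ∣_) (regroup a a′) (∣m⇒∣-m d))
    where regroup : ∀ a a′ → - (a - a′) ≡ - a - - a′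
          regroup = solve-∀

  -‿≉0 : ∀ {a} → a ≉ 0ℤ → - a ≉ 0ℤ
  -‿≉0 {a} a≉0 -a≋0 = a≉0 (≋-trans (≡⇒≋ (sym (ℤ.neg-involutive a))) (-‿cong -a≋0))

  minus-cong : ∀ {a a′ b b′} → a ≋ a′ → b ≋ b′ → a - b ≋ a′ - b′
  minus-cong a≋a′ b≋b′ = +-cong a≋a′ (-‿cong b≋b′)

  *-cong : ∀ {a a′ b b′} → a ≋ a′ → b ≋ b′ → a * b ≋ a′ * b′
  *-cong {a} {a′} {b} {b′} (mk≋ d) (mk≋ e) =
    mk≋ (subst (+ p ∣_) (regroup a a′ b b′) (∣m∣n⇒∣m+n (∣m⇒∣m*n b d) (∣n⇒∣m*n a′ e)))
    where regroup : ∀ a a′ b b′ → (a - a′) * b + a′ * (b - b′) ≡ a * b - a′ * b′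
          regroup = solve-∀

  +-congˡ : ∀ {a b b′} → b ≋ b′ → a + b ≋ a + b′
  +-congˡ {a} = +-cong (≋-refl {a})

  +-congʳ : ∀ {a a′ b} → a ≋ a′ → a + b ≋ a′ + b
  +-congʳ {b = b} a≋a′ = +-cong a≋a′ (≋-refl {b})

  *-congˡ : ∀ {a b b′} → b ≋ b′ → a * b ≋ a * b′
  *-congˡ {a} = *-cong (≋-refl {a})

  *-congʳ : ∀ {a a′ b} → a ≋ a′ → a * b ≋ a′ * b
  *-congʳ {b = b} a≋a′ = *-cong a≋a′ (≋-refl {b})

  _≋?_ : ∀ a b → Dec (a ≋ b)
  a ≋? b = map′ mk≋ p∣a-b (+ p ∣? (a - b))

  minus≋0⇒≋ : ∀ {a b} → a - b ≋ 0ℤ → a ≋ b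
  minus≋0⇒≋ {a} {b} (mk≋ d) = mk≋ (subst (+ p ∣_) (ℤ.+-identityʳ (a - b)) d)

  ≋⇒minus≋0 : ∀ {a b} → a ≋ b → a - b ≋ 0ℤ
  ≋⇒minus≋0 {a} {b} (mk≋ d) = mk≋ (subst (+ p ∣_) (sym (ℤ.+-identityʳ (a - b))) d)

  *p≋0 : ∀ k → k * + p ≋ 0ℤ
  *p≋0 k = mk≋ (divides k (ℤ.+-identityʳ (k * + p)))

  p≋0 : + p ≋ 0ℤ
  p≋0 = ≋-trans (≡⇒≋ (sym (ℤ.*-identityˡ (+ p)))) (*p≋0 1ℤ)

  ≋0⇒p∣ : ∀ {a} → a ≋ 0ℤ → p ℕ.∣ ∣ a ∣
  ≋0⇒p∣ {a} (mk≋ d) = ∣⇒∣ᵤ (subst (+ p ∣_) (ℤ.+-identityʳ a) d)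

  p∣⇒≋0 : ∀ {a} → p ℕ.∣ ∣ a ∣ → a ≋ 0ℤ
  p∣⇒≋0 {a} d = mk≋ (subst (+ p ∣_) (sym (ℤ.+-identityʳ a)) (∣ᵤ⇒∣ d))

  *≋0⇒≋0⊎≋0 : ∀ {a b} → a * b ≋ 0ℤ → a ≋ 0ℤ ⊎ b ≋ 0ℤ
  *≋0⇒≋0⊎≋0 {a} {b} ab≋0 with euclidsLemma ∣ a ∣ ∣ b ∣ prime (subst (p ℕ.∣_) (ℤ.abs-* a b) (≋0⇒p∣ ab≋0))
  ... | inj₁ p∣a = inj₁ (p∣⇒≋0 p∣a)
  ... | inj₂ p∣b = inj₂ (p∣⇒≋0 p∣b)

  *-≉0 : ∀ {a b} → a ≉ 0ℤ → b ≉ 0ℤ → a * b ≉ 0ℤ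
  *-≉0 a≉0 b≉0 ab≋0 = [ a≉0 , b≉0 ] (*≋0⇒≋0⊎≋0 ab≋0)

  *-cancelˡ-≋ : ∀ {c a b} → c ≉ 0ℤ → c * a ≋ c * b → a ≋ b
  *-cancelˡ-≋ {c} {a} {b} c≉0 ca≋cb =
    [ (λ c≋0 → ⊥-elim (c≉0 c≋0)) , minus≋0⇒≋ ] (*≋0⇒≋0⊎≋0 (≋-trans (≡⇒≋ (factor c a b)) (≋⇒minus≋0 ca≋cb)))
    where factor : ∀ c a b → c * (a - b) ≡ c * a - c * b
          factor = solve-∀

  n≋n%p : ∀ n → + n ≋ + (n ℕ.% p)
  n≋n%p n = ≋-trans (≡⇒≋ (trans (cong +_ (ℕ.m≡m%n+[m/n]*n n p)) (ℤ.pos-+ (n ℕ.% p) _)))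
    (≋-trans (+-congˡ {+ (n ℕ.% p)} (≋-trans (≡⇒≋ (ℤ.pos-* (n ℕ./ p) p)) (*p≋0 (+ (n ℕ./ p)))))
    (≡⇒≋ (ℤ.+-identityʳ _)))

  %≡⇒≋ : ∀ {m n} → m ℕ.% p ≡ n ℕ.% p → + m ≋ + n
  %≡⇒≋ {m} {n} eq = ≋-trans (n≋n%p m) (≋-trans (≡⇒≋ (cong +_ eq)) (≋-sym (n≋n%p n)))

  %≡0⇒≋0 : ∀ {n} → n ℕ.% p ≡ 0 → + n ≋ 0ℤ
  %≡0⇒≋0 {n} eq = p∣⇒≋0 (ℕ.m%n≡0⇒n∣m n p eq)

  ≋0⇒%≡0 : ∀ {n} → + n ≋ 0ℤ → n ℕ.% p ≡ 0
  ≋0⇒%≡0 {n} n≋0 = ℕ.n∣m⇒m%n≡0 n p (≋0⇒p∣ n≋0)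

  private
    ≤-≋⇒≡-below-p : ∀ {x y} → x ℕ.≤ y → y ℕ.< p → + x ≋ + y → x ≡ y
    ≤-≋⇒≡-below-p {x} {y} x≤y y<p x≋y = ℕ.≤-antisym x≤y (ℕ.m∸n≡0⇒m≤n (begin
      y ∸ x         ≡⟨ ℕ.m<n⇒m%n≡m (ℕ.≤-<-trans (ℕ.m∸n≤m y x) y<p) ⟨
      (y ∸ x) ℕ.% p ≡⟨ ℕ.n∣m⇒m%n≡0 _ p p∣y-x ⟩
      0             ∎))
      where
      open ≡-Reasoning
      p∣y-x : p ℕ.∣ y ∸ x
      p∣y-x = subst (p ℕ.∣_) (trans (cong ∣_∣ (ℤ.[+m]-[+n]≡m⊖n x y)) (ℤ.∣⊖∣-≤ x≤y))
                    (≋0⇒p∣ (≋⇒minus≋0 x≋y))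

  ≋⇒≡-below-p : ∀ {x y} → x ℕ.< p → y ℕ.< p → + x ≋ + y → x ≡ y
  ≋⇒≡-below-p {x} {y} x<p y<p x≋y with ℕ.≤-total x y
  ... | inj₁ x≤y = ≤-≋⇒≡-below-p x≤y y<p x≋y
  ... | inj₂ y≤x = sym (≤-≋⇒≡-below-p y≤x x<p (≋-sym x≋y))

  1<p : 1 ℕ.< p
  1<p = ℕ.nonTrivial⇒n>1 p {{prime⇒nonTrivial prime}}

  0<p : 0 ℕ.< p
  0<p = ℕ.<-trans ℕ.0<1+n 1<p

  nonzero-below-p : ∀ {n} → 0 ℕ.< n → n ℕ.< p → + n ≉ 0ℤ
  nonzero-below-p 0<n n<p n≋0 = ℕ.<⇒≢ 0<n (sym (≋⇒≡-below-p n<p 0<p n≋0))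

  1≉0 : 1ℤ ≉ 0ℤ
  1≉0 = nonzero-below-p ℕ.0<1+n 1<p

  !≉0 : ∀ n → n ℕ.< p → + (n ℕ.!) ≉ 0ℤ
  !≉0 zero    _     = 1≉0
  !≉0 (suc n) 1+n<p = *-≉0 (nonzero-below-p (s≤s z≤n) 1+n<p) (!≉0 n (ℕ.<-trans ℕ.≤-refl 1+n<p))
                      ∘ ≋-trans (≡⇒≋ (sym (ℤ.pos-* (suc n) (n ℕ.!))))

  reduce : ℤ → ℕ
  reduce a = a %ℕ p

  reduce<p : ∀ a → reduce a ℕ.< p
  reduce<p a = ℤ.n%ℕd<d a p

  reduce-≋ : ∀ a → + reduce a ≋ a
  reduce-≋ a = ≋-sym (≋-trans (≡⇒≋ (ℤ.a≡a%ℕn+[a/ℕn]*n a p))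
    (≋-trans (+-congˡ {+ reduce a} (*p≋0 (a /ℕ p))) (≡⇒≋ (ℤ.+-identityʳ _))))

  private
    bézout-inverse : ∀ {r} → Bézout.Identity 1 p r → Σ ℤ λ i → + r * i ≋ 1ℤ
    bézout-inverse {r} (Bézout.+- x y eq) = - + y , minus≋0⇒≋ (mk≋ (divides (- + x) (begin
        + r * - + y - 1ℤ + 0ℤ    ≡⟨ regroup (+ r) (+ y) ⟩
        - (1ℤ + + y * + r)       ≡⟨ cong (λ z → - z) (trans (cong (λ z → 1ℤ + z) (sym (ℤ.pos-* y r))) (cong +_ eq)) ⟩
        - (+ (x ℕ.* p))          ≡⟨ cong -_ (ℤ.pos-* x p) ⟩
        - (+ x * + p)            ≡⟨ ℤ.neg-distribˡ-* (+ x) (+ p) ⟩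
        - + x * + p              ∎)))
      where open ≡-Reasoning
            regroup : ∀ r y → r * - y - 1ℤ + 0ℤ ≡ - (1ℤ + y * r)
            regroup = solve-∀
    bézout-inverse {r} (Bézout.-+ x y eq) = + y , minus≋0⇒≋ (mk≋ (divides (+ x) (begin
        + r * + y - 1ℤ + 0ℤ      ≡⟨ regroup (+ r) (+ y) ⟩
        + y * + r - 1ℤ           ≡⟨ cong (_- 1ℤ) (trans (sym (ℤ.pos-* y r)) (cong +_ (sym eq))) ⟩
        + (1 ℕ.+ x ℕ.* p) - 1ℤ   ≡⟨ cong (_- 1ℤ) (trans (ℤ.pos-+ 1 (x ℕ.* p)) (cong (λ z → 1ℤ + z) (ℤ.pos-* x p))) ⟩
        1ℤ + + x * + p - 1ℤ      ≡⟨ cancel (+ x * + p) ⟩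
        + x * + p                ∎)))
      where open ≡-Reasoning
            regroup : ∀ r y → r * y - 1ℤ + 0ℤ ≡ y * r - 1ℤ
            regroup = solve-∀
            cancel : ∀ k → 1ℤ + k - 1ℤ ≡ k
            cancel = solve-∀

  -- By convention 0 ⁻¹ = 0.
  abstract
    _⁻¹ : ℤ → ℤ
    a ⁻¹ with reduce a ℕ.≟ 0
    ... | yes _ = 0ℤ
    ... | no a≢0 = proj₁ (bézout-inverse (coprime-Bézout (prime⇒coprime prime {{ℕ.≢-nonZero a≢0}} (reduce<p a))))

    ⁻¹-inverseʳ : ∀ {a} → a ≉ 0ℤ → a * a ⁻¹ ≋ 1ℤ
    ⁻¹-inverseʳ {a} a≉0 with reduce a ℕ.≟ 0
    ... | yes a≡0 = ⊥-elim (a≉0 (≋-trans (≋-sym (reduce-≋ a)) (≡⇒≋ (cong +_ a≡0))))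
    ... | no a≢0 = ≋-trans (*-congʳ (≋-sym (reduce-≋ a)))
      (proj₂ (bézout-inverse (coprime-Bézout (prime⇒coprime prime {{ℕ.≢-nonZero a≢0}} (reduce<p a)))))

  ⁻¹-inverseˡ : ∀ {a} → a ≉ 0ℤ → a ⁻¹ * a ≋ 1ℤ
  ⁻¹-inverseˡ {a} a≉0 = ≋-trans (≡⇒≋ (ℤ.*-comm (a ⁻¹) a)) (⁻¹-inverseʳ a≉0)

  ⁻¹-≉0 : ∀ {a} → a ≉ 0ℤ → a ⁻¹ ≉ 0ℤ
  ⁻¹-≉0 {a} a≉0 a⁻¹≋0 = 1≉0 (≋-trans (≋-sym (⁻¹-inverseʳ a≉0)) (≋-trans (*-congˡ {a} a⁻¹≋0) (≡⇒≋ (ℤ.*-zeroʳ a))))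

  abstract
    δ : ℤ → ℤ
    δ a with a ≋? 0ℤ
    ... | yes _ = 1ℤ
    ... | no _ = 0ℤ

    δ-≋0 : ∀ {a} → a ≋ 0ℤ → δ a ≡ 1ℤ
    δ-≋0 {a} a≋0 with a ≋? 0ℤ
    ... | yes _ = refl
    ... | no a≉0 = ⊥-elim (a≉0 a≋0)

    δ-≉0 : ∀ {a} → a ≉ 0ℤ → δ a ≡ 0ℤ
    δ-≉0 {a} a≉0 with a ≋? 0ℤ
    ... | yes a≋0 = ⊥-elim (a≉0 a≋0)
    ... | no _ = refl

  δ-cong : ∀ {a b} → a ≋ b → δ a ≡ δ b
  δ-cong {a} {b} a≋b with b ≋? 0ℤ
  ... | yes b≋0 = trans (δ-≋0 (≋-trans a≋b b≋0)) (sym (δ-≋0 b≋0))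
  ... | no b≉0 = trans (δ-≉0 (λ a≋0 → b≉0 (≋-trans (≋-sym a≋b) a≋0))) (sym (δ-≉0 b≉0))

  δ-*-≉0 : ∀ {c a} → c ≉ 0ℤ → δ (c * a) ≡ δ a
  δ-*-≉0 {c} {a} c≉0 with a ≋? 0ℤ
  ... | yes a≋0 = trans (δ-≋0 (≋-trans (*-congˡ {c} a≋0) (≡⇒≋ (ℤ.*-zeroʳ c)))) (sym (δ-≋0 a≋0))
  ... | no a≉0 = trans (δ-≉0 (*-≉0 c≉0 a≉0)) (sym (δ-≉0 a≉0))

module Summation (p : ℕ) .{{_ : NonZero p}} (prime : Prime p) where
  open import Data.Nat as ℕ using (ℕ; zero; suc; NonZero; z≤n; s≤s)
  open import Data.Nat.Primality using (Prime)
  import Data.Nat.Properties as ℕ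
  open import Data.Integer using (ℤ; +_; _+_; _*_; -_; _-_; 0ℤ; 1ℤ)
  import Data.Integer.Properties as ℤ
  open import Data.Integer.Tactic.RingSolver using (solve-∀)
  open import Relation.Binary.Core using (_Preserves_⟶_)
  open import Relation.Binary.PropositionalEquality

  open Modular p prime

  ∑ : ℕ → (ℕ → ℤ) → ℤ
  ∑ zero    f = 0ℤ
  ∑ (suc n) f = ∑ n f + f n

  ∑-cong : ∀ n {f g} → (∀ k → f k ≋ g k) → ∑ n f ≋ ∑ n g
  ∑-cong zero    f≋g = ≋-refl
  ∑-cong (suc n) f≋g = +-cong (∑-cong n f≋g) (f≋g n)

  ∑-cong≡ : ∀ n {f g} → (∀ k → f k ≡ g k) → ∑ n f ≡ ∑ n g
  ∑-cong≡ zero    f≡g = refl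
  ∑-cong≡ (suc n) f≡g = cong₂ _+_ (∑-cong≡ n f≡g) (f≡g n)

  ∑-distrib-+ : ∀ n f g → ∑ n (λ k → f k + g k) ≡ ∑ n f + ∑ n g
  ∑-distrib-+ zero    f g = refl
  ∑-distrib-+ (suc n) f g = trans (cong (_+ (f n + g n)) (∑-distrib-+ n f g)) (swap (∑ n f) (∑ n g) (f n) (g n))
    where swap : ∀ a b c d → (a + b) + (c + d) ≡ (a + c) + (b + d)
          swap = solve-∀

  ∑-*ˡ : ∀ n c f → ∑ n (λ k → c * f k) ≡ c * ∑ n f
  ∑-*ˡ zero    c f = sym (ℤ.*-zeroʳ c)
  ∑-*ˡ (suc n) c f = trans (cong (_+ c * f n) (∑-*ˡ n c f)) (sym (ℤ.*-distribˡ-+ c (∑ n f) (f n)))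

  ∑-*ʳ : ∀ n f c → ∑ n (λ k → f k * c) ≡ ∑ n f * c
  ∑-*ʳ n f c = trans (∑-cong≡ n (λ k → ℤ.*-comm (f k) c)) (trans (∑-*ˡ n c f) (ℤ.*-comm c (∑ n f)))

  ∑-distrib-- : ∀ n f g → ∑ n (λ k → f k - g k) ≡ ∑ n f - ∑ n g
  ∑-distrib-- n f g = trans (∑-distrib-+ n f (λ k → - g k)) (cong (λ e → ∑ n f + e) (neg n))
    where neg : ∀ n → ∑ n (λ k → - g k) ≡ - ∑ n g
          neg zero    = refl
          neg (suc n) = trans (cong (_- g n) (neg n)) (sym (ℤ.neg-distrib-+ (∑ n g) (g n)))

  ∑-zero : ∀ n {f} → (∀ k → f k ≋ 0ℤ) → ∑ n f ≋ 0ℤ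
  ∑-zero zero    f≋0 = ≋-refl
  ∑-zero (suc n) f≋0 = +-cong (∑-zero n f≋0) (f≋0 n)

  ∑-shift : ∀ t (F : ℤ → ℤ) → F Preserves _≋_ ⟶ _≋_ → ∑ p (λ k → F (+ k + t)) ≋ ∑ p (λ k → F (+ k))
  ∑-shift t F F-cong = ≋-trans (∑-cong p (λ k → F-cong (+-congˡ {+ k} (≋-sym (reduce-≋ t)))))
                               (shift-ℕ (reduce t) F F-cong)
    where
    telescope : ∀ n (F : ℤ → ℤ) → ∑ n (λ k → F (+ k + 1ℤ)) + F 0ℤ ≡ ∑ n (λ k → F (+ k)) + F (+ n)
    telescope zero    F = refl
    telescope (suc n) F = begin
      ∑ n (λ k → F (+ k + 1ℤ)) + F (+ n + 1ℤ) + F 0ℤ   ≡⟨ swap (∑ n (λ k → F (+ k + 1ℤ))) (F (+ n + 1ℤ)) (F 0ℤ) ⟩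
      ∑ n (λ k → F (+ k + 1ℤ)) + F 0ℤ + F (+ n + 1ℤ)   ≡⟨ cong₂ _+_ (telescope n F) (cong F (ℤ.+-comm (+ n) 1ℤ)) ⟩
      ∑ n (λ k → F (+ k)) + F (+ n) + F (+ suc n)      ∎
      where open ≡-Reasoning
            swap : ∀ a b c → a + b + c ≡ a + c + b
            swap = solve-∀
    shift-1 : ∀ (F : ℤ → ℤ) → F Preserves _≋_ ⟶ _≋_ → ∑ p (λ k → F (+ k + 1ℤ)) ≋ ∑ p (λ k → F (+ k))
    shift-1 F F-cong = ≋-trans (≡⇒≋ (cancel _ (F 0ℤ)))
      (≋-trans (minus-cong (≋-trans (≡⇒≋ (telescope p F)) (+-congˡ {∑ p (λ k → F (+ k))} (F-cong p≋0))) (≋-refl {F 0ℤ}))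
               (≡⇒≋ (sym (cancel _ (F 0ℤ)))))
      where cancel : ∀ a c → a ≡ a + c - c
            cancel = solve-∀
    shift-ℕ : ∀ n (F : ℤ → ℤ) → F Preserves _≋_ ⟶ _≋_ → ∑ p (λ k → F (+ k + + n)) ≋ ∑ p (λ k → F (+ k))
    shift-ℕ zero    F F-cong = ≡⇒≋ (∑-cong≡ p (λ k → cong F (ℤ.+-identityʳ (+ k))))
    shift-ℕ (suc n) F F-cong = ≋-trans (≡⇒≋ (∑-cong≡ p (λ k → cong F (regroup (+ k) (+ n)))))
      (≋-trans (shift-ℕ n (λ z → F (z + 1ℤ)) (λ e → F-cong (+-congʳ e))) (shift-1 F F-cong))
      where regroup : ∀ k n → k + (1ℤ + n) ≡ k + n + 1ℤ
            regroup = solve-∀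

  private
    ∑-δ₀ : ∀ n → n ℕ.< p → ∀ (h : ℕ → ℤ) → ∑ (suc n) (λ k → h k * δ (+ k)) ≋ h 0
    ∑-δ₀ zero    _    h = ≡⇒≋ (trans (ℤ.+-identityˡ (h 0 * δ 0ℤ)) (trans (cong (h 0 *_) (δ-≋0 ≋-refl)) (ℤ.*-identityʳ (h 0))))
    ∑-δ₀ (suc n) n<p h = ≋-trans (+-congʳ {b = h (suc n) * δ (+ suc n)} (∑-δ₀ n (ℕ.<-trans ℕ.≤-refl n<p) h))
      (≡⇒≋ (trans (cong (λ e → h 0 + h (suc n) * e) (δ-≉0 (nonzero-below-p (s≤s z≤n) n<p)))
                  (trans (cong (λ e → h 0 + e) (ℤ.*-zeroʳ (h (suc n)))) (ℤ.+-identityʳ (h 0)))))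

  ∑-δ : ∀ (g : ℤ → ℤ) → g Preserves _≋_ ⟶ _≋_ → ∀ y → ∑ p (λ k → g (+ k) * δ (+ k - y)) ≋ g y
  ∑-δ g g-cong y = begin
    ∑ p (λ k → g (+ k) * δ (+ k - y))         ≈⟨ ∑-shift y F F-cong ⟨
    ∑ p (λ k → g (+ k + y) * δ (+ k + y - y)) ≡⟨ ∑-cong≡ p (λ k → cong (g (+ k + y) *_) (δ-cong (≡⇒≋ (cancel (+ k) y)))) ⟩
    ∑ p (λ k → g (+ k + y) * δ (+ k))         ≡⟨ cong (λ n → ∑ n (λ k → g (+ k + y) * δ (+ k))) (ℕ.suc-pred p) ⟨
    ∑ (suc (ℕ.pred p)) (λ k → g (+ k + y) * δ (+ k)) ≈⟨ ∑-δ₀ (ℕ.pred p) (subst (ℕ.pred p ℕ.<_) (ℕ.suc-pred p) ℕ.≤-refl) (λ k → g (+ k + y)) ⟩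
    g (0ℤ + y)                                ≡⟨ cong g (ℤ.+-identityˡ y) ⟩
    g y                                       ∎
    where
    open ≋-Reasoning
    F : ℤ → ℤ
    F z = g z * δ (z - y)
    F-cong : F Preserves _≋_ ⟶ _≋_
    F-cong z≋z′ = *-cong (g-cong z≋z′) (≡⇒≋ (δ-cong (minus-cong z≋z′ (≋-refl {y}))))
    cancel : ∀ k y → k + y - y ≡ k
    cancel = solve-∀

module Counting where
  open import Data.Nat as ℕ using (ℕ; zero; suc; _+_; _≤_; _<_; z≤n; s≤s)
  import Data.Nat.Properties as ℕ
  open import Data.Nat.Tactic.RingSolver using (solve-∀)
  open import Data.Bool using (Bool; true; false; _∧_; _∨_; not; if_then_else_)
  import Data.Bool.Properties as Bool
  open import Data.Fin using (Fin)
  import Data.Fin as Fin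
  import Data.Fin.Properties as Fin
  open import Data.Product using (Σ; _×_; _,_; proj₁; proj₂)
  open import Data.Empty using (⊥-elim)
  open import Relation.Nullary using (Dec; yes; no; does)
  open import Relation.Nullary.Decidable using (⌊_⌋)
  open import Relation.Binary.PropositionalEquality
  open import Function using (_∘_)

  does⇒ : ∀ {A : Set} (a? : Dec A) → does a? ≡ true → A
  does⇒ (yes a) _ = a

  𝟙 : Bool → ℕ
  𝟙 b = if b then 1 else 0

  count : (ℕ → Bool) → ℕ → ℕ
  count P zero    = 0
  count P (suc n) = count P n + 𝟙 (P n)

  private
    𝟙-mono : ∀ u v → (u ≡ true → v ≡ true) → 𝟙 u ≤ 𝟙 v
    𝟙-mono false v     _   = z≤n
    𝟙-mono true  true  _   = ℕ.≤-refl
    𝟙-mono true  false u⇒v with u⇒v refl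
    ... | ()


  𝟙≤1 : ∀ u → 𝟙 u ≤ 1
  𝟙≤1 true  = ℕ.≤-refl
  𝟙≤1 false = z≤n

  count-mono : ∀ n {P Q} → (∀ x → x < n → P x ≡ true → Q x ≡ true) → count P n ≤ count Q n
  count-mono zero    P⇒Q = z≤n
  count-mono (suc n) {P} {Q} P⇒Q =
    ℕ.+-mono-≤ (count-mono n (λ x x<n → P⇒Q x (ℕ.m<n⇒m<1+n x<n))) (𝟙-mono (P n) (Q n) (P⇒Q n ℕ.≤-refl))

  count-cong : ∀ n {P Q} → (∀ x → x < n → P x ≡ Q x) → count P n ≡ count Q n
  count-cong n P≡Q = ℕ.≤-antisym (count-mono n (λ x x<n e → trans (sym (P≡Q x x<n)) e))
                                  (count-mono n (λ x x<n e → trans (P≡Q x x<n) e))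

  count-zero : ∀ n P → (∀ x → x < n → P x ≡ false) → count P n ≡ 0
  count-zero zero    P P≡false = refl
  count-zero (suc n) P P≡false rewrite P≡false n ℕ.≤-refl =
    trans (ℕ.+-identityʳ _) (count-zero n P (λ x x<n → P≡false x (ℕ.m<n⇒m<1+n x<n)))

  count-witness : ∀ n P → 1 ≤ count P n → Σ ℕ λ r → r < n × P r ≡ true
  count-witness zero    P ()
  count-witness (suc n) P 1≤count with P n in Pn
  ... | true  = n , ℕ.≤-refl , Pn
  ... | false with count-witness n P (subst (1 ≤_) (ℕ.+-identityʳ (count P n)) 1≤count)
  ...   | r , r<n , Pr = r , ℕ.m<n⇒m<1+n r<n , Pr

  count-complement : ∀ n P → count P n + count (λ x → not (P x)) n ≡ n
  count-complement zero    P = refl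
  count-complement (suc n) P with P n
  ... | true  = trans (cong (_+ (count (λ x → not (P x)) n + 0)) (ℕ.+-comm (count P n) 1))
                      (cong suc (trans (cong (count P n +_) (ℕ.+-identityʳ _)) (count-complement n P)))
  ... | false = trans (cong (_+ (count (λ x → not (P x)) n + 1)) (ℕ.+-identityʳ (count P n)))
                      (trans (sym (ℕ.+-assoc (count P n) _ 1))
                      (trans (ℕ.+-comm _ 1) (cong suc (count-complement n P))))

  count-∨ : ∀ n P Q → count (λ x → P x ∨ Q x) n ≤ count P n + count Q n
  count-∨ zero    P Q = z≤n
  count-∨ (suc n) P Q = ℕ.≤-trans (ℕ.+-mono-≤ (count-∨ n P Q) (𝟙-∨ (P n) (Q n)))
                                  (ℕ.≤-reflexive (interchange (count P n) (count Q n) _ _))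
    where 𝟙-∨ : ∀ u v → 𝟙 (u ∨ v) ≤ 𝟙 u + 𝟙 v
          𝟙-∨ true  v     = s≤s z≤n
          𝟙-∨ false true  = ℕ.≤-refl
          𝟙-∨ false false = z≤n
          interchange : ∀ a b c d → (a + b) + (c + d) ≡ (a + c) + (b + d)
          interchange = solve-∀

  count-≤1 : ∀ n P → (∀ x y → x < n → y < n → P x ≡ true → P y ≡ true → x ≡ y) → count P n ≤ 1
  count-≤1 zero    P unique = z≤n
  count-≤1 (suc n) P unique with P n in Pn
  ... | true  = ℕ.≤-reflexive (cong (_+ 1) (count-zero n P others))
    where others : ∀ x → x < n → P x ≡ false
          others x x<n with P x in Px
          ... | true  = ⊥-elim (ℕ.<-irrefl (unique x n (ℕ.m<n⇒m<1+n x<n) ℕ.≤-refl Px Pn) x<n)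
          ... | false = refl
  ... | false = subst (_≤ 1) (sym (ℕ.+-identityʳ _))
                      (count-≤1 n P (λ x y x<n y<n → unique x y (ℕ.m<n⇒m<1+n x<n) (ℕ.m<n⇒m<1+n y<n)))

  _∖_ : (ℕ → Bool) → ℕ → (ℕ → Bool)
  (P ∖ r) x = P x ∧ not ⌊ x ℕ.≟ r ⌋

  ∖-sound : ∀ P r x → (P ∖ r) x ≡ true → P x ≡ true × x ≢ r
  ∖-sound P r x e with P x | x ℕ.≟ r
  ∖-sound P r x () | false | _
  ∖-sound P r x () | true  | yes _
  ... | true | no x≢r = refl , x≢r

  ∖-complete : ∀ P r x → P x ≡ true → x ≢ r → (P ∖ r) x ≡ true
  ∖-complete P r x Px x≢r with x ℕ.≟ r
  ... | yes x≡r = ⊥-elim (x≢r x≡r)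
  ... | no _    = trans (Bool.∧-identityʳ (P x)) Px

  private
    ∖-away : ∀ P r x → x ≢ r → (P ∖ r) x ≡ P x
    ∖-away P r x x≢r with x ℕ.≟ r
    ... | yes x≡r = ⊥-elim (x≢r x≡r)
    ... | no _    = Bool.∧-identityʳ (P x)

    ∖-at : ∀ P r → (P ∖ r) r ≡ false
    ∖-at P r with r ℕ.≟ r
    ... | yes _   = Bool.∧-zeroʳ (P r)
    ... | no r≢r  = ⊥-elim (r≢r refl)

  count-∖ : ∀ n P r → r < n → count P n ≡ count (P ∖ r) n + 𝟙 (P r)
  count-∖ zero    P r ()
  count-∖ (suc n) P r r<1+n with r ℕ.≟ n
  ... | yes refl = cong (_+ 𝟙 (P r)) (begin
    count P r                      ≡⟨ count-cong r (λ x x<r → sym (∖-away P r x (ℕ.<⇒≢ x<r))) ⟩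
    count (P ∖ r) r                ≡⟨ ℕ.+-identityʳ _ ⟨
    count (P ∖ r) r + 0            ≡⟨ cong (λ b → count (P ∖ r) r + 𝟙 b) (∖-at P r) ⟨
    count (P ∖ r) r + 𝟙 ((P ∖ r) r) ∎)
    where open ≡-Reasoning
  ... | no r≢n = begin
    count P n + 𝟙 (P n)                     ≡⟨ cong (_+ 𝟙 (P n)) (count-∖ n P r (ℕ.≤∧≢⇒< (ℕ.≤-pred r<1+n) r≢n)) ⟩
    count (P ∖ r) n + 𝟙 (P r) + 𝟙 (P n)     ≡⟨ swap (count (P ∖ r) n) (𝟙 (P r)) (𝟙 (P n)) ⟩
    count (P ∖ r) n + 𝟙 (P n) + 𝟙 (P r)     ≡⟨ cong (λ b → count (P ∖ r) n + 𝟙 b + 𝟙 (P r)) (∖-away P r n (r≢n ∘ sym)) ⟨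
    count (P ∖ r) n + 𝟙 ((P ∖ r) n) + 𝟙 (P r) ∎
    where open ≡-Reasoning
          swap : ∀ a b c → a + b + c ≡ a + c + b
          swap = solve-∀

  count-≤-∖ : ∀ n P r → count P n ≤ count (P ∖ r) n + 1
  count-≤-∖ n P r with r ℕ.<? n
  ... | yes r<n = subst (_≤ count (P ∖ r) n + 1) (sym (count-∖ n P r r<n))
                        (ℕ.+-monoʳ-≤ (count (P ∖ r) n) (𝟙≤1 (P r)))
  ... | no r≮n  = ℕ.≤-trans (ℕ.≤-reflexive (count-cong n (λ x x<n → sym (∖-away P r x λ { refl → r≮n x<n }))))
                            (ℕ.m≤m+n _ 1)

  count-∖-lower : ∀ n P Q r {d} → suc d ≤ count P n → (∀ x → x < n → (P ∖ r) x ≡ true → Q x ≡ true) → d ≤ count Q n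
  count-∖-lower n P Q r {d} 1+d≤P P∖r⇒Q = ℕ.+-cancelʳ-≤ 1 d _ (begin
    d + 1                 ≡⟨ ℕ.+-comm d 1 ⟩
    suc d                 ≤⟨ 1+d≤P ⟩
    count P n             ≤⟨ count-≤-∖ n P r ⟩
    count (P ∖ r) n + 1   ≤⟨ ℕ.+-monoˡ-≤ 1 (count-mono n P∖r⇒Q) ⟩
    count Q n + 1         ∎)
    where open ℕ.≤-Reasoning

  count-< : ∀ n P Q r → r < n → P r ≡ true → (∀ x → x < n → Q x ≡ true → P x ≡ true × x ≢ r) → count Q n < count P n
  count-< n P Q r r<n Pr Q⊆P∖r = begin-strict
    count Q n               ≤⟨ count-mono n (λ x x<n Qx → ∖-complete P r x (proj₁ (Q⊆P∖r x x<n Qx)) (proj₂ (Q⊆P∖r x x<n Qx))) ⟩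
    count (P ∖ r) n         <⟨ ℕ.m<m+n _ ℕ.0<1+n ⟩
    count (P ∖ r) n + 1     ≡⟨ cong (λ b → count (P ∖ r) n + 𝟙 b) Pr ⟨
    count (P ∖ r) n + 𝟙 (P r) ≡⟨ count-∖ n P r r<n ⟨
    count P n               ∎
    where open ℕ.≤-Reasoning

  count-injective : ∀ m n P (f : Fin m → ℕ) → (∀ i j → f i ≡ f j → i ≡ j) → (∀ i → f i < n) →
                    (∀ i → P (f i) ≡ true) → m ≤ count P n
  count-injective zero    n P f f-inj f<n Pf = z≤n
  count-injective (suc m) n P f f-inj f<n Pf = begin
    suc m                                      ≡⟨ ℕ.+-comm 1 m ⟩
    m + 1                                      ≤⟨ ℕ.+-monoˡ-≤ 1 (count-injective m n (P ∖ r) (f ∘ Fin.suc)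
                                                    (λ i j e → Fin.suc-injective (f-inj _ _ e)) (f<n ∘ Fin.suc) Pf-rest) ⟩
    count (P ∖ r) n + 1                        ≡⟨ cong (λ b → count (P ∖ r) n + 𝟙 b) (Pf Fin.zero) ⟨
    count (P ∖ r) n + 𝟙 (P r)                  ≡⟨ count-∖ n P r (f<n Fin.zero) ⟨
    count P n                                  ∎
    where
    open ℕ.≤-Reasoning
    r = f Fin.zero
    Pf-rest : ∀ i → (P ∖ r) (f (Fin.suc i)) ≡ true
    Pf-rest i = ∖-complete P r _ (Pf (Fin.suc i)) (λ e → Fin.0≢1+n (sym (f-inj _ _ e)))

  anyᶠ : (k : ℕ) → (Fin k → Bool) → Bool
  anyᶠ zero    g = false
  anyᶠ (suc k) g = g Fin.zero ∨ anyᶠ k (g ∘ Fin.suc)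

  anyᶠ-intro : ∀ k g t → g t ≡ true → anyᶠ k g ≡ true
  anyᶠ-intro (suc k) g Fin.zero    gt rewrite gt = refl
  anyᶠ-intro (suc k) g (Fin.suc t) gt with g Fin.zero
  ... | true  = refl
  ... | false = anyᶠ-intro k (g ∘ Fin.suc) t gt

  anyᶠ-elim : ∀ k g → anyᶠ k g ≡ true → Σ (Fin k) λ t → g t ≡ true
  anyᶠ-elim zero    g ()
  anyᶠ-elim (suc k) g any with g Fin.zero in g0
  ... | true  = Fin.zero , g0
  ... | false with anyᶠ-elim k (g ∘ Fin.suc) any
  ...   | t , gt = Fin.suc t , gt

  sumᶠ : (k : ℕ) → (Fin k → ℕ) → ℕ
  sumᶠ zero    g = 0
  sumᶠ (suc k) g = g Fin.zero + sumᶠ k (g ∘ Fin.suc)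

  sumᶠ-mono : ∀ k {g h} → (∀ t → g t ≤ h t) → sumᶠ k g ≤ sumᶠ k h
  sumᶠ-mono zero    g≤h = z≤n
  sumᶠ-mono (suc k) g≤h = ℕ.+-mono-≤ (g≤h Fin.zero) (sumᶠ-mono k (g≤h ∘ Fin.suc))

  sumᶠ-≤ : ∀ k g → (∀ t → g t ≤ 1) → sumᶠ k g ≤ k
  sumᶠ-≤ zero    g g≤1 = z≤n
  sumᶠ-≤ (suc k) g g≤1 = ℕ.+-mono-≤ (g≤1 Fin.zero) (sumᶠ-≤ k _ (g≤1 ∘ Fin.suc))

  sumᶠ-< : ∀ k g → (∀ t → g t ≤ 1) → ∀ t₀ → g t₀ ≡ 0 → sumᶠ k g < k
  sumᶠ-< (suc k) g g≤1 Fin.zero      g0≡0 rewrite g0≡0 = s≤s (sumᶠ-≤ k _ (g≤1 ∘ Fin.suc))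
  sumᶠ-< (suc k) g g≤1 (Fin.suc t₀) gt≡0 = subst (_≤ suc k) (ℕ.+-suc (g Fin.zero) (sumᶠ k (g ∘ Fin.suc)))
    (ℕ.+-mono-≤ (g≤1 Fin.zero) (sumᶠ-< k _ (g≤1 ∘ Fin.suc) t₀ gt≡0))

  count-anyᶠ : ∀ n k (Q : Fin k → ℕ → Bool) →
               count (λ x → anyᶠ k (λ t → Q t x)) n ≤ sumᶠ k (λ t → count (Q t) n)
  count-anyᶠ n zero    Q = ℕ.≤-reflexive (count-zero n (λ _ → false) (λ _ _ → refl))
  count-anyᶠ n (suc k) Q = ℕ.≤-trans (count-∨ n (Q Fin.zero) (λ x → anyᶠ k (λ t → Q (Fin.suc t) x)))
                                     (ℕ.+-monoʳ-≤ (count (Q Fin.zero) n) (count-anyᶠ n k (Q ∘ Fin.suc)))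

module Polynomial (p : ℕ) .{{_ : NonZero p}} (prime : Prime p) where
  open import Data.Nat as ℕ using (ℕ; zero; suc; NonZero; _≤_; _<_; z≤n; s≤s)
  open import Data.Nat.Primality using (Prime)
  import Data.Nat.Properties as ℕ
  open import Data.Integer using (ℤ; +_; _+_; _*_; -_; _-_; 0ℤ; 1ℤ; _^_)
  import Data.Integer.Properties as ℤ
  open import Data.Integer.Tactic.RingSolver using (solve-∀)
  open import Data.Vec using (Vec; []; _∷_)
  open import Data.Bool using (Bool; true)
  open import Data.Product using (Σ; _,_)
  open import Data.Sum using (_⊎_; inj₁; inj₂)
  open import Data.Empty using (⊥-elim)
  open import Relation.Nullary using (yes; no)
  open import Relation.Nullary.Decidable using (⌊_⌋)
  open import Relation.Binary.Core using (_Preserves_⟶_)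
  open import Relation.Binary.PropositionalEquality
  open Counting

  open Modular p prime
  open Summation p prime

  -- A vector c₀ ∷ c₁ ∷ ⋯ of length d is the polynomial c₀ + c₁ x + ⋯ of degree < d.
  eval : ∀ {d} → Vec ℤ d → ℤ → ℤ
  eval []       x = 0ℤ
  eval (c ∷ cs) x = c + x * eval cs x

  infixl 6 _+ₚ_
  infixl 7 _*ₚ_

  _+ₚ_ : ∀ {d} → Vec ℤ d → Vec ℤ d → Vec ℤ d
  []       +ₚ []       = []
  (a ∷ as) +ₚ (b ∷ bs) = (a + b) ∷ (as +ₚ bs)

  _*ₚ_ : ∀ {d} → ℤ → Vec ℤ d → Vec ℤ d
  c *ₚ []       = []
  c *ₚ (a ∷ as) = (c * a) ∷ (c *ₚ as)

  0ₚ : ∀ d → Vec ℤ d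
  0ₚ zero    = []
  0ₚ (suc d) = 0ℤ ∷ 0ₚ d

  raise : ∀ {d} → Vec ℤ d → Vec ℤ (suc d)
  raise []       = 0ℤ ∷ []
  raise (a ∷ as) = a ∷ raise as

  -- The coefficient of x ^ d, which may be 0.
  top : ∀ {d} → Vec ℤ (suc d) → ℤ
  top (a ∷ [])     = a
  top (a ∷ b ∷ as) = top (b ∷ as)

  drop-top : ∀ {d} → Vec ℤ (suc d) → Vec ℤ d
  drop-top (a ∷ [])     = []
  drop-top (a ∷ b ∷ as) = a ∷ drop-top (b ∷ as)

  eval-+ₚ : ∀ {d} (f g : Vec ℤ d) x → eval (f +ₚ g) x ≡ eval f x + eval g x
  eval-+ₚ []       []       x = refl
  eval-+ₚ (a ∷ as) (b ∷ bs) x = trans (cong (λ e → a + b + x * e) (eval-+ₚ as bs x)) (distrib a b x (eval as x) (eval bs x))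
    where distrib : ∀ a b x u v → a + b + x * (u + v) ≡ a + x * u + (b + x * v)
          distrib = solve-∀

  eval-*ₚ : ∀ {d} c (f : Vec ℤ d) x → eval (c *ₚ f) x ≡ c * eval f x
  eval-*ₚ c []       x = sym (ℤ.*-zeroʳ c)
  eval-*ₚ c (a ∷ as) x = trans (cong (λ e → c * a + x * e) (eval-*ₚ c as x)) (distrib c a x (eval as x))
    where distrib : ∀ c a x u → c * a + x * (c * u) ≡ c * (a + x * u)
          distrib = solve-∀

  eval-0ₚ : ∀ d x → eval (0ₚ d) x ≋ 0ℤ
  eval-0ₚ zero    x = ≋-refl
  eval-0ₚ (suc d) x = ≋-trans (+-congˡ {0ℤ} (≋-trans (*-congˡ {x} (eval-0ₚ d x)) (≡⇒≋ (ℤ.*-zeroʳ x)))) ≋-refl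

  eval-raise : ∀ {d} (f : Vec ℤ d) x → eval (raise f) x ≡ eval f x
  eval-raise []       x = trans (ℤ.+-identityˡ _) (ℤ.*-zeroʳ x)
  eval-raise (a ∷ as) x = cong (λ e → a + x * e) (eval-raise as x)

  top-+ₚ : ∀ {d} (f g : Vec ℤ (suc d)) → top (f +ₚ g) ≡ top f + top g
  top-+ₚ (a ∷ [])     (b ∷ [])     = refl
  top-+ₚ (a ∷ a′ ∷ as) (b ∷ b′ ∷ bs) = top-+ₚ (a′ ∷ as) (b′ ∷ bs)

  top-*ₚ : ∀ {d} c (f : Vec ℤ (suc d)) → top (c *ₚ f) ≡ c * top f
  top-*ₚ c (a ∷ [])     = refl
  top-*ₚ c (a ∷ a′ ∷ as) = top-*ₚ c (a′ ∷ as)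

  top-0ₚ : ∀ d → top (0ₚ (suc d)) ≡ 0ℤ
  top-0ₚ zero    = refl
  top-0ₚ (suc d) = top-0ₚ d

  top-raise : ∀ {d} (f : Vec ℤ d) → top (raise f) ≡ 0ℤ
  top-raise []            = refl
  top-raise (a ∷ [])      = refl
  top-raise (a ∷ a′ ∷ as) = top-raise (a′ ∷ as)

  eval-drop-top : ∀ {d} (f : Vec ℤ (suc d)) x → top f ≋ 0ℤ → eval f x ≋ eval (drop-top f) x
  eval-drop-top (a ∷ [])      x a≋0 = ≋-trans (+-cong a≋0 (≡⇒≋ (ℤ.*-zeroʳ x))) ≋-refl
  eval-drop-top (a ∷ a′ ∷ as) x top≋0 = +-congˡ {a} (*-congˡ {x} (eval-drop-top (a′ ∷ as) x top≋0))

  linear* : ∀ {d} → ℤ → ℤ → Vec ℤ (suc d) → Vec ℤ (suc (suc d))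
  linear* c₀ c₁ g = c₀ *ₚ raise g +ₚ c₁ *ₚ (0ℤ ∷ g)

  eval-linear* : ∀ {d} c₀ c₁ (g : Vec ℤ (suc d)) x → eval (linear* c₀ c₁ g) x ≡ (c₀ + c₁ * x) * eval g x
  eval-linear* c₀ c₁ g x = begin
    eval (linear* c₀ c₁ g) x                             ≡⟨ eval-+ₚ (c₀ *ₚ raise g) (c₁ *ₚ (0ℤ ∷ g)) x ⟩
    eval (c₀ *ₚ raise g) x + eval (c₁ *ₚ (0ℤ ∷ g)) x     ≡⟨ cong₂ _+_ (eval-*ₚ c₀ (raise g) x) (eval-*ₚ c₁ (0ℤ ∷ g) x) ⟩
    c₀ * eval (raise g) x + c₁ * (0ℤ + x * eval g x)     ≡⟨ cong (λ e → c₀ * e + c₁ * (0ℤ + x * eval g x)) (eval-raise g x) ⟩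
    c₀ * eval g x + c₁ * (0ℤ + x * eval g x)             ≡⟨ factor c₀ c₁ x (eval g x) ⟩
    (c₀ + c₁ * x) * eval g x                             ∎
    where open ≡-Reasoning
          factor : ∀ c₀ c₁ x u → c₀ * u + c₁ * (0ℤ + x * u) ≡ (c₀ + c₁ * x) * u
          factor = solve-∀

  top-linear* : ∀ {d} c₀ c₁ (g : Vec ℤ (suc d)) → top (linear* c₀ c₁ g) ≡ c₁ * top g
  top-linear* c₀ c₁ g = begin
    top (linear* c₀ c₁ g)                           ≡⟨ top-+ₚ (c₀ *ₚ raise g) (c₁ *ₚ (0ℤ ∷ g)) ⟩
    top (c₀ *ₚ raise g) + top (c₁ *ₚ (0ℤ ∷ g))     ≡⟨ cong₂ _+_ (top-*ₚ c₀ (raise g)) (top-*ₚ c₁ (0ℤ ∷ g)) ⟩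
    c₀ * top (raise g) + c₁ * top (0ℤ ∷ g)         ≡⟨ cong (λ e → c₀ * e + c₁ * top (0ℤ ∷ g)) (top-raise g) ⟩
    c₀ * 0ℤ + c₁ * top (0ℤ ∷ g)                    ≡⟨ vanish c₀ (c₁ * top (0ℤ ∷ g)) ⟩
    c₁ * top (0ℤ ∷ g)                              ≡⟨ cong (c₁ *_) (top-cons g) ⟩
    c₁ * top g                                     ∎
    where open ≡-Reasoning
          vanish : ∀ a b → a * 0ℤ + b ≡ b
          vanish = solve-∀
          top-cons : ∀ {d} (g : Vec ℤ (suc d)) → top (0ℤ ∷ g) ≡ top g
          top-cons (a ∷ as) = refl

  falling : ℕ → ℤ → ℤ
  falling zero    z = 1ℤ
  falling (suc j) z = falling j z * (z - + j)

  falling-cong : ∀ j → falling j Preserves _≋_ ⟶ _≋_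
  falling-cong zero    z≋z′ = ≋-refl
  falling-cong (suc j) z≋z′ = *-cong (falling-cong j z≋z′) (minus-cong z≋z′ ≋-refl)

  falling-poly : ℤ → ℤ → (j : ℕ) → Vec ℤ (suc j)
  falling-poly c₀ c₁ zero    = 1ℤ ∷ []
  falling-poly c₀ c₁ (suc j) = linear* (c₀ - + j) c₁ (falling-poly c₀ c₁ j)

  eval-falling-poly : ∀ c₀ c₁ j x → eval (falling-poly c₀ c₁ j) x ≡ falling j (c₀ + c₁ * x)
  eval-falling-poly c₀ c₁ zero    x = cong (λ e → 1ℤ + e) (ℤ.*-zeroʳ x)
  eval-falling-poly c₀ c₁ (suc j) x = trans (eval-linear* (c₀ - + j) c₁ (falling-poly c₀ c₁ j) x)
    (trans (cong ((c₀ - + j + c₁ * x) *_) (eval-falling-poly c₀ c₁ j x)) (regroup c₀ c₁ (+ j) x (falling j (c₀ + c₁ * x))))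
    where regroup : ∀ c₀ c₁ j x u → (c₀ - j + c₁ * x) * u ≡ u * (c₀ + c₁ * x - j)
          regroup = solve-∀

  top-falling-poly : ∀ c₀ c₁ j → top (falling-poly c₀ c₁ j) ≡ c₁ ^ j
  top-falling-poly c₀ c₁ zero    = refl
  top-falling-poly c₀ c₁ (suc j) = trans (top-linear* (c₀ - + j) c₁ (falling-poly c₀ c₁ j)) (cong (c₁ *_) (top-falling-poly c₀ c₁ j))

  falling-difference : ∀ j z → falling (suc j) (z + 1ℤ) - falling (suc j) z ≡ + suc j * falling j z
  falling-difference j z = trans (cong (_- falling (suc j) z) (step j z))
    (trans (collect z (falling j z) (+ j)) (cong (_* falling j z) (sym (ℤ.pos-+ 1 j))))
    where
    collect : ∀ z u j → (z + 1ℤ) * u - u * (z - j) ≡ (1ℤ + j) * u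
    collect = solve-∀
    step : ∀ j z → falling (suc j) (z + 1ℤ) ≡ (z + 1ℤ) * falling j z
    step zero    z = base z
      where base : ∀ z → 1ℤ * (z + 1ℤ - 0ℤ) ≡ (z + 1ℤ) * 1ℤ
            base = solve-∀
    step (suc j) z = begin
      falling (suc j) (z + 1ℤ) * (z + 1ℤ - + suc j)    ≡⟨ cong₂ _*_ (step j z) (cong (λ w → z + 1ℤ - w) (ℤ.pos-+ 1 j)) ⟩
      (z + 1ℤ) * falling j z * (z + 1ℤ - (1ℤ + + j))   ≡⟨ regroup z (falling j z) (+ j) ⟩
      (z + 1ℤ) * (falling j z * (z - + j))             ∎
      where open ≡-Reasoning
            regroup : ∀ z u j → (z + 1ℤ) * u * (z + 1ℤ - (1ℤ + j)) ≡ (z + 1ℤ) * (u * (z - j))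
            regroup = solve-∀

  -- The differences of falling (j + 1) telescope over a period.
  ∑-falling≋0 : ∀ j → suc j < p → ∑ p (λ k → falling j (+ k)) ≋ 0ℤ
  ∑-falling≋0 j 1+j<p = *-cancelˡ-≋ {+ suc j} (nonzero-below-p (s≤s z≤n) 1+j<p) (begin
    + suc j * ∑ p (λ k → falling j (+ k))                        ≡⟨ ∑-*ˡ p (+ suc j) (λ k → falling j (+ k)) ⟨
    ∑ p (λ k → + suc j * falling j (+ k))                        ≡⟨ ∑-cong≡ p (λ k → falling-difference j (+ k)) ⟨
    ∑ p (λ k → F (+ k + 1ℤ) - F (+ k))                           ≡⟨ ∑-distrib-- p (λ k → F (+ k + 1ℤ)) (λ k → F (+ k)) ⟩
    ∑ p (λ k → F (+ k + 1ℤ)) - ∑ p (λ k → F (+ k))               ≈⟨ minus-cong (∑-shift 1ℤ F (falling-cong (suc j))) (≋-refl {∑ p (λ k → F (+ k))}) ⟩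
    ∑ p (λ k → F (+ k)) - ∑ p (λ k → F (+ k))                    ≡⟨ ℤ.+-inverseʳ (∑ p (λ k → F (+ k))) ⟩
    0ℤ                                                          ≡⟨ ℤ.*-zeroʳ (+ suc j) ⟨
    + suc j * 0ℤ                                                ∎)
    where open ≋-Reasoning
          F = falling (suc j)

  ∑-poly≋0 : ∀ d → d < p → (f : Vec ℤ d) → ∑ p (λ k → eval f (+ k)) ≋ 0ℤ
  ∑-poly≋0 zero    d<p []   = ∑-zero p (λ k → ≋-refl)
  ∑-poly≋0 (suc d) d<p f = begin
    ∑ p (λ k → eval f (+ k))                                       ≡⟨ ∑-cong≡ p (λ k → split (+ k)) ⟩
    ∑ p (λ k → eval f′ (+ k) + c * eval F (+ k))                   ≡⟨ ∑-distrib-+ p (λ k → eval f′ (+ k)) (λ k → c * eval F (+ k)) ⟩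
    ∑ p (λ k → eval f′ (+ k)) + ∑ p (λ k → c * eval F (+ k))       ≈⟨ +-cong (∑-cong p (λ k → eval-drop-top f′ (+ k) top-f′≋0)) (≡⇒≋ (∑-*ˡ p c (λ k → eval F (+ k)))) ⟩
    ∑ p (λ k → eval (drop-top f′) (+ k)) + c * ∑ p (λ k → eval F (+ k))
          ≈⟨ +-cong (∑-poly≋0 d (ℕ.<-trans ℕ.≤-refl d<p) (drop-top f′)) (*-congˡ {c} (≋-trans (∑-cong p (λ k → ≡⇒≋ (eval-F (+ k)))) (∑-falling≋0 d d<p))) ⟩
    0ℤ + c * 0ℤ                                                     ≡⟨ vanish c ⟩
    0ℤ                                                              ∎
    where
    open ≋-Reasoning
    c = top f
    F = falling-poly 0ℤ 1ℤ d
    f′ = f +ₚ (- c) *ₚ F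
    eval-F : ∀ x → eval F x ≡ falling d x
    eval-F x = trans (eval-falling-poly 0ℤ 1ℤ d x) (cong (falling d) (trans (ℤ.+-identityˡ _) (ℤ.*-identityˡ x)))
    split : ∀ x → eval f x ≡ eval f′ x + c * eval F x
    split x = trans (shuffle (eval f x) c (eval F x))
      (cong (_+ c * eval F x) (sym (trans (eval-+ₚ f ((- c) *ₚ F) x) (cong (λ e → eval f x + e) (eval-*ₚ (- c) F x)))))
      where shuffle : ∀ a c b → a ≡ a + - c * b + c * b
            shuffle = solve-∀
    top-f′≋0 : top f′ ≋ 0ℤ
    top-f′≋0 = ≡⇒≋ (trans (top-+ₚ f ((- c) *ₚ F))
      (trans (cong (λ e → c + e) (trans (top-*ₚ (- c) F) (cong (- c *_) (trans (top-falling-poly 0ℤ 1ℤ d) (ℤ.^-zeroˡ d))))) (cancel c)))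
      where cancel : ∀ c → c + - c * 1ℤ ≡ 0ℤ
            cancel = solve-∀
    vanish : ∀ c → 0ℤ + c * 0ℤ ≡ 0ℤ
    vanish = solve-∀

  ∑-power≋0 : ∀ j → suc j < p → ∑ p (λ k → (+ k) ^ j) ≋ 0ℤ
  ∑-power≋0 j 1+j<p = ≋-trans (∑-cong p (λ k → ≡⇒≋ (sym (eval-monomial j (+ k))))) (∑-poly≋0 (suc j) 1+j<p (monomial j))
    where
    monomial : (j : ℕ) → Vec ℤ (suc j)
    monomial zero    = 1ℤ ∷ []
    monomial (suc j) = 0ℤ ∷ monomial j
    eval-monomial : ∀ j x → eval (monomial j) x ≡ x ^ j
    eval-monomial zero    x = cong (λ e → 1ℤ + e) (ℤ.*-zeroʳ x)
    eval-monomial (suc j) x = trans (ℤ.+-identityˡ _) (cong (x *_) (eval-monomial j x))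

  factor : ∀ {d} (f : Vec ℤ (suc d)) r → Σ (Vec ℤ d) λ g → ∀ x → eval f x ≡ (x - r) * eval g x + eval f r
  factor (c ∷ [])      r = [] , λ x → constant c x r
    where constant : ∀ c x r → c + x * 0ℤ ≡ (x - r) * 0ℤ + (c + r * 0ℤ)
          constant = solve-∀
  factor (c ∷ c′ ∷ cs) r with factor (c′ ∷ cs) r
  ... | g , f≡ = (c′ ∷ cs) +ₚ r *ₚ raise g , λ x → begin
    c + x * eval (c′ ∷ cs) x                                          ≡⟨ cong (λ e → c + x * e) (f≡ x) ⟩
    c + x * ((x - r) * eval g x + eval (c′ ∷ cs) r)                   ≡⟨ horner c x r (eval g x) (eval (c′ ∷ cs) r) ⟩
    (x - r) * ((x - r) * eval g x + eval (c′ ∷ cs) r + r * eval g x) + (c + r * eval (c′ ∷ cs) r)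
        ≡⟨ cong (λ e → (x - r) * (e + r * eval g x) + (c + r * eval (c′ ∷ cs) r)) (f≡ x) ⟨
    (x - r) * (eval (c′ ∷ cs) x + r * eval g x) + (c + r * eval (c′ ∷ cs) r)
        ≡⟨ cong (λ e → (x - r) * e + (c + r * eval (c′ ∷ cs) r)) (quotient x) ⟨
    (x - r) * eval ((c′ ∷ cs) +ₚ r *ₚ raise g) x + (c + r * eval (c′ ∷ cs) r) ∎
    where
    open ≡-Reasoning
    horner : ∀ c x r G F → c + x * ((x - r) * G + F) ≡ (x - r) * ((x - r) * G + F + r * G) + (c + r * F)
    horner = solve-∀
    quotient : ∀ x → eval ((c′ ∷ cs) +ₚ r *ₚ raise g) x ≡ eval (c′ ∷ cs) x + r * eval g x
    quotient x = trans (eval-+ₚ (c′ ∷ cs) (r *ₚ raise g) x)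
                     (cong (λ e → eval (c′ ∷ cs) x + e) (trans (eval-*ₚ r (raise g) x) (cong (r *_) (eval-raise g x))))

  is-root : ∀ {d} → Vec ℤ d → ℕ → Bool
  is-root f x = ⌊ eval f (+ x) ≋? 0ℤ ⌋

  is-root-intro : ∀ {d} (f : Vec ℤ d) x → eval f (+ x) ≋ 0ℤ → is-root f x ≡ true
  is-root-intro f x fx≋0 with eval f (+ x) ≋? 0ℤ
  ... | yes _    = refl
  ... | no fx≉0 = ⊥-elim (fx≉0 fx≋0)

  is-root-elim : ∀ {d} (f : Vec ℤ d) x → is-root f x ≡ true → eval f (+ x) ≋ 0ℤ
  is-root-elim f x root with eval f (+ x) ≋? 0ℤ
  ... | yes fx≋0 = fx≋0

  root-bound : ∀ d (f : Vec ℤ d) → d ≤ count (is-root f) p → ∀ a → eval f a ≋ 0ℤ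
  root-bound zero    []  _      a = ≋-refl
  root-bound (suc d) f  d≤roots a with count-witness p (is-root f) (ℕ.≤-trans (s≤s z≤n) d≤roots)
  ... | r , r<p , r-root with factor f (+ r)
  ...   | g , f≡ = begin
    eval f a                              ≡⟨ f≡ a ⟩
    (a - + r) * eval g a + eval f (+ r)   ≈⟨ +-cong (*-congˡ {a - + r} (root-bound d g g-roots a)) (is-root-elim f r r-root) ⟩
    (a - + r) * 0ℤ + 0ℤ                   ≡⟨ vanish (a - + r) ⟩
    0ℤ                                    ∎
    where
    open ≋-Reasoning
    vanish : ∀ u → u * 0ℤ + 0ℤ ≡ 0ℤ
    vanish = solve-∀
    other-roots : ∀ x → x < p → (is-root f ∖ r) x ≡ true → is-root g x ≡ true
    other-roots x x<p x-root with ∖-sound (is-root f) r x x-root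
    ... | fx-root , x≢r = is-root-intro g x (pick (*≋0⇒≋0⊎≋0 product≋0))
      where
      product≋0 : (+ x - + r) * eval g (+ x) ≋ 0ℤ
      product≋0 = ≋-trans (≡⇒≋ (sym (ℤ.+-identityʳ _))) (≋-trans (+-congˡ {(+ x - + r) * eval g (+ x)} (≋-sym (is-root-elim f r r-root)))
                  (≋-trans (≡⇒≋ (sym (f≡ (+ x)))) (is-root-elim f x fx-root)))
      pick : + x - + r ≋ 0ℤ ⊎ eval g (+ x) ≋ 0ℤ → eval g (+ x) ≋ 0ℤ
      pick (inj₁ x-r≋0) = ⊥-elim (x≢r (≋⇒≡-below-p x<p r<p (minus≋0⇒≋ x-r≋0)))
      pick (inj₂ gx≋0)  = gx≋0
    g-roots : d ≤ count (is-root g) p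
    g-roots = count-∖-lower p (is-root f) (is-root g) r d≤roots other-roots

module Projective (p : ℕ) .{{_ : NonZero p}} (prime : Prime p) where
  open import Data.Nat as ℕ using (ℕ; NonZero)
  open import Data.Nat.Primality using (Prime)
  import Data.Nat.Properties as ℕ
  import Data.Nat.DivMod as ℕ
  open import Data.Integer using (ℤ; +_; _+_; _*_; -_; _-_; 0ℤ; 1ℤ)
  import Data.Integer.Properties as ℤ
  open import Data.Integer.Tactic.RingSolver using (solve-∀)
  open import Data.Fin using (Fin; toℕ; fromℕ<)
  import Data.Fin.Properties as Fin
  open import Data.Product using (Σ; _,_; proj₁; proj₂)
  open import Data.Sum using (inj₁; inj₂)
  open import Data.Empty using (⊥-elim)
  open import Relation.Nullary using (¬_; yes; no)
  open import Relation.Binary.PropositionalEquality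
  open import Relation.Binary.Bundles using (Setoid)
  import Level
  import Relation.Binary.Reasoning.Setoid as SetoidReasoning
  open Vector

  open Modular p prime
  open PG p

  infix 4 _≈ᵛ_
  record _≈ᵛ_ (a b : Vec3) : Set where
    constructor mk≈ᵛ
    field ≈x : Vec3.vx a ≋ Vec3.vx b
          ≈y : Vec3.vy a ≋ Vec3.vy b
          ≈z : Vec3.vz a ≋ Vec3.vz b

  0ᵛ : Vec3
  0ᵛ = vec 0ℤ 0ℤ 0ℤ

  ≈ᵛ-refl : ∀ {a} → a ≈ᵛ a
  ≈ᵛ-refl = mk≈ᵛ ≋-refl ≋-refl ≋-refl

  ≈ᵛ-sym : ∀ {a b} → a ≈ᵛ b → b ≈ᵛ a
  ≈ᵛ-sym (mk≈ᵛ x y z) = mk≈ᵛ (≋-sym x) (≋-sym y) (≋-sym z)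

  ≈ᵛ-trans : ∀ {a b c} → a ≈ᵛ b → b ≈ᵛ c → a ≈ᵛ c
  ≈ᵛ-trans (mk≈ᵛ x y z) (mk≈ᵛ x′ y′ z′) = mk≈ᵛ (≋-trans x x′) (≋-trans y y′) (≋-trans z z′)

  ≡⇒≈ᵛ : ∀ {a b} → a ≡ b → a ≈ᵛ b
  ≡⇒≈ᵛ refl = ≈ᵛ-refl

  ≈ᵛ-setoid : Setoid Level.zero Level.zero
  ≈ᵛ-setoid = record { Carrier = Vec3 ; _≈_ = _≈ᵛ_ ; isEquivalence = record { refl = ≈ᵛ-refl ; sym = ≈ᵛ-sym ; trans = ≈ᵛ-trans } }

  module ≈ᵛ-Reasoning = SetoidReasoning ≈ᵛ-setoid

  ∙-cong : ∀ {a a′ b b′} → a ≈ᵛ a′ → b ≈ᵛ b′ → a ∙ b ≋ a′ ∙ b′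
  ∙-cong (mk≈ᵛ x y z) (mk≈ᵛ x′ y′ z′) = +-cong (+-cong (*-cong x x′) (*-cong y y′)) (*-cong z z′)

  ∙-congˡ : ∀ {a b b′} → b ≈ᵛ b′ → a ∙ b ≋ a ∙ b′
  ∙-congˡ {a} = ∙-cong (≈ᵛ-refl {a})

  *ᵛ-cong : ∀ {k k′ a a′} → k ≋ k′ → a ≈ᵛ a′ → k *ᵛ a ≈ᵛ k′ *ᵛ a′
  *ᵛ-cong k≋k′ (mk≈ᵛ x y z) = mk≈ᵛ (*-cong k≋k′ x) (*-cong k≋k′ y) (*-cong k≋k′ z)

  *ᵛ-congʳ : ∀ k {a a′} → a ≈ᵛ a′ → k *ᵛ a ≈ᵛ k *ᵛ a′
  *ᵛ-congʳ k = *ᵛ-cong (≋-refl {k})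

  -ᵛ-cong : ∀ {a a′ b b′} → a ≈ᵛ a′ → b ≈ᵛ b′ → a -ᵛ b ≈ᵛ a′ -ᵛ b′
  -ᵛ-cong (mk≈ᵛ x y z) (mk≈ᵛ x′ y′ z′) = mk≈ᵛ (minus-cong x x′) (minus-cong y y′) (minus-cong z z′)

  0*ᵛ : ∀ v → 0ℤ *ᵛ v ≡ 0ᵛ
  0*ᵛ (vec a b c) = vec-≡ (ℤ.*-zeroˡ a) (ℤ.*-zeroˡ b) (ℤ.*-zeroˡ c)

  ∙-0ᵛ : ∀ {a b} → b ≈ᵛ 0ᵛ → a ∙ b ≋ 0ℤ
  ∙-0ᵛ {vec a₁ a₂ a₃} b≈0 = ≋-trans (∙-congˡ {vec a₁ a₂ a₃} b≈0) (≡⇒≋ (annihilate a₁ a₂ a₃))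
    where annihilate : ∀ x y z → x * 0ℤ + y * 0ℤ + z * 0ℤ ≡ 0ℤ
          annihilate = solve-∀

  coordinates : Triple → Vec3
  coordinates (a , b , c) = vec (+ toℕ a) (+ toℕ b) (+ toℕ c)

  ⟦_⟧ : Σ Triple Normalised → Vec3
  ⟦ x ⟧ = coordinates (proj₁ x)

  private
    value≡∙ : ∀ L Q → + (value L Q) ≋ ⟦ L ⟧ ∙ ⟦ Q ⟧
    value≡∙ ((a , b , c) , _) ((x , y , z) , _) = ≋-trans (≋-sym (n≋n%p _)) (≡⇒≋ (begin
      + (toℕ a ℕ.* toℕ x ℕ.+ toℕ b ℕ.* toℕ y ℕ.+ toℕ c ℕ.* toℕ z)
        ≡⟨ ℤ.pos-+ (toℕ a ℕ.* toℕ x ℕ.+ toℕ b ℕ.* toℕ y) _ ⟩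
      + (toℕ a ℕ.* toℕ x ℕ.+ toℕ b ℕ.* toℕ y) + + (toℕ c ℕ.* toℕ z)
        ≡⟨ cong₂ _+_ (ℤ.pos-+ (toℕ a ℕ.* toℕ x) _) (ℤ.pos-* (toℕ c) (toℕ z)) ⟩
      + (toℕ a ℕ.* toℕ x) + + (toℕ b ℕ.* toℕ y) + + toℕ c * + toℕ z
        ≡⟨ cong (λ e → e + + toℕ c * + toℕ z) (cong₂ _+_ (ℤ.pos-* (toℕ a) (toℕ x)) (ℤ.pos-* (toℕ b) (toℕ y))) ⟩
      + toℕ a * + toℕ x + + toℕ b * + toℕ y + + toℕ c * + toℕ z ∎))
      where open ≡-Reasoning

  ∈L⇒∙≋0 : ∀ {L Q} → Q ∈L L → ⟦ L ⟧ ∙ ⟦ Q ⟧ ≋ 0ℤ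
  ∈L⇒∙≋0 {L} {Q} Q∈L = ≋-trans (≋-sym (value≡∙ L Q)) (≡⇒≋ (cong +_ Q∈L))

  ∙≋0⇒∈L : ∀ {L Q} → ⟦ L ⟧ ∙ ⟦ Q ⟧ ≋ 0ℤ → Q ∈L L
  ∙≋0⇒∈L {L} {Q} LQ≋0 = ≋⇒≡-below-p (ℕ.m%n<n _ p) 0<p (≋-trans (value≡∙ L Q) LQ≋0)

  χ≡δ : ∀ L Q → + χ L Q ≡ δ (⟦ L ⟧ ∙ ⟦ Q ⟧)
  χ≡δ L Q with value L Q ℕ.≟ 0
  ... | yes Q∈L = sym (δ-≋0 (∈L⇒∙≋0 {L} {Q} Q∈L))
  ... | no Q∉L = sym (δ-≉0 (λ LQ≋0 → Q∉L (∙≋0⇒∈L {L} {Q} LQ≋0)))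

  leading : Σ Triple Normalised → Vec3 → ℤ
  leading (_ , inj₁ _)        = Vec3.vx
  leading (_ , inj₂ (inj₁ _)) = Vec3.vy
  leading (_ , inj₂ (inj₂ _)) = Vec3.vz

  leading-unit : Σ Triple Normalised → Vec3
  leading-unit (_ , inj₁ _)        = vec 1ℤ 0ℤ 0ℤ
  leading-unit (_ , inj₂ (inj₁ _)) = vec 0ℤ 1ℤ 0ℤ
  leading-unit (_ , inj₂ (inj₂ _)) = vec 0ℤ 0ℤ 1ℤ

  leading-unit-∙ : ∀ x v → leading-unit x ∙ v ≡ leading x v
  leading-unit-∙ (_ , inj₁ _)        (vec a b c) = pick a b c
    where pick : ∀ a b c → 1ℤ * a + 0ℤ * b + 0ℤ * c ≡ a
          pick = solve-∀
  leading-unit-∙ (_ , inj₂ (inj₁ _)) (vec a b c) = pick a b c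
    where pick : ∀ a b c → 0ℤ * a + 1ℤ * b + 0ℤ * c ≡ b
          pick = solve-∀
  leading-unit-∙ (_ , inj₂ (inj₂ _)) (vec a b c) = pick a b c
    where pick : ∀ a b c → 0ℤ * a + 0ℤ * b + 1ℤ * c ≡ c
          pick = solve-∀

  leading-⟦⟧ : ∀ x → leading x ⟦ x ⟧ ≡ 1ℤ
  leading-⟦⟧ (_ , inj₁ e)                 = cong +_ e
  leading-⟦⟧ (_ , inj₂ (inj₁ (_ , e)))     = cong +_ e
  leading-⟦⟧ (_ , inj₂ (inj₂ (_ , _ , e))) = cong +_ e

  ⟦⟧≉0ᵛ : ∀ x → ¬ ⟦ x ⟧ ≈ᵛ 0ᵛ
  ⟦⟧≉0ᵛ (_ , inj₁ e)                 x≈0 = 1≉0 (≋-trans (≡⇒≋ (sym (cong +_ e))) (_≈ᵛ_.≈x x≈0))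
  ⟦⟧≉0ᵛ (_ , inj₂ (inj₁ (_ , e)))     x≈0 = 1≉0 (≋-trans (≡⇒≋ (sym (cong +_ e))) (_≈ᵛ_.≈y x≈0))
  ⟦⟧≉0ᵛ (_ , inj₂ (inj₂ (_ , _ , e))) x≈0 = 1≉0 (≋-trans (≡⇒≋ (sym (cong +_ e))) (_≈ᵛ_.≈z x≈0))

  ⨯-≈0ᵛ⇒∝ : ∀ A x → A ⨯ ⟦ x ⟧ ≈ᵛ 0ᵛ → A ≈ᵛ leading x A *ᵛ ⟦ x ⟧
  ⨯-≈0ᵛ⇒∝ (vec A₁ A₂ A₃) ((_ , b , c) , inj₁ e) (mk≈ᵛ _ e₂ e₃) rewrite e =
    mk≈ᵛ (≡⇒≋ (sym (ℤ.*-identityʳ A₁)))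
         (≋-sym (minus≋0⇒≋ (≋-trans (≡⇒≋ (x₂ A₁ A₂ (+ toℕ b))) e₃)))
         (minus≋0⇒≋ (≋-trans (≡⇒≋ (x₃ A₁ A₃ (+ toℕ c))) e₂))
    where x₂ : ∀ a₁ a₂ u → a₁ * u - a₂ ≡ a₁ * u - a₂ * 1ℤ
          x₂ = solve-∀
          x₃ : ∀ a₁ a₃ u → a₃ - a₁ * u ≡ a₃ * 1ℤ - a₁ * u
          x₃ = solve-∀
  ⨯-≈0ᵛ⇒∝ (vec A₁ A₂ A₃) ((_ , _ , c) , inj₂ (inj₁ (e₀ , e))) (mk≈ᵛ e₁ _ e₃) rewrite e₀ | e =
    mk≈ᵛ (≋-trans (minus≋0⇒≋ (≋-trans (≡⇒≋ (x₁ A₁ A₂)) e₃)) (≡⇒≋ (sym (ℤ.*-zeroʳ A₂))))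
         (≡⇒≋ (sym (ℤ.*-identityʳ A₂)))
         (≋-sym (minus≋0⇒≋ (≋-trans (≡⇒≋ (x₃ A₂ A₃ (+ toℕ c))) e₁)))
    where x₁ : ∀ a₁ a₂ → a₁ - 0ℤ ≡ a₁ * 1ℤ - a₂ * 0ℤ
          x₁ = solve-∀
          x₃ : ∀ a₂ a₃ u → a₂ * u - a₃ ≡ a₂ * u - a₃ * 1ℤ
          x₃ = solve-∀
  ⨯-≈0ᵛ⇒∝ (vec A₁ A₂ A₃) (_ , inj₂ (inj₂ (e₀ , e₀′ , e))) (mk≈ᵛ e₁ e₂ _) rewrite e₀ | e₀′ | e =
    mk≈ᵛ (≋-trans (≋-sym (minus≋0⇒≋ (≋-trans (≡⇒≋ (x₁ A₁ A₃)) e₂))) (≡⇒≋ (sym (ℤ.*-zeroʳ A₃))))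
         (≋-trans (≋-trans (≡⇒≋ (x₂ A₂ A₃)) e₁) (≡⇒≋ (sym (ℤ.*-zeroʳ A₃))))
         (≡⇒≋ (sym (ℤ.*-identityʳ A₃)))
    where x₁ : ∀ a₁ a₃ → 0ℤ - a₁ ≡ a₃ * 0ℤ - a₁ * 1ℤ
          x₁ = solve-∀
          x₂ : ∀ a₂ a₃ → a₂ ≡ a₂ * 1ℤ - a₃ * 0ℤ
          x₂ = solve-∀

  private
    one-one : ∀ {u u′ c} → u ≡ 1 → u′ ≡ 1 → + u ≋ c * + u′ → c ≋ 1ℤ
    one-one {c = c} refl refl u≋cu′ = ≋-trans (≡⇒≋ (sym (ℤ.*-identityʳ c))) (≋-sym u≋cu′)

    one-zero : ∀ {u u′ c} → u ≡ 1 → u′ ≡ 0 → ¬ + u ≋ c * + u′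
    one-zero {c = c} refl refl u≋cu′ = 1≉0 (≋-trans u≋cu′ (≡⇒≋ (ℤ.*-zeroʳ c)))

    zero-one : ∀ {u u′ c} → u ≡ 0 → u′ ≡ 1 → + u ≋ c * + u′ → c ≋ 0ℤ
    zero-one {c = c} refl refl u≋cu′ = ≋-trans (≡⇒≋ (sym (ℤ.*-identityʳ c))) (≋-sym u≋cu′)

    ∝-scalar≋1 : ∀ x x′ {c} → ⟦ x ⟧ ≈ᵛ c *ᵛ ⟦ x′ ⟧ → c ≋ 1ℤ
    ∝-scalar≋1 x x′ {c} x≈cx′ = cases (proj₂ x) (proj₂ x′) x≈cx′
      where
      open _≈ᵛ_
      c≉0 : c ≉ 0ℤ
      c≉0 c≋0 = ⟦⟧≉0ᵛ x (≈ᵛ-trans x≈cx′ (≈ᵛ-trans (*ᵛ-cong c≋0 ≈ᵛ-refl) (≡⇒≈ᵛ (0*ᵛ ⟦ x′ ⟧))))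
      cases : ∀ {a b c′ a′ b′ c″} → Normalised (a , b , c′) → Normalised (a′ , b′ , c″) →
              vec (+ toℕ a) (+ toℕ b) (+ toℕ c′) ≈ᵛ c *ᵛ vec (+ toℕ a′) (+ toℕ b′) (+ toℕ c″) → c ≋ 1ℤ
      cases (inj₁ e)                 (inj₁ e′)                 eq = one-one {c = c} e e′ (≈x eq)
      cases (inj₁ e)                 (inj₂ (inj₁ (e′ , _)))     eq = ⊥-elim (one-zero {c = c} e e′ (≈x eq))
      cases (inj₁ e)                 (inj₂ (inj₂ (e′ , _)))     eq = ⊥-elim (one-zero {c = c} e e′ (≈x eq))
      cases (inj₂ (inj₁ (e , _)))     (inj₁ e′)                 eq = ⊥-elim (c≉0 (zero-one {c = c} e e′ (≈x eq)))
      cases (inj₂ (inj₁ (_ , e)))     (inj₂ (inj₁ (_ , e′)))     eq = one-one {c = c} e e′ (≈y eq)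
      cases (inj₂ (inj₁ (_ , e)))     (inj₂ (inj₂ (_ , e′ , _))) eq = ⊥-elim (one-zero {c = c} e e′ (≈y eq))
      cases (inj₂ (inj₂ (e , _)))     (inj₁ e′)                 eq = ⊥-elim (c≉0 (zero-one {c = c} e e′ (≈x eq)))
      cases (inj₂ (inj₂ (_ , e , _))) (inj₂ (inj₁ (_ , e′)))     eq = ⊥-elim (c≉0 (zero-one {c = c} e e′ (≈y eq)))
      cases (inj₂ (inj₂ (_ , _ , e))) (inj₂ (inj₂ (_ , _ , e′))) eq = one-one {c = c} e e′ (≈z eq)

    fin-≋⇒≡ : ∀ {a a′ : Fin p} {c} → c ≋ 1ℤ → + toℕ a ≋ c * + toℕ a′ → a ≡ a′
    fin-≋⇒≡ {a} {a′} {c} c≋1 a≋ca′ = Fin.toℕ-injective (≋⇒≡-below-p (Fin.toℕ<n a) (Fin.toℕ<n a′)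
      (≋-trans a≋ca′ (≋-trans (*-congʳ c≋1) (≡⇒≋ (ℤ.*-identityˡ (+ toℕ a′))))))

  ∝⇒≡ : ∀ x x′ {k} → ⟦ x ⟧ ≈ᵛ k *ᵛ ⟦ x′ ⟧ → proj₁ x ≡ proj₁ x′
  ∝⇒≡ x x′ {k} x≈kx′@(mk≈ᵛ ≈x ≈y ≈z) =
    cong₂ _,_ (fin-≋⇒≡ {c = k} k≋1 ≈x) (cong₂ _,_ (fin-≋⇒≡ {c = k} k≋1 ≈y) (fin-≋⇒≡ {c = k} k≋1 ≈z))
    where k≋1 = ∝-scalar≋1 x x′ x≈kx′

  *ᵛ-assoc : ∀ k l v → k *ᵛ (l *ᵛ v) ≡ (k * l) *ᵛ v
  *ᵛ-assoc k l (vec a b c) = vec-≡ (sym (ℤ.*-assoc k l a)) (sym (ℤ.*-assoc k l b)) (sym (ℤ.*-assoc k l c))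

  *ᵛ-identityˡ : ∀ v → 1ℤ *ᵛ v ≡ v
  *ᵛ-identityˡ (vec a b c) = vec-≡ (ℤ.*-identityˡ a) (ℤ.*-identityˡ b) (ℤ.*-identityˡ c)

  ≈ᵛ-*ᵛ-unscale : ∀ {k u v} → k ≉ 0ℤ → u ≈ᵛ k *ᵛ v → v ≈ᵛ k ⁻¹ *ᵛ u
  ≈ᵛ-*ᵛ-unscale {k} {u} {v} k≉0 u≈kv = begin
    v                 ≡⟨ *ᵛ-identityˡ v ⟨
    1ℤ *ᵛ v           ≈⟨ *ᵛ-cong (≋-sym (⁻¹-inverseˡ k≉0)) ≈ᵛ-refl ⟩
    (k ⁻¹ * k) *ᵛ v   ≡⟨ *ᵛ-assoc (k ⁻¹) k v ⟨
    k ⁻¹ *ᵛ (k *ᵛ v)  ≈⟨ *ᵛ-congʳ (k ⁻¹) (≈ᵛ-sym u≈kv) ⟩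
    k ⁻¹ *ᵛ u         ∎
    where open ≈ᵛ-Reasoning

  private
    fin : ℤ → Fin p
    fin z = fromℕ< (reduce<p z)

    fin-≋ : ∀ z → + toℕ (fin z) ≋ z
    fin-≋ z = ≋-trans (≡⇒≋ (cong +_ (Fin.toℕ-fromℕ< (reduce<p z)))) (reduce-≋ z)

    0F 1F : Fin p
    0F = fromℕ< 0<p
    1F = fromℕ< 1<p

    toℕ-0F : toℕ 0F ≡ 0
    toℕ-0F = Fin.toℕ-fromℕ< 0<p

    toℕ-1F : toℕ 1F ≡ 1
    toℕ-1F = Fin.toℕ-fromℕ< 1<p

  infix 4 _∼_
  record _∼_ (x : Σ Triple Normalised) (v : Vec3) : Set where
    constructor scaled
    field
      scalar    : ℤ
      scalar≉0  : scalar ≉ 0ℤ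
      ⟦⟧≈scaled : ⟦ x ⟧ ≈ᵛ scalar *ᵛ v

  abstract
    normalise : Vec3 → Point
    normalise (vec a b c) with a ≋? 0ℤ | b ≋? 0ℤ
    ... | no _  | _    = (1F , fin (b * a ⁻¹) , fin (c * a ⁻¹)) , inj₁ toℕ-1F
    ... | yes _ | no _  = (0F , 1F , fin (c * b ⁻¹)) , inj₂ (inj₁ (toℕ-0F , toℕ-1F))
    ... | yes _ | yes _ = (0F , 0F , 1F) , inj₂ (inj₂ (toℕ-0F , toℕ-0F , toℕ-1F))

    normalise-∼ : ∀ v → ¬ v ≈ᵛ 0ᵛ → normalise v ∼ v
    normalise-∼ (vec a b c) v≉0 with a ≋? 0ℤ | b ≋? 0ℤ
    ... | no a≉0 | _ = scaled (a ⁻¹) (⁻¹-≉0 a≉0) (mk≈ᵛ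
      (≋-trans (≡⇒≋ (cong +_ toℕ-1F)) (≋-sym (⁻¹-inverseˡ a≉0)))
      (≋-trans (fin-≋ _) (≡⇒≋ (ℤ.*-comm b (a ⁻¹))))
      (≋-trans (fin-≋ _) (≡⇒≋ (ℤ.*-comm c (a ⁻¹)))))
    ... | yes a≋0 | no b≉0 = scaled (b ⁻¹) (⁻¹-≉0 b≉0) (mk≈ᵛ
      (≋-trans (≡⇒≋ (cong +_ toℕ-0F)) (≋-sym (≋-trans (*-congˡ {b ⁻¹} a≋0) (≡⇒≋ (ℤ.*-zeroʳ (b ⁻¹))))))
      (≋-trans (≡⇒≋ (cong +_ toℕ-1F)) (≋-sym (⁻¹-inverseˡ b≉0)))
      (≋-trans (fin-≋ _) (≡⇒≋ (ℤ.*-comm c (b ⁻¹)))))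
    ... | yes a≋0 | yes b≋0 with c ≋? 0ℤ
    ...   | yes c≋0 = ⊥-elim (v≉0 (mk≈ᵛ a≋0 b≋0 c≋0))
    ...   | no c≉0 = scaled (c ⁻¹) (⁻¹-≉0 c≉0) (mk≈ᵛ
      (≋-trans (≡⇒≋ (cong +_ toℕ-0F)) (≋-sym (≋-trans (*-congˡ {c ⁻¹} a≋0) (≡⇒≋ (ℤ.*-zeroʳ (c ⁻¹))))))
      (≋-trans (≡⇒≋ (cong +_ toℕ-0F)) (≋-sym (≋-trans (*-congˡ {c ⁻¹} b≋0) (≡⇒≋ (ℤ.*-zeroʳ (c ⁻¹))))))
      (≋-trans (≡⇒≋ (cong +_ toℕ-1F)) (≋-sym (⁻¹-inverseˡ c≉0))))

  ⨯-⨯-≈0ᵛ : ∀ y x c → y ∙ c ≋ 0ℤ → x ∙ c ≋ 0ℤ → (y ⨯ x) ⨯ c ≈ᵛ 0ᵛ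
  ⨯-⨯-≈0ᵛ y x c yc≋0 xc≋0 = ≈ᵛ-trans (≡⇒≈ᵛ (⨯-⨯-expand y x c))
    (≈ᵛ-trans (-ᵛ-cong (*ᵛ-cong yc≋0 ≈ᵛ-refl) (*ᵛ-cong xc≋0 ≈ᵛ-refl)) (≡⇒≈ᵛ (vanish x y)))
    where vanish : ∀ x y → 0ℤ *ᵛ x -ᵛ 0ℤ *ᵛ y ≡ 0ᵛ
          vanish (vec a b c) (vec d e f) = vec-≡ (zero a d) (zero b e) (zero c f)
            where zero : ∀ u v → 0ℤ * u - 0ℤ * v ≡ 0ℤ
                  zero = solve-∀

  -- z ∙ (y ⨯ x) ≉ 0 says that y and x are independent.
  line-unique : ∀ L L′ {y x z} → z ∙ (y ⨯ x) ≉ 0ℤ →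
    ⟦ L ⟧ ∙ y ≋ 0ℤ → ⟦ L ⟧ ∙ x ≋ 0ℤ → ⟦ L′ ⟧ ∙ y ≋ 0ℤ → ⟦ L′ ⟧ ∙ x ≋ 0ℤ → proj₁ L ≡ proj₁ L′
  line-unique L L′ {y} {x} {z} independent Ly Lx L′y L′x =
    ∝⇒≡ L L′ {leading L U ⁻¹ * leading L′ U} (≈ᵛ-trans (≈ᵛ-*ᵛ-unscale λ≉0 U∝L)
      (≈ᵛ-trans (*ᵛ-congʳ (leading L U ⁻¹) U∝L′) (≡⇒≈ᵛ (*ᵛ-assoc (leading L U ⁻¹) (leading L′ U) ⟦ L′ ⟧))))
    where
    U = y ⨯ x
    U∝ : ∀ M → ⟦ M ⟧ ∙ y ≋ 0ℤ → ⟦ M ⟧ ∙ x ≋ 0ℤ → U ≈ᵛ leading M U *ᵛ ⟦ M ⟧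
    U∝ M My Mx = ⨯-≈0ᵛ⇒∝ U M (⨯-⨯-≈0ᵛ y x ⟦ M ⟧ (≋-trans (≡⇒≋ (∙-comm y ⟦ M ⟧)) My) (≋-trans (≡⇒≋ (∙-comm x ⟦ M ⟧)) Mx))
    U∝L = U∝ L Ly Lx
    U∝L′ = U∝ L′ L′y L′x
    λ≉0 : leading L U ≉ 0ℤ
    λ≉0 λ≋0 = independent (∙-0ᵛ {z} (≈ᵛ-trans U∝L (≈ᵛ-trans (*ᵛ-cong λ≋0 ≈ᵛ-refl) (≡⇒≈ᵛ (0*ᵛ ⟦ L ⟧)))))

  ∼-∙ : ∀ {x v} c (x∼v : x ∼ v) → ⟦ x ⟧ ∙ c ≋ _∼_.scalar x∼v * (v ∙ c)
  ∼-∙ {x} {v} c (scaled μ μ≉0 x≈μv) = ≋-trans (∙-cong x≈μv ≈ᵛ-refl) (≡⇒≋ (∙-*ˡ μ v c))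

  ∼-∈L⇒ : ∀ {L Q v} → Q ∼ v → Q ∈L L → ⟦ L ⟧ ∙ v ≋ 0ℤ
  ∼-∈L⇒ {L} {Q} {v} Q∼v@(scaled μ μ≉0 _) Q∈L = *-cancelˡ-≋ μ≉0 (begin
    μ * (⟦ L ⟧ ∙ v)  ≡⟨ cong (μ *_) (∙-comm ⟦ L ⟧ v) ⟩
    μ * (v ∙ ⟦ L ⟧)  ≈⟨ ∼-∙ ⟦ L ⟧ Q∼v ⟨
    ⟦ Q ⟧ ∙ ⟦ L ⟧    ≡⟨ ∙-comm ⟦ Q ⟧ ⟦ L ⟧ ⟩
    ⟦ L ⟧ ∙ ⟦ Q ⟧    ≈⟨ ∈L⇒∙≋0 {L} {Q} Q∈L ⟩
    0ℤ               ≡⟨ ℤ.*-zeroʳ μ ⟨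
    μ * 0ℤ           ∎)
    where open ≋-Reasoning

  ∼-∈L⇐ : ∀ {L Q v} → Q ∼ v → ⟦ L ⟧ ∙ v ≋ 0ℤ → Q ∈L L
  ∼-∈L⇐ {L} {Q} {v} Q∼v@(scaled μ _ _) L∙v≋0 = ∙≋0⇒∈L {L} {Q} (begin
    ⟦ L ⟧ ∙ ⟦ Q ⟧    ≡⟨ ∙-comm ⟦ L ⟧ ⟦ Q ⟧ ⟩
    ⟦ Q ⟧ ∙ ⟦ L ⟧    ≈⟨ ∼-∙ ⟦ L ⟧ Q∼v ⟩
    μ * (v ∙ ⟦ L ⟧)  ≡⟨ cong (μ *_) (∙-comm v ⟦ L ⟧) ⟩
    μ * (⟦ L ⟧ ∙ v)  ≈⟨ *-congˡ {μ} L∙v≋0 ⟩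
    μ * 0ℤ           ≡⟨ ℤ.*-zeroʳ μ ⟩
    0ℤ               ∎)
    where open ≋-Reasoning

  ∼-χ : ∀ {L Q l q} → L ∼ l → Q ∼ q → + χ L Q ≡ δ (l ∙ q)
  ∼-χ {L} {Q} {l} {q} (scaled λ′ λ′≉0 L≈λl) (scaled μ μ≉0 Q≈μq) = begin
    + χ L Q                       ≡⟨ χ≡δ L Q ⟩
    δ (⟦ L ⟧ ∙ ⟦ Q ⟧)             ≡⟨ δ-cong (∙-cong L≈λl Q≈μq) ⟩
    δ ((λ′ *ᵛ l) ∙ (μ *ᵛ q))      ≡⟨ cong δ (trans (∙-*ˡ λ′ l (μ *ᵛ q)) (cong (λ′ *_) (∙-*ʳ l μ q))) ⟩
    δ (λ′ * (μ * (l ∙ q)))        ≡⟨ δ-*-≉0 λ′≉0 ⟩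
    δ (μ * (l ∙ q))               ≡⟨ δ-*-≉0 μ≉0 ⟩
    δ (l ∙ q)                     ∎
    where open ≡-Reasoning

  ⟦⟧-∼ : ∀ x → x ∼ ⟦ x ⟧
  ⟦⟧-∼ x = scaled 1ℤ 1≉0 (≡⇒≈ᵛ (sym (*ᵛ-identityˡ ⟦ x ⟧)))

  ∼-≢ : ∀ {Q R v} c → Q ∼ v → v ∙ c ≉ 0ℤ → ⟦ R ⟧ ∙ c ≋ 0ℤ → proj₁ Q ≢ proj₁ R
  ∼-≢ {Q} {R} {v} c Q∼v@(scaled μ μ≉0 _) v∙c≉0 R∙c≋0 Q≡R =
    *-≉0 μ≉0 v∙c≉0 (≋-trans (≋-sym (∼-∙ c Q∼v)) (≋-trans (≡⇒≋ (cong (λ x → coordinates x ∙ c) Q≡R)) R∙c≋0))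

module Frame (p : ℕ) .{{_ : NonZero p}} (prime : Prime p)
             (P L₀ L₁ : PG.Point p) (P∈L₀ : PG._∈L_ p P L₀) (P∈L₁ : PG._∈L_ p P L₁)
             (L₀≢L₁ : proj₁ L₀ ≢ proj₁ L₁) where
  open import Data.Nat using (ℕ; NonZero)
  open import Data.Nat.Primality using (Prime)
  open import Data.Integer using (ℤ; +_; _+_; _*_; -_; _-_; 0ℤ; 1ℤ)
  import Data.Integer.Properties as ℤ
  open import Data.Integer.Tactic.RingSolver using (solve-∀)
  open import Data.Product using (Σ; _,_; proj₁; proj₂)
  open import Data.Sum using (_⊎_; inj₁; inj₂)
  open import Relation.Nullary using (¬_; Dec; yes; no)
  open import Relation.Binary.PropositionalEquality
  open Vector

  open Modular p prime
  open PG p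
  open Projective p prime

  -- The chart o + x s + y t: t is P, and s ∈ L₀, o ∈ L₁ are points other than P (t ∙ m = 1),
  -- so P is the vertical direction, L₀ the line at infinity and L₁ the vertical x = 0.
  t m s o : Vec3
  t = ⟦ P ⟧
  m = leading-unit P
  s = ⟦ L₀ ⟧ ⨯ m
  o = ⟦ L₁ ⟧ ⨯ m

  Δ : ℤ
  Δ = triple s t o

  L₀∙t≋0 : ⟦ L₀ ⟧ ∙ t ≋ 0ℤ
  L₀∙t≋0 = ∈L⇒∙≋0 {L₀} {P} P∈L₀

  L₁∙t≋0 : ⟦ L₁ ⟧ ∙ t ≋ 0ℤ
  L₁∙t≋0 = ∈L⇒∙≋0 {L₁} {P} P∈L₁

  L₀∙s≡0 : ⟦ L₀ ⟧ ∙ s ≡ 0ℤ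
  L₀∙s≡0 = ∙-⨯-selfˡ ⟦ L₀ ⟧ m

  L₁∙o≡0 : ⟦ L₁ ⟧ ∙ o ≡ 0ℤ
  L₁∙o≡0 = ∙-⨯-selfˡ ⟦ L₁ ⟧ m

  Δ≉0 : Δ ≉ 0ℤ
  Δ≉0 Δ≋0 = L₀≢L₁ (sym (∝⇒≡ L₁ L₀ {leading L₀ ⟦ L₁ ⟧} (⨯-≈0ᵛ⇒∝ ⟦ L₁ ⟧ L₀ W≈0)))
    where
    open ≋-Reasoning
    W = ⟦ L₁ ⟧ ⨯ ⟦ L₀ ⟧
    W∝t : W ≈ᵛ leading P W *ᵛ t
    W∝t = ⨯-≈0ᵛ⇒∝ W P (⨯-⨯-≈0ᵛ ⟦ L₁ ⟧ ⟦ L₀ ⟧ t L₁∙t≋0 L₀∙t≋0)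
    Δ≋leading : Δ ≋ leading P W
    Δ≋leading = begin
      Δ                                                  ≡⟨ triple-⨯ ⟦ L₀ ⟧ m t ⟦ L₁ ⟧ ⟩
      (t ∙ m) * (m ∙ W) - (t ∙ ⟦ L₁ ⟧) * (s ∙ m)         ≡⟨ cong₂ (λ a b → a * (m ∙ W) - (t ∙ ⟦ L₁ ⟧) * b) t∙m≡1 s∙m≡0 ⟩
      1ℤ * (m ∙ W) - (t ∙ ⟦ L₁ ⟧) * 0ℤ                   ≡⟨ simplify (m ∙ W) (t ∙ ⟦ L₁ ⟧) ⟩
      m ∙ W                                              ≡⟨ leading-unit-∙ P W ⟩
      leading P W                                        ∎
      where
      t∙m≡1 : t ∙ m ≡ 1ℤ
      t∙m≡1 = trans (∙-comm t m) (trans (leading-unit-∙ P t) (leading-⟦⟧ P))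
      s∙m≡0 : s ∙ m ≡ 0ℤ
      s∙m≡0 = trans (∙-comm s m) (∙-⨯-selfʳ ⟦ L₀ ⟧ m)
      simplify : ∀ a b → 1ℤ * a - b * 0ℤ ≡ a
      simplify = solve-∀
    W≈0 : W ≈ᵛ 0ᵛ
    W≈0 = ≈ᵛ-trans W∝t (≈ᵛ-trans (*ᵛ-cong (≋-trans (≋-sym Δ≋leading) Δ≋0) ≈ᵛ-refl) (≡⇒≈ᵛ (0*ᵛ t)))

  affine-vec : ℤ → ℤ → Vec3
  affine-vec x y = o +ᵛ x *ᵛ s +ᵛ y *ᵛ t

  infinite-vec : ℤ → Vec3
  infinite-vec z = s +ᵛ z *ᵛ t

  -- Dual coordinates of the line y = k x + b.
  line-vec : ℤ → ℤ → Vec3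
  line-vec k b = k *ᵛ (t ⨯ o) -ᵛ o ⨯ s +ᵛ b *ᵛ (s ⨯ t)

  private
    ≉0ᵛ : ∀ {v} c → v ∙ c ≉ 0ℤ → ¬ v ≈ᵛ 0ᵛ
    ≉0ᵛ {v} c v∙c≉0 v≈0 = v∙c≉0 (≋-trans (≡⇒≋ (∙-comm v c)) (∙-0ᵛ {c} v≈0))

    affine-w : ∀ x y → affine-vec x y ∙ (s ⨯ t) ≡ Δ
    affine-w x y = proj₂ (proj₂ (affine-coordinates s t o x y))

    infinite-u : ∀ z → infinite-vec z ∙ (t ⨯ o) ≡ Δ
    infinite-u z = +*ᵛ-∙-t⨯o s t o z

  affine : ℤ → ℤ → Point
  affine x y = normalise (affine-vec x y)

  at-infinity : ℤ → Point
  at-infinity z = normalise (infinite-vec z)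

  line : ℤ → ℤ → Line
  line k b = normalise (line-vec k b)

  affine-∼ : ∀ x y → affine x y ∼ affine-vec x y
  affine-∼ x y = normalise-∼ (affine-vec x y) (≉0ᵛ (s ⨯ t) (λ e → Δ≉0 (≋-trans (≡⇒≋ (sym (affine-w x y))) e)))

  at-infinity-∼ : ∀ z → at-infinity z ∼ infinite-vec z
  at-infinity-∼ z = normalise-∼ (infinite-vec z) (≉0ᵛ (t ⨯ o) (λ e → Δ≉0 (≋-trans (≡⇒≋ (sym (infinite-u z))) e)))

  line-∼ : ∀ k b → line k b ∼ line-vec k b
  line-∼ k b = normalise-∼ (line-vec k b) (≉0ᵛ t (λ e → -‿≉0 Δ≉0 (≋-trans (≡⇒≋ (sym (dual-combination-∙-t s t o k b))) e)))

  affine≢P : ∀ x y → proj₁ (affine x y) ≢ proj₁ P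
  affine≢P x y = ∼-≢ {R = P} (s ⨯ t) (affine-∼ x y) (λ e → Δ≉0 (≋-trans (≡⇒≋ (sym (affine-w x y))) e)) (≡⇒≋ (∙-⨯-selfʳ s t))

  at-infinity≢P : ∀ z → proj₁ (at-infinity z) ≢ proj₁ P
  at-infinity≢P z = ∼-≢ {R = P} (t ⨯ o) (at-infinity-∼ z) (λ e → Δ≉0 (≋-trans (≡⇒≋ (sym (infinite-u z))) e)) (≡⇒≋ (∙-⨯-selfˡ t o))

  α β γ : Line → ℤ
  α L = ⟦ L ⟧ ∙ s
  β L = ⟦ L ⟧ ∙ t
  γ L = ⟦ L ⟧ ∙ o

  ∙-affine-vec : ∀ L x y → ⟦ L ⟧ ∙ affine-vec x y ≡ γ L + x * α L + y * β L
  ∙-affine-vec L x y = ∙-affine ⟦ L ⟧ o x s y t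

  χ-affine : ∀ L x y → + χ L (affine x y) ≡ δ (γ L + x * α L + y * β L)
  χ-affine L x y = trans (∼-χ (⟦⟧-∼ L) (affine-∼ x y)) (cong δ (∙-affine-vec L x y))

  χ-at-infinity : ∀ L z → + χ L (at-infinity z) ≡ δ (α L + z * β L)
  χ-at-infinity L z = trans (∼-χ (⟦⟧-∼ L) (at-infinity-∼ z)) (cong δ (∙-+*ᵛ ⟦ L ⟧ s z t))

  χ-line : ∀ {Q x y} k b → Q ∼ affine-vec x y → + χ (line k b) Q ≡ δ (b - (y - k * x))
  χ-line {Q} {x} {y} k b Q∼ = begin
    + χ (line k b) Q                                                  ≡⟨ ∼-χ (line-∼ k b) Q∼ ⟩
    δ (line-vec k b ∙ affine-vec x y)                                 ≡⟨ cong δ (dual-combination-∙ s t o k b (affine-vec x y)) ⟩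
    δ (k * (A ∙ (t ⨯ o)) - A ∙ (o ⨯ s) + b * (A ∙ (s ⨯ t)))           ≡⟨ cong δ (cong₃ (λ u v w → k * u - v + b * w) uA vA wA) ⟩
    δ (k * (x * Δ) - y * Δ + b * Δ)                                   ≡⟨ cong δ (factor k x y b Δ) ⟩
    δ (Δ * (b - (y - k * x)))                                         ≡⟨ δ-*-≉0 Δ≉0 ⟩
    δ (b - (y - k * x))                                               ∎
    where
    open ≡-Reasoning
    A = affine-vec x y
    uA = proj₁ (affine-coordinates s t o x y)
    vA = proj₁ (proj₂ (affine-coordinates s t o x y))
    wA = proj₂ (proj₂ (affine-coordinates s t o x y))
    cong₃ : ∀ (f : ℤ → ℤ → ℤ → ℤ) {a a′ b b′ c c′} → a ≡ a′ → b ≡ b′ → c ≡ c′ → f a b c ≡ f a′ b′ c′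
    cong₃ f refl refl refl = refl
    factor : ∀ k x y b d → k * (x * d) - y * d + b * d ≡ d * (b - (y - k * x))
    factor = solve-∀

  private
    drop-β : ∀ {L} x y → β L ≋ 0ℤ → γ L + x * α L + y * β L ≋ γ L + x * α L
    drop-β {L} x y βL≋0 = ≋-trans (+-congˡ {γ L + x * α L} (≋-trans (*-congˡ {y} βL≋0) (≡⇒≋ (ℤ.*-zeroʳ y))))
                                  (≡⇒≋ (ℤ.+-identityʳ _))

  ∈L-affine⇒ : ∀ {L Q x y} → β L ≋ 0ℤ → Q ∼ affine-vec x y → Q ∈L L → γ L + x * α L ≋ 0ℤ
  ∈L-affine⇒ {L} {Q} {x} {y} βL≋0 Q∼ Q∈L =
    ≋-trans (≋-sym (drop-β {L} x y βL≋0)) (≋-trans (≡⇒≋ (sym (∙-affine-vec L x y))) (∼-∈L⇒ {L} Q∼ Q∈L))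

  ∈L-affine⇐ : ∀ {L Q x y} → β L ≋ 0ℤ → Q ∼ affine-vec x y → γ L + x * α L ≋ 0ℤ → Q ∈L L
  ∈L-affine⇐ {L} {Q} {x} {y} βL≋0 Q∼ on = ∼-∈L⇐ {L} Q∼ (≋-trans (≡⇒≋ (∙-affine-vec L x y)) (≋-trans (drop-β {L} x y βL≋0) on))

  ∈L-at-infinity⇒ : ∀ {L} z → β L ≋ 0ℤ → at-infinity z ∈L L → α L ≋ 0ℤ
  ∈L-at-infinity⇒ {L} z βL≋0 on = ≋-trans (≋-sym α+zβ≋α) (≋-trans (≡⇒≋ (sym (∙-+*ᵛ ⟦ L ⟧ s z t))) (∼-∈L⇒ {L} (at-infinity-∼ z) on))
    where α+zβ≋α = ≋-trans (+-congˡ {α L} (≋-trans (*-congˡ {z} βL≋0) (≡⇒≋ (ℤ.*-zeroʳ z)))) (≡⇒≋ (ℤ.+-identityʳ (α L)))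

  ∈L-at-infinity⇐ : ∀ {L} z → β L ≋ 0ℤ → α L ≋ 0ℤ → at-infinity z ∈L L
  ∈L-at-infinity⇐ {L} z βL≋0 αL≋0 = ∼-∈L⇐ {L} (at-infinity-∼ z) (≋-trans (≡⇒≋ (∙-+*ᵛ ⟦ L ⟧ s z t))
    (≋-trans (+-cong αL≋0 (≋-trans (*-congˡ {z} βL≋0) (≡⇒≋ (ℤ.*-zeroʳ z)))) ≋-refl))

  α≋0⇒L₀ : ∀ L → β L ≋ 0ℤ → α L ≋ 0ℤ → proj₁ L ≡ proj₁ L₀
  α≋0⇒L₀ L βL≋0 αL≋0 = line-unique L L₀ {t} {s} {o}
    (λ e → -‿≉0 Δ≉0 (≋-trans (≡⇒≋ (sym (triple-swap₁₃ s t o))) e)) βL≋0 αL≋0 L₀∙t≋0 (≡⇒≋ L₀∙s≡0)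

  γ≋0⇒L₁ : ∀ L → β L ≋ 0ℤ → γ L ≋ 0ℤ → proj₁ L ≡ proj₁ L₁
  γ≋0⇒L₁ L βL≋0 γL≋0 = line-unique L L₁ {t} {o} {s} Δ≉0 βL≋0 γL≋0 L₁∙t≋0 (≡⇒≋ L₁∙o≡0)

  α≋0⇒γ≉0 : ∀ L → β L ≋ 0ℤ → α L ≋ 0ℤ → γ L ≉ 0ℤ
  α≋0⇒γ≉0 L βL≋0 αL≋0 γL≋0 = L₀≢L₁ (trans (sym (α≋0⇒L₀ L βL≋0 αL≋0)) (γ≋0⇒L₁ L βL≋0 γL≋0))

  same-intercept⇒≡ : ∀ L L′ x → β L ≋ 0ℤ → β L′ ≋ 0ℤ → γ L + x * α L ≋ 0ℤ → γ L′ + x * α L′ ≋ 0ℤ → proj₁ L ≡ proj₁ L′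
  same-intercept⇒≡ L L′ x βL≋0 βL′≋0 L∋ L′∋ = line-unique L L′ {t} {affine-vec x 0ℤ} {s}
    (λ e → Δ≉0 (≋-trans (≡⇒≋ (sym (triple-affine s t o x 0ℤ))) e))
    βL≋0 (on L βL≋0 L∋) βL′≋0 (on L′ βL′≋0 L′∋)
    where on : ∀ M → β M ≋ 0ℤ → γ M + x * α M ≋ 0ℤ → ⟦ M ⟧ ∙ affine-vec x 0ℤ ≋ 0ℤ
          on M βM≋0 M∋ = ≋-trans (≡⇒≋ (∙-affine-vec M x 0ℤ)) (≋-trans (drop-β {M} x 0ℤ βM≋0) M∋)

  private
    module Coordinates (Q : Point) where
      q = ⟦ Q ⟧
      u = q ∙ (t ⨯ o)
      v = q ∙ (o ⨯ s)
      w = q ∙ (s ⨯ t)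

    w≋0⇒∈L₀ : ∀ Q → ⟦ Q ⟧ ∙ (s ⨯ t) ≋ 0ℤ → Q ∈L L₀
    w≋0⇒∈L₀ Q w≋0 = ∙≋0⇒∈L {L₀} {Q} (*-cancelˡ-≋ Δ≉0 (begin
      Δ * (⟦ L₀ ⟧ ∙ q)                                       ≡⟨ ∙-*ʳ ⟦ L₀ ⟧ Δ q ⟨
      ⟦ L₀ ⟧ ∙ (Δ *ᵛ q)                                      ≡⟨ cong (⟦ L₀ ⟧ ∙_) (cramer s t o q) ⟩
      ⟦ L₀ ⟧ ∙ (u *ᵛ s +ᵛ v *ᵛ t +ᵛ w *ᵛ o)                  ≡⟨ ∙-combination ⟦ L₀ ⟧ u s v t w o ⟩
      u * (⟦ L₀ ⟧ ∙ s) + v * (⟦ L₀ ⟧ ∙ t) + w * (⟦ L₀ ⟧ ∙ o) ≈⟨ +-cong (+-cong (≡⇒≋ (cong (u *_) L₀∙s≡0)) (*-congˡ {v} L₀∙t≋0)) (*-congʳ w≋0) ⟩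
      u * 0ℤ + v * 0ℤ + 0ℤ * (⟦ L₀ ⟧ ∙ o)                    ≡⟨ vanish u v (⟦ L₀ ⟧ ∙ o) ⟩
      0ℤ                                                     ≡⟨ ℤ.*-zeroʳ Δ ⟨
      Δ * 0ℤ                                                 ∎))
      where
      open ≋-Reasoning
      open Coordinates Q
      vanish : ∀ u v c → u * 0ℤ + v * 0ℤ + 0ℤ * c ≡ 0ℤ
      vanish = solve-∀

    -- Cramer's rule Δ q = u s + v t + w o, divided by w.
    w≉0⇒affine : ∀ Q (let open Coordinates Q) → w ≉ 0ℤ → Q ∼ affine-vec (u * w ⁻¹) (v * w ⁻¹)
    w≉0⇒affine Q w≉0 = scaled (w * Δ ⁻¹) (*-≉0 w≉0 (⁻¹-≉0 Δ≉0))
      (mk≈ᵛ (rescale (cong Vec3.vx (cramer s t o q))) (rescale (cong Vec3.vy (cramer s t o q))) (rescale (cong Vec3.vz (cramer s t o q))))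
      where
      open Coordinates Q
      rescale : ∀ {q′ s′ t′ o′} → Δ * q′ ≡ u * s′ + v * t′ + w * o′ → q′ ≋ w * Δ ⁻¹ * (o′ + u * w ⁻¹ * s′ + v * w ⁻¹ * t′)
      rescale {q′} {s′} {t′} {o′} cramer′ = ≋-sym (begin
        w * Δ ⁻¹ * (o′ + u * w ⁻¹ * s′ + v * w ⁻¹ * t′)          ≡⟨ expand s′ t′ o′ u v w (Δ ⁻¹) (w ⁻¹) ⟩
        Δ ⁻¹ * (w * o′ + u * (w * w ⁻¹) * s′ + v * (w * w ⁻¹) * t′)
            ≈⟨ *-congˡ {Δ ⁻¹} (+-cong (+-congˡ {w * o′} (*-congʳ (*-congˡ {u} ww⁻¹))) (*-congʳ (*-congˡ {v} ww⁻¹))) ⟩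
        Δ ⁻¹ * (w * o′ + u * 1ℤ * s′ + v * 1ℤ * t′)              ≡⟨ cong (Δ ⁻¹ *_) (regroup s′ t′ o′ u v w) ⟩
        Δ ⁻¹ * (u * s′ + v * t′ + w * o′)                        ≡⟨ cong (Δ ⁻¹ *_) cramer′ ⟨
        Δ ⁻¹ * (Δ * q′)                                          ≡⟨ ℤ.*-assoc (Δ ⁻¹) Δ q′ ⟨
        Δ ⁻¹ * Δ * q′                                            ≈⟨ *-congʳ (⁻¹-inverseˡ Δ≉0) ⟩
        1ℤ * q′                                                  ≡⟨ ℤ.*-identityˡ q′ ⟩
        q′                                                       ∎)
        where
        open ≋-Reasoning
        ww⁻¹ = ⁻¹-inverseʳ w≉0
        expand : ∀ s t o u v w d⁻¹ w⁻¹ → w * d⁻¹ * (o + u * w⁻¹ * s + v * w⁻¹ * t) ≡ d⁻¹ * (w * o + u * (w * w⁻¹) * s + v * (w * w⁻¹) * t)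
        expand = solve-∀
        regroup : ∀ s t o u v w → w * o + u * 1ℤ * s + v * 1ℤ * t ≡ u * s + v * t + w * o
        regroup = solve-∀

  affine-or-on-L₀ : ∀ Q → Q ∈L L₀ ⊎ Σ ℤ λ x → Σ ℤ λ y → Q ∼ affine-vec x y
  affine-or-on-L₀ Q = classify (w ≋? 0ℤ)
    where
    open Coordinates Q
    classify : Dec (w ≋ 0ℤ) → Q ∈L L₀ ⊎ Σ ℤ λ x → Σ ℤ λ y → Q ∼ affine-vec x y
    classify (yes w≋0) = inj₁ (w≋0⇒∈L₀ Q w≋0)
    classify (no w≉0)  = inj₂ (u * w ⁻¹ , v * w ⁻¹ , w≉0⇒affine Q w≉0)

module Codeword (p : ℕ) .{{_ : NonZero p}} (prime : Prime p)
                (P L₀ L₁ : PG.Point p) (P∈L₀ : PG._∈L_ p P L₀) (P∈L₁ : PG._∈L_ p P L₁)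
                (L₀≢L₁ : proj₁ L₀ ≢ proj₁ L₁) where
  open import Data.Nat as ℕ using (ℕ; zero; suc; NonZero; _!)
  open import Data.Nat.Primality using (Prime)
  open import Data.Integer using (ℤ; +_; _+_; _*_; -_; _-_; 0ℤ; 1ℤ)
  import Data.Integer.Properties as ℤ
  open import Data.Integer.Tactic.RingSolver using (solve-∀)
  open import Data.List using (List; []; _∷_; length)
  open import Data.List.Relation.Unary.Any using (Any; here; there)
  open import Data.Product using (_,_; proj₁)
  open import Relation.Binary.PropositionalEquality

  open Modular p prime
  open PG p
  open Projective p prime
  open Summation p prime
  open Polynomial p prime
  open Frame p prime P L₀ L₁ P∈L₀ P∈L₁ L₀≢L₁

  sumℕ : ℕ → (ℕ → ℕ) → ℕ
  sumℕ zero    f = 0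
  sumℕ (suc n) f = sumℕ n f ℕ.+ f n

  +sumℕ≡∑ : ∀ n f → + sumℕ n f ≡ ∑ n (λ k → + f k)
  +sumℕ≡∑ zero    f = refl
  +sumℕ≡∑ (suc n) f = trans (ℤ.pos-+ (sumℕ n f) (f n)) (cong (_+ + f n) (+sumℕ≡∑ n f))

  Span-sumℕ : ∀ {S : Fun → Set} n (F : ℕ → Fun) → (∀ k → Span S (F k)) → Span S (λ Q → sumℕ n (λ k → F k Q))
  Span-sumℕ zero    F F∈S = zer
  Span-sumℕ (suc n) F F∈S = add (Span-sumℕ n F F∈S) (F∈S n)

  -- The coefficient of the line y = k x + b. The empty list gives the x-axis; each s applies
  -- the difference operator f (x , y) ↦ f (x , y - s x - 1) - f (x , y), which vanishes on the
  -- vertical s x + 1 = 0, where the shift is trivial.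
  weight : List ℤ → ℤ → ℤ → ℤ
  weight []       k b = δ k * δ b
  weight (s ∷ ds) k b = weight ds (k - s) (b - 1ℤ) - weight ds k b

  weight-cong : ∀ ds {k k′ b b′} → k ≋ k′ → b ≋ b′ → weight ds k b ≡ weight ds k′ b′
  weight-cong []       k≋k′ b≋b′ = cong₂ _*_ (δ-cong k≋k′) (δ-cong b≋b′)
  weight-cong (s ∷ ds) k≋k′ b≋b′ =
    cong₂ _-_ (weight-cong ds (minus-cong k≋k′ (≋-refl {s})) (minus-cong b≋b′ (≋-refl {1ℤ}))) (weight-cong ds k≋k′ b≋b′)

  codeword : List ℤ → Fun
  codeword ds Q = sumℕ p (λ k → sumℕ p (λ b → reduce (weight ds (+ k) (+ b)) ℕ.* χ (line (+ k) (+ b)) Q))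

  codeword-∈C : ∀ ds → InCode (codeword ds)
  codeword-∈C ds = Span-sumℕ p _ (λ k → Span-sumℕ p _ (λ b →
    smul (reduce (weight ds (+ k) (+ b))) (gen (line (+ k) (+ b) , λ Q → refl))))

  Λ : List ℤ → ℤ → ℤ → ℤ
  Λ ds x y = ∑ p (λ k → weight ds (+ k) (y - + k * x))

  Λ-cong : ∀ ds {x x′ y y′} → x ≋ x′ → y ≋ y′ → Λ ds x y ≋ Λ ds x′ y′
  Λ-cong ds {x} {x′} {y} {y′} x≋x′ y≋y′ =
    ∑-cong p (λ k → ≡⇒≋ (weight-cong ds (≋-refl {+ k}) (minus-cong y≋y′ (*-congˡ {+ k} x≋x′))))

  codeword-affine : ∀ ds {Q x y} → Q ∼ affine-vec x y → + codeword ds Q ≋ Λ ds x y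
  codeword-affine ds {Q} {x} {y} Q∼ = begin
    + codeword ds Q
      ≡⟨ trans (+sumℕ≡∑ p _) (∑-cong≡ p (λ k → +sumℕ≡∑ p _)) ⟩
    ∑ p (λ k → ∑ p (λ b → + (reduce (weight ds (+ k) (+ b)) ℕ.* χ (line (+ k) (+ b)) Q)))
      ≈⟨ ∑-cong p (λ k → ∑-cong p (λ b → ≋-trans (≡⇒≋ (ℤ.pos-* (reduce (weight ds (+ k) (+ b))) (χ (line (+ k) (+ b)) Q)))
           (*-cong (reduce-≋ (weight ds (+ k) (+ b))) (≡⇒≋ (χ-line {Q} {x} {y} (+ k) (+ b) Q∼))))) ⟩
    ∑ p (λ k → ∑ p (λ b → weight ds (+ k) (+ b) * δ (+ b - (y - + k * x))))
      ≈⟨ ∑-cong p (λ k → ∑-δ (weight ds (+ k)) (λ b≋b′ → ≡⇒≋ (weight-cong ds (≋-refl {+ k}) b≋b′)) (y - + k * x)) ⟩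
    Λ ds x y ∎
    where open ≋-Reasoning

  Λ-step : ∀ s ds x y → Λ (s ∷ ds) x y ≋ Λ ds x (y - s * x - 1ℤ) - Λ ds x y
  Λ-step s ds x y = ≋-trans (≡⇒≋ (∑-distrib-- p _ _)) (minus-cong shifted (≋-refl {Λ ds x y}))
    where
    F : ℤ → ℤ
    F z = weight ds z (y - s * x - 1ℤ - z * x)
    regroup : ∀ y s x k → y - k * x - 1ℤ ≡ y - s * x - 1ℤ - (k + - s) * x
    regroup = solve-∀
    shifted : ∑ p (λ k → weight ds (+ k - s) (y - + k * x - 1ℤ)) ≋ Λ ds x (y - s * x - 1ℤ)
    shifted = ≋-trans (≡⇒≋ (∑-cong≡ p (λ k → cong (weight ds (+ k - s)) (regroup y s x (+ k)))))
      (∑-shift (- s) F (λ {a} {b} a≋b → ≡⇒≋ (weight-cong ds a≋b (minus-cong (≋-refl {y - s * x - 1ℤ}) (*-congʳ a≋b)))))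

  Λ-vanishes : ∀ ds x → Any (λ s → s * x + 1ℤ ≋ 0ℤ) ds → ∀ y → Λ ds x y ≋ 0ℤ
  Λ-vanishes (s ∷ ds) x (here sx+1≋0) y = ≋-trans (Λ-step s ds x y)
    (≋-trans (minus-cong (Λ-cong ds (≋-refl {x}) unshifted) (≋-refl {Λ ds x y})) (≡⇒≋ (ℤ.+-inverseʳ (Λ ds x y))))
    where unshifted : y - s * x - 1ℤ ≋ y
          unshifted = ≋-trans (≡⇒≋ (regroup y (s * x))) (≋-trans (minus-cong (≋-refl {y}) sx+1≋0) (≡⇒≋ (ℤ.+-identityʳ y)))
            where regroup : ∀ y u → y - u - 1ℤ ≡ y - (u + 1ℤ)
                  regroup = solve-∀
  Λ-vanishes (s ∷ ds) x (there rest) y = ≋-trans (Λ-step s ds x y)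
    (≋-trans (minus-cong (Λ-vanishes ds x rest (y - s * x - 1ℤ)) (Λ-vanishes ds x rest y)) ≋-refl)

  Λ-[] : ∀ x y → Λ [] x y ≋ δ y
  Λ-[] x y = ≋-trans (∑-cong p (λ k → ≡⇒≋ (trans (ℤ.*-comm (δ (+ k)) (δ (y - + k * x)))
                                             (cong (δ (y - + k * x) *_) (δ-cong (≡⇒≋ (sym (ℤ.+-identityʳ (+ k)))))))))
    (≋-trans (∑-δ (λ z → δ (y - z * x)) (λ z≋z′ → ≡⇒≋ (δ-cong (minus-cong (≋-refl {y}) (*-congʳ z≋z′)))) 0ℤ)
             (≡⇒≋ (δ-cong (≡⇒≋ (cancel y x)))))
    where cancel : ∀ y x → y - 0ℤ * x ≡ y
          cancel = solve-∀

  -- Summation by parts against the falling factorials, one difference operator at a time.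
  ∑-falling-Λ-axis : ∀ es → ∑ p (λ k → falling (length es) (+ k) * Λ es 0ℤ (+ k)) ≋ + (length es !)
  ∑-falling-Λ-axis [] = ≋-trans (∑-cong p (λ k → ≋-trans (*-congˡ {1ℤ} (Λ-[] 0ℤ (+ k)))
                                            (≡⇒≋ (cong (1ℤ *_) (δ-cong (≡⇒≋ (sym (ℤ.+-identityʳ (+ k)))))))))
                                (∑-δ (λ _ → 1ℤ) (λ _ → ≋-refl) 0ℤ)
  ∑-falling-Λ-axis (s ∷ es) = begin
    ∑ p (λ k → falling (suc j) (+ k) * Λ (s ∷ es) 0ℤ (+ k))
      ≈⟨ ∑-cong p (λ k → *-congˡ {falling (suc j) (+ k)} (step (+ k))) ⟩
    ∑ p (λ k → falling (suc j) (+ k) * (G (+ k - 1ℤ) - G (+ k)))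
      ≡⟨ trans (∑-cong≡ p (λ k → distribˡ (falling (suc j) (+ k)) (G (+ k - 1ℤ)) (G (+ k)))) (∑-distrib-- p _ _) ⟩
    ∑ p (λ k → falling (suc j) (+ k) * G (+ k - 1ℤ)) - ∑ p (λ k → falling (suc j) (+ k) * G (+ k))
      ≈⟨ minus-cong (≋-sym (≋-trans (∑-cong p (λ k → *-congˡ {falling (suc j) (+ k + 1ℤ)} (Λ-cong es ≋-refl (≡⇒≋ (sym (cancel (+ k)))))))
                                    (∑-shift 1ℤ F F-cong)))
                    (≋-refl {∑ p (λ k → falling (suc j) (+ k) * G (+ k))}) ⟩
    ∑ p (λ k → falling (suc j) (+ k + 1ℤ) * G (+ k)) - ∑ p (λ k → falling (suc j) (+ k) * G (+ k))
      ≡⟨ sym (trans (∑-cong≡ p (λ k → distribʳ (falling (suc j) (+ k + 1ℤ)) (falling (suc j) (+ k)) (G (+ k)))) (∑-distrib-- p _ _)) ⟩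
    ∑ p (λ k → (falling (suc j) (+ k + 1ℤ) - falling (suc j) (+ k)) * G (+ k))
      ≡⟨ trans (∑-cong≡ p (λ k → trans (cong (_* G (+ k)) (falling-difference j (+ k))) (ℤ.*-assoc (+ suc j) (falling j (+ k)) _)))
               (∑-*ˡ p (+ suc j) _) ⟩
    + suc j * ∑ p (λ k → falling j (+ k) * G (+ k))
      ≈⟨ *-congˡ {+ suc j} (∑-falling-Λ-axis es) ⟩
    + suc j * + (j !)
      ≡⟨ ℤ.pos-* (suc j) (j !) ⟨
    + (suc j !) ∎
    where
    open ≋-Reasoning
    j = length es
    G : ℤ → ℤ
    G = Λ es 0ℤ
    F : ℤ → ℤ
    F z = falling (suc j) z * G (z - 1ℤ)
    F-cong : ∀ {a b} → a ≋ b → F a ≋ F b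
    F-cong a≋b = *-cong (falling-cong (suc j) a≋b) (Λ-cong es (≋-refl {0ℤ}) (minus-cong a≋b (≋-refl {1ℤ})))
    step : ∀ y → Λ (s ∷ es) 0ℤ y ≋ G (y - 1ℤ) - G y
    step y = ≋-trans (Λ-step s es 0ℤ y) (minus-cong (Λ-cong es (≋-refl {0ℤ}) (≡⇒≋ (drop y s))) (≋-refl {G y}))
      where drop : ∀ y s → y - s * 0ℤ - 1ℤ ≡ y - 1ℤ
            drop = solve-∀
    cancel : ∀ k → k + 1ℤ - 1ℤ ≡ k
    cancel = solve-∀
    distribˡ : ∀ a b c → a * (b - c) ≡ a * b - a * c
    distribˡ = solve-∀
    distribʳ : ∀ a b c → (a - b) * c ≡ a * c - b * c
    distribʳ = solve-∀

module Moments (p : ℕ) .{{_ : NonZero p}} (prime : Prime p)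
               (P L₀ L₁ : PG.Point p) (P∈L₀ : PG._∈L_ p P L₀) (P∈L₁ : PG._∈L_ p P L₁)
               (L₀≢L₁ : proj₁ L₀ ≢ proj₁ L₁) where
  open import Data.Nat as ℕ using (ℕ; zero; suc; NonZero; _≤_; _<_; s≤s)
  open import Data.Nat.Primality using (Prime)
  import Data.Nat.Properties as ℕ
  open import Data.Integer using (ℤ; +_; _+_; _*_; -_; _-_; 0ℤ; 1ℤ; _^_)
  import Data.Integer.Properties as ℤ
  open import Data.Integer.Tactic.RingSolver using (solve-∀)
  open import Data.Vec using (Vec)
  open import Data.Bool using (Bool; true; false; not)
  import Data.Bool.Properties as Bool
  open import Data.Fin using (Fin)
  import Data.Fin.Properties as Fin
  open import Data.Product using (_,_; proj₁; proj₂)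
  open import Data.Empty using (⊥-elim)
  open import Relation.Nullary using (¬_; Dec; yes; no; does)
  open import Relation.Nullary.Decidable using (dec-true; dec-false)
  open import Relation.Binary.PropositionalEquality
  open import Relation.Binary.Core using (_Preserves_⟶_)
  open Counting

  open Modular p prime
  open PG p
  open Projective p prime
  open Summation p prime
  open Polynomial p prime
  open Frame p prime P L₀ L₁ P∈L₀ P∈L₁ L₀≢L₁

  moment : ℕ → Fun → ℤ → ℤ
  moment j c a = ∑ p (λ k → falling j (+ k) * + c (affine a (+ k)))

  moment-at-infinity : ℕ → Fun → ℤ
  moment-at-infinity j c = ∑ p (λ k → (+ k) ^ j * + c (at-infinity (+ k)))

  record MomentPolynomial (j : ℕ) (c : Fun) : Set where
    field
      coefficients       : Vec ℤ (suc j)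
      moment≋eval        : ∀ a → moment j c a ≋ eval coefficients a
      top≋at-infinity    : top coefficients ≋ moment-at-infinity j c

  private
    moment-cong : ∀ j {c c′} → (∀ Q → + c Q ≋ + c′ Q) → ∀ a → moment j c a ≋ moment j c′ a
    moment-cong j c≋c′ a = ∑-cong p (λ k → *-congˡ {falling j (+ k)} (c≋c′ (affine a (+ k))))

    moment-at-infinity-cong : ∀ j {c c′} → (∀ Q → + c Q ≋ + c′ Q) → moment-at-infinity j c ≋ moment-at-infinity j c′
    moment-at-infinity-cong j c≋c′ = ∑-cong p (λ k → *-congˡ {(+ k) ^ j} (c≋c′ (at-infinity (+ k))))

    MomentPolynomial-cong : ∀ j {c c′} → (∀ Q → + c Q ≋ + c′ Q) → MomentPolynomial j c′ → MomentPolynomial j c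
    MomentPolynomial-cong j c≋c′ F = record
      { coefficients    = coefficients
      ; moment≋eval     = λ a → ≋-trans (moment-cong j c≋c′ a) (moment≋eval a)
      ; top≋at-infinity = ≋-trans top≋at-infinity (≋-sym (moment-at-infinity-cong j c≋c′))
      }
      where open MomentPolynomial F

    ^-cong : ∀ j → (λ z → z ^ j) Preserves _≋_ ⟶ _≋_
    ^-cong zero    z≋z′ = ≋-refl
    ^-cong (suc j) z≋z′ = *-cong z≋z′ (^-cong j z≋z′)

    ∑-mul-+ : ∀ (w : ℕ → ℤ) (f g : ℕ → ℕ) → ∑ p (λ k → w k * + (f k ℕ.+ g k)) ≡ ∑ p (λ k → w k * + f k) + ∑ p (λ k → w k * + g k)
    ∑-mul-+ w f g = trans (∑-cong≡ p (λ k → trans (cong (w k *_) (ℤ.pos-+ (f k) (g k))) (ℤ.*-distribˡ-+ (w k) _ _))) (∑-distrib-+ p _ _)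

    ∑-mul-* : ∀ (w : ℕ → ℤ) n (f : ℕ → ℕ) → ∑ p (λ k → w k * + (n ℕ.* f k)) ≡ + n * ∑ p (λ k → w k * + f k)
    ∑-mul-* w n f = trans (∑-cong≡ p (λ k → trans (cong (w k *_) (ℤ.pos-* n (f k))) (swap (w k) (+ n) _))) (∑-*ˡ p (+ n) _)
      where swap : ∀ a s x → a * (s * x) ≡ s * (a * x)
            swap = solve-∀

    through-P : ∀ j → suc j < p → ∀ L → β L ≋ 0ℤ → MomentPolynomial j (χ L)
    through-P j 1+j<p L βL≋0 = record
      { coefficients = 0ₚ (suc j)
      ; moment≋eval = λ a → ≋-trans (moment≋0 a) (≋-sym (eval-0ₚ (suc j) a))
      ; top≋at-infinity = ≋-trans (≡⇒≋ (top-0ₚ j)) (≋-sym at-infinity≋0)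
      }
      where
      drop : ∀ a k → a + + k * β L ≋ a
      drop a k = ≋-trans (+-congˡ {a} (≋-trans (*-congˡ {+ k} βL≋0) (≡⇒≋ (ℤ.*-zeroʳ (+ k))))) (≡⇒≋ (ℤ.+-identityʳ a))
      moment≋0 : ∀ a → moment j (χ L) a ≋ 0ℤ
      moment≋0 a = begin
        ∑ p (λ k → falling j (+ k) * + χ L (affine a (+ k)))         ≡⟨ ∑-cong≡ p (λ k → cong (falling j (+ k) *_) (trans (χ-affine L a (+ k)) (δ-cong (drop (γ L + a * α L) k)))) ⟩
        ∑ p (λ k → falling j (+ k) * δ (γ L + a * α L))              ≡⟨ ∑-*ʳ p (λ k → falling j (+ k)) (δ (γ L + a * α L)) ⟩
        ∑ p (λ k → falling j (+ k)) * δ (γ L + a * α L)              ≈⟨ *-congʳ (∑-falling≋0 j 1+j<p) ⟩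
        0ℤ * δ (γ L + a * α L)                                       ≡⟨ ℤ.*-zeroˡ (δ (γ L + a * α L)) ⟩
        0ℤ                                                           ∎
        where open ≋-Reasoning
      at-infinity≋0 : moment-at-infinity j (χ L) ≋ 0ℤ
      at-infinity≋0 = begin
        ∑ p (λ k → (+ k) ^ j * + χ L (at-infinity (+ k)))            ≡⟨ ∑-cong≡ p (λ k → cong ((+ k) ^ j *_) (trans (χ-at-infinity L (+ k)) (δ-cong (drop (α L) k)))) ⟩
        ∑ p (λ k → (+ k) ^ j * δ (α L))                              ≡⟨ ∑-*ʳ p (λ k → (+ k) ^ j) (δ (α L)) ⟩
        ∑ p (λ k → (+ k) ^ j) * δ (α L)                              ≈⟨ *-congʳ (∑-power≋0 j 1+j<p) ⟩
        0ℤ * δ (α L)                                                 ≡⟨ ℤ.*-zeroˡ (δ (α L)) ⟩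
        0ℤ                                                           ∎
        where open ≋-Reasoning

    -- A line not through P meets the vertical x = a in the single point y = c₀ + c₁ a.
    not-through-P : ∀ j L → β L ≉ 0ℤ → MomentPolynomial j (χ L)
    not-through-P j L βL≉0 = record
      { coefficients    = falling-poly c₀ c₁ j
      ; moment≋eval     = λ a → ≋-trans (moment≋ a) (≡⇒≋ (sym (eval-falling-poly c₀ c₁ j a)))
      ; top≋at-infinity = ≋-trans (≡⇒≋ (top-falling-poly c₀ c₁ j)) (≋-sym at-infinity≋)
      }
      where
      c₀ = - γ L * β L ⁻¹
      c₁ = - α L * β L ⁻¹
      solve-for-k : ∀ r k → δ (r + + k * β L) ≡ δ (+ k - (- r * β L ⁻¹))
      solve-for-k r k = trans (δ-cong (≋-sym (begin
        β L * (+ k - (- r * β L ⁻¹))   ≡⟨ expand (β L) (+ k) r (β L ⁻¹) ⟩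
        β L * + k + r * (β L * β L ⁻¹) ≈⟨ +-congˡ {β L * + k} (*-congˡ {r} (⁻¹-inverseʳ βL≉0)) ⟩
        β L * + k + r * 1ℤ             ≡⟨ collect (β L) (+ k) r ⟩
        r + + k * β L                  ∎))) (δ-*-≉0 βL≉0)
        where
        open ≋-Reasoning
        expand : ∀ b k r i → b * (k - (- r * i)) ≡ b * k + r * (b * i)
        expand = solve-∀
        collect : ∀ b k r → b * k + r * 1ℤ ≡ r + k * b
        collect = solve-∀
      moment≋ : ∀ a → moment j (χ L) a ≋ falling j (c₀ + c₁ * a)
      moment≋ a = ≋-trans (≡⇒≋ (∑-cong≡ p (λ k → cong (falling j (+ k) *_) (trans (χ-affine L a (+ k)) (solve-for-k (γ L + a * α L) k)))))
        (≋-trans (∑-δ (falling j) (falling-cong j) (- (γ L + a * α L) * β L ⁻¹)) (≡⇒≋ (cong (falling j) (linear (γ L) (α L) a (β L ⁻¹)))))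
        where linear : ∀ g l a i → - (g + a * l) * i ≡ - g * i + - l * i * a
              linear = solve-∀
      at-infinity≋ : moment-at-infinity j (χ L) ≋ c₁ ^ j
      at-infinity≋ = ≋-trans (≡⇒≋ (∑-cong≡ p (λ k → cong ((+ k) ^ j *_) (trans (χ-at-infinity L (+ k)) (solve-for-k (α L) k)))))
        (∑-δ (λ z → z ^ j) (^-cong j) c₁)

    ≈⇒≋ : ∀ {c c′} → c ≈ c′ → ∀ Q → + c Q ≋ + c′ Q
    ≈⇒≋ c≈c′ Q = %≡⇒≋ (c≈c′ Q)

  moment-polynomial : ∀ j → suc j < p → ∀ {c} → InCode c → MomentPolynomial j c
  moment-polynomial j 1+j<p (gen (L , c≈χL)) with β L ≋? 0ℤ
  ... | yes βL≋0 = MomentPolynomial-cong j (≈⇒≋ c≈χL) (through-P j 1+j<p L βL≋0)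
  ... | no βL≉0  = MomentPolynomial-cong j (≈⇒≋ c≈χL) (not-through-P j L βL≉0)
  moment-polynomial j 1+j<p zer = record
    { coefficients    = 0ₚ (suc j)
    ; moment≋eval     = λ a → ≋-trans (∑-zero p (λ k → ≡⇒≋ (ℤ.*-zeroʳ (falling j (+ k))))) (≋-sym (eval-0ₚ (suc j) a))
    ; top≋at-infinity = ≋-trans (≡⇒≋ (top-0ₚ j)) (≋-sym (∑-zero p (λ k → ≡⇒≋ (ℤ.*-zeroʳ ((+ k) ^ j)))))
    }
  moment-polynomial j 1+j<p (add {f} {g} f∈C g∈C) = record
    { coefficients    = coefficients F +ₚ coefficients G
    ; moment≋eval     = λ a → ≋-trans (≡⇒≋ (∑-mul-+ (λ k → falling j (+ k)) (λ k → f (affine a (+ k))) (λ k → g (affine a (+ k)))))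
                                (≋-trans (+-cong (moment≋eval F a) (moment≋eval G a)) (≡⇒≋ (sym (eval-+ₚ (coefficients F) (coefficients G) a))))
    ; top≋at-infinity = ≋-trans (≡⇒≋ (top-+ₚ (coefficients F) (coefficients G)))
                                (≋-trans (+-cong (top≋at-infinity F) (top≋at-infinity G))
                                         (≡⇒≋ (sym (∑-mul-+ (λ k → (+ k) ^ j) (λ k → f (at-infinity (+ k))) (λ k → g (at-infinity (+ k)))))))
    }
    where
    open MomentPolynomial
    F = moment-polynomial j 1+j<p f∈C
    G = moment-polynomial j 1+j<p g∈C
  moment-polynomial j 1+j<p (smul {f} n f∈C) = record
    { coefficients    = + n *ₚ coefficients F
    ; moment≋eval     = λ a → ≋-trans (≡⇒≋ (∑-mul-* (λ k → falling j (+ k)) n (λ k → f (affine a (+ k)))))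
                                (≋-trans (*-congˡ {+ n} (moment≋eval F a)) (≡⇒≋ (sym (eval-*ₚ (+ n) (coefficients F) a))))
    ; top≋at-infinity = ≋-trans (≡⇒≋ (top-*ₚ (+ n) (coefficients F)))
                                (≋-trans (*-congˡ {+ n} (top≋at-infinity F))
                                         (≡⇒≋ (sym (∑-mul-* (λ k → (+ k) ^ j) n (λ k → f (at-infinity (+ k)))))))
    }
    where
    open MomentPolynomial
    F = moment-polynomial j 1+j<p f∈C
  moment-polynomial j 1+j<p (resp c≈c′ c∈C) =
    MomentPolynomial-cong j (λ Q → ≋-sym (≈⇒≋ c≈c′ Q)) (moment-polynomial j 1+j<p c∈C)

  private
    not≡true : ∀ {b} → not b ≡ true → b ≡ false
    not≡true {false} _ = refl

    true≢false : true ≢ false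
    true≢false ()

    -- A line through P other than L₀ is a vertical x = a for exactly one a; L₀ is none.
    verticals-≤ : ∀ L → β L ≋ 0ℤ → (d : Dec (α L ≋ 0ℤ)) → count (λ a → does (γ L + + a * α L ≋? 0ℤ)) p ≤ 𝟙 (not (does d))
    verticals-≤ L βL≋0 (yes αL≋0) = ℕ.≤-reflexive (count-zero p _ λ a _ → dec-false (γ L + + a * α L ≋? 0ℤ) (off a))
      where off : ∀ a → γ L + + a * α L ≉ 0ℤ
            off a on = α≋0⇒γ≉0 L βL≋0 αL≋0 (≋-trans (≋-sym γ+aα≋γ) on)
              where γ+aα≋γ = ≋-trans (+-congˡ {γ L} (≋-trans (*-congˡ {+ a} αL≋0) (≡⇒≋ (ℤ.*-zeroʳ (+ a))))) (≡⇒≋ (ℤ.+-identityʳ (γ L)))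
    verticals-≤ L βL≋0 (no αL≉0) = count-≤1 p _ unique
      where
      cancel : ∀ {g u v} → g + u ≋ g + v → u ≋ v
      cancel {g} {u} {v} g+u≋g+v = ≋-trans (≡⇒≋ (sym (restore g u))) (≋-trans (minus-cong g+u≋g+v (≋-refl {g})) (≡⇒≋ (restore g v)))
        where restore : ∀ g u → g + u - g ≡ u
              restore = solve-∀
      unique : ∀ a b → a < p → b < p → does (γ L + + a * α L ≋? 0ℤ) ≡ true → does (γ L + + b * α L ≋? 0ℤ) ≡ true → a ≡ b
      unique a b a<p b<p on-a on-b = ≋⇒≡-below-p a<p b<p (*-cancelˡ-≋ αL≉0 (≋-trans (≡⇒≋ (ℤ.*-comm (α L) (+ a)))
        (≋-trans (cancel {γ L} (≋-trans (does⇒ (γ L + + a * α L ≋? 0ℤ) on-a) (≋-sym (does⇒ (γ L + + b * α L ≋? 0ℤ) on-b)))) (≡⇒≋ (ℤ.*-comm (+ b) (α L))))))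

    -- The moment polynomial vanishes at the verticals missed by the cover, and so does its top
    -- coefficient when L₀ is not in the cover.
    module Covered (j n : ℕ) (1+j<p : suc j < p) (j+n≤1+p : j ℕ.+ n ≤ suc p) {c : Fun} (cov : CoveredByFewer n P c) where
      c∈C = proj₁ cov
      k = proj₁ (proj₂ cov)
      k<n = proj₁ (proj₂ (proj₂ cov))
      ℓ = proj₁ (proj₂ (proj₂ (proj₂ cov)))
      P∈ℓ = proj₁ (proj₂ (proj₂ (proj₂ (proj₂ cov))))
      covers = proj₂ (proj₂ (proj₂ (proj₂ (proj₂ cov))))
      open MomentPolynomial (moment-polynomial j 1+j<p c∈C) renaming (coefficients to f)

      βℓ≋0 : ∀ t → β (ℓ t) ≋ 0ℤ
      βℓ≋0 t = ∈L⇒∙≋0 {ℓ t} {P} (P∈ℓ t)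

      vanishes-off-cover : ∀ Q → (∀ t → ¬ Q ∈L ℓ t) → + c Q ≋ 0ℤ
      vanishes-off-cover Q off with c Q ℕ.% p ℕ.≟ 0
      ... | yes cQ≡0 = %≡0⇒≋0 cQ≡0
      ... | no cQ≢0 = ⊥-elim (off (proj₁ (covers Q cQ≢0)) (proj₂ (covers Q cQ≢0)))

      hits : ℕ → Bool
      hits x = anyᶠ k (λ t → does (γ (ℓ t) + + x * α (ℓ t) ≋? 0ℤ))

      moment-off-cover : ∀ x → not (hits x) ≡ true → moment j c (+ x) ≋ 0ℤ
      moment-off-cover x off = ∑-zero p (λ y → ≋-trans (*-congˡ {falling j (+ y)} (vanishes-off-cover (affine (+ x) (+ y)) (missed y)))
                                                       (≡⇒≋ (ℤ.*-zeroʳ (falling j (+ y)))))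
        where
        missed : ∀ y t → ¬ affine (+ x) (+ y) ∈L ℓ t
        missed y t on = true≢false (trans (sym hit) (not≡true off))
          where
          hit : hits x ≡ true
          hit = anyᶠ-intro k (λ t → does (γ (ℓ t) + + x * α (ℓ t) ≋? 0ℤ)) t
                  (dec-true (γ (ℓ t) + + x * α (ℓ t) ≋? 0ℤ) (∈L-affine⇒ {ℓ t} {affine (+ x) (+ y)} {+ x} {+ y} (βℓ≋0 t) (affine-∼ (+ x) (+ y)) on))

      vertical : Fin k → Bool
      vertical t = not (does (α (ℓ t) ≋? 0ℤ))

      hits-≤ : count hits p ≤ sumᶠ k (λ t → 𝟙 (vertical t))
      hits-≤ = ℕ.≤-trans (count-anyᶠ p k _) (sumᶠ-mono k (λ t → verticals-≤ (ℓ t) (βℓ≋0 t) (α (ℓ t) ≋? 0ℤ)))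

      j+k≤p : j ℕ.+ k ≤ p
      j+k≤p = ℕ.≤-pred (ℕ.≤-trans (ℕ.≤-reflexive (sym (ℕ.+-suc j k))) (ℕ.≤-trans (ℕ.+-monoʳ-≤ j k<n) j+n≤1+p))

      roots-off-cover : ∀ {d} (g : Vec ℤ d) → (∀ x → eval g x ≋ moment j c x) → ∀ x → x < p → not (hits x) ≡ true → is-root g x ≡ true
      roots-off-cover g g≋moment x _ off = is-root-intro g x (≋-trans (g≋moment (+ x)) (moment-off-cover x off))

      with-L₀ : ∀ t₀ → α (ℓ t₀) ≋ 0ℤ → ∀ a → moment j c a ≋ 0ℤ
      with-L₀ t₀ αℓ≋0 a = ≋-trans (moment≋eval a) (root-bound (suc j) f (ℕ.≤-trans enough (count-mono p (roots-off-cover f (λ x → ≋-sym (moment≋eval x))))) a)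
        where
        verticals<k : sumᶠ k (λ t → 𝟙 (vertical t)) < k
        verticals<k = sumᶠ-< k _ (λ t → 𝟙≤1 (vertical t)) t₀ (cong (λ b → 𝟙 (not b)) (dec-true (α (ℓ t₀) ≋? 0ℤ) αℓ≋0))
        enough : suc j ≤ count (λ x → not (hits x)) p
        enough = ℕ.+-cancelˡ-≤ k (suc j) _ (begin
          k ℕ.+ suc j                                                            ≡⟨ trans (ℕ.+-suc k j) (cong suc (ℕ.+-comm k j)) ⟩
          suc (j ℕ.+ k)                                                          ≤⟨ s≤s j+k≤p ⟩
          suc p                                                                  ≡⟨ cong suc (count-complement p hits) ⟨
          suc (count hits p ℕ.+ count (λ x → not (hits x)) p)                    ≤⟨ s≤s (ℕ.+-monoˡ-≤ _ hits-≤) ⟩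
          suc (sumᶠ k (λ t → 𝟙 (vertical t))) ℕ.+ count (λ x → not (hits x)) p  ≤⟨ ℕ.+-monoˡ-≤ _ verticals<k ⟩
          k ℕ.+ count (λ x → not (hits x)) p                                     ∎)
          where open ℕ.≤-Reasoning

      without-L₀ : (∀ t → α (ℓ t) ≉ 0ℤ) → ∀ a → moment j c a ≋ 0ℤ
      without-L₀ all-vertical a = ≋-trans (moment≋eval a) (≋-trans (eval-drop-top f a top≋0)
        (root-bound j (drop-top f) (ℕ.≤-trans enough (count-mono p (roots-off-cover (drop-top f) lower))) a))
        where
        at-infinity≋0 : moment-at-infinity j c ≋ 0ℤ
        at-infinity≋0 = ∑-zero p (λ z → ≋-trans (*-congˡ {(+ z) ^ j} (vanishes-off-cover (at-infinity (+ z))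
          (λ t on → all-vertical t (∈L-at-infinity⇒ {ℓ t} (+ z) (βℓ≋0 t) on)))) (≡⇒≋ (ℤ.*-zeroʳ ((+ z) ^ j))))
        top≋0 : top f ≋ 0ℤ
        top≋0 = ≋-trans top≋at-infinity at-infinity≋0
        lower : ∀ x → eval (drop-top f) x ≋ moment j c x
        lower x = ≋-sym (≋-trans (moment≋eval x) (eval-drop-top f x top≋0))
        enough : j ≤ count (λ x → not (hits x)) p
        enough = ℕ.+-cancelˡ-≤ k j _ (begin
          k ℕ.+ j                                                     ≡⟨ ℕ.+-comm k j ⟩
          j ℕ.+ k                                                     ≤⟨ j+k≤p ⟩
          p                                                           ≡⟨ count-complement p hits ⟨
          count hits p ℕ.+ count (λ x → not (hits x)) p               ≤⟨ ℕ.+-monoˡ-≤ _ (ℕ.≤-trans hits-≤ (sumᶠ-≤ k _ (λ t → 𝟙≤1 (vertical t)))) ⟩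
          k ℕ.+ count (λ x → not (hits x)) p                          ∎)
          where open ℕ.≤-Reasoning

      moment≋0 : ∀ a → moment j c a ≋ 0ℤ
      moment≋0 with Fin.any? (λ t → α (ℓ t) ≋? 0ℤ)
      ... | yes (t₀ , αℓ≋0) = with-L₀ t₀ αℓ≋0
      ... | no none        = without-L₀ (λ t αℓ≋0 → none (t , αℓ≋0))

  covered⇒moment≋0 : ∀ j n → suc j < p → j ℕ.+ n ≤ suc p → ∀ {c} → CoveredByFewer n P c → ∀ a → moment j c a ≋ 0ℤ
  covered⇒moment≋0 j n 1+j<p j+n≤1+p cov = Covered.moment≋0 j n 1+j<p j+n≤1+p cov

  moment-+ : ∀ j f g a → moment j (λ Q → f Q ℕ.+ g Q) a ≡ moment j f a + moment j g a
  moment-+ j f g a = ∑-mul-+ (λ k → falling j (+ k)) (λ k → f (affine a (+ k))) (λ k → g (affine a (+ k)))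

  moment-* : ∀ j n f a → moment j (λ Q → n ℕ.* f Q) a ≡ + n * moment j f a
  moment-* j n f a = ∑-mul-* (λ k → falling j (+ k)) n (λ k → f (affine a (+ k)))

  Span⇒moment≋0 : ∀ j a {S : Fun → Set} → (∀ {c} → S c → moment j c a ≋ 0ℤ) → ∀ {c} → Span S c → moment j c a ≋ 0ℤ
  Span⇒moment≋0 j a S⇒0 (gen c∈S) = S⇒0 c∈S
  Span⇒moment≋0 j a S⇒0 zer = ∑-zero p (λ k → ≡⇒≋ (ℤ.*-zeroʳ (falling j (+ k))))
  Span⇒moment≋0 j a S⇒0 (add {f} {g} f∈ g∈) =
    ≋-trans (≡⇒≋ (moment-+ j f g a)) (≋-trans (+-cong (Span⇒moment≋0 j a S⇒0 f∈) (Span⇒moment≋0 j a S⇒0 g∈)) ≋-refl)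
  Span⇒moment≋0 j a S⇒0 (smul {f} n f∈) =
    ≋-trans (≡⇒≋ (moment-* j n f a)) (≋-trans (*-congˡ {+ n} (Span⇒moment≋0 j a S⇒0 f∈)) (≡⇒≋ (ℤ.*-zeroʳ (+ n))))
  Span⇒moment≋0 j a S⇒0 (resp f≈g f∈) = ≋-trans (moment-cong j (λ Q → ≋-sym (≈⇒≋ f≈g Q)) a) (Span⇒moment≋0 j a S⇒0 f∈)

module Theorem (p : ℕ) .{{_ : NonZero p}} (prime : Prime p) (n′ : ℕ)
               (P : PG.Point p) (ℓ : Fin (suc (suc (suc n′))) → PG.Line p)
               (ℓ-injective : Injective _≡_ _≡_ (proj₁ ∘ ℓ)) (P∈ℓ : ∀ i → PG._∈L_ p P (ℓ i)) where
  open import Data.Nat as ℕ using (ℕ; zero; suc; NonZero; _≤_; _<_; s≤s; _!)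
  open import Data.Nat.Primality using (Prime)
  import Data.Nat.Properties as ℕ
  open import Data.Integer using (ℤ; +_; _+_; _*_; -_; _-_; 0ℤ; 1ℤ; _^_)
  import Data.Integer.Properties as ℤ
  open import Data.Integer.Tactic.RingSolver using (solve-∀)
  open import Data.Vec using (Vec)
  open import Data.List using (List; []; _∷_; length)
  open import Data.List.Relation.Unary.Any using (Any; here; there)
  open import Data.Bool using (Bool; true; false; not; if_then_else_)
  import Data.Bool.Properties as Bool
  open import Data.Fin using (Fin)
  import Data.Fin as Fin
  import Data.Fin.Properties as Fin
  open import Data.Product using (Σ; _×_; _,_; proj₁)
  open import Data.Sum using (inj₁; inj₂)
  open import Data.Empty using (⊥; ⊥-elim)
  open import Function using (_∘_)
  open import Function.Definitions using (Injective)
  open import Relation.Nullary using (¬_; yes; no; does)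
  open import Relation.Nullary.Decidable using (dec-true)
  open import Relation.Binary.PropositionalEquality
  open Counting

  open Modular p prime
  open PG p
  open Projective p prime
  open Summation p prime
  open Polynomial p prime

  n : ℕ
  n = 3 ℕ.+ n′

  L₀≢L₁ : proj₁ (ℓ Fin.zero) ≢ proj₁ (ℓ (Fin.suc Fin.zero))
  L₀≢L₁ e with ℓ-injective e
  ... | ()

  open Frame p prime P (ℓ Fin.zero) (ℓ (Fin.suc Fin.zero)) (P∈ℓ Fin.zero) (P∈ℓ (Fin.suc Fin.zero)) L₀≢L₁
  open Codeword p prime P (ℓ Fin.zero) (ℓ (Fin.suc Fin.zero)) (P∈ℓ Fin.zero) (P∈ℓ (Fin.suc Fin.zero)) L₀≢L₁
  open Moments p prime P (ℓ Fin.zero) (ℓ (Fin.suc Fin.zero)) (P∈ℓ Fin.zero) (P∈ℓ (Fin.suc Fin.zero)) L₀≢L₁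

  βℓ≋0 : ∀ i → β (ℓ i) ≋ 0ℤ
  βℓ≋0 i = ∈L⇒∙≋0 {ℓ i} {P} (P∈ℓ i)

  -- The vertical x = a is one of the lines ℓ i.
  on-ℓ : ℕ → Bool
  on-ℓ x = anyᶠ n (λ i → does (γ (ℓ i) + + x * α (ℓ i) ≋? 0ℤ))

  -- The factors s = -1/a of the codeword: one for each vertical x = a missing from ℓ.
  slopes : ℕ → List ℤ
  slopes zero    = []
  slopes (suc x) = if on-ℓ x then slopes x else (- ((+ x) ⁻¹) ∷ slopes x)

  length-slopes : ∀ m → length (slopes m) ≡ count (λ x → not (on-ℓ x)) m
  length-slopes zero = refl
  length-slopes (suc m) with on-ℓ m
  ... | true  = trans (length-slopes m) (sym (ℕ.+-identityʳ _))
  ... | false = trans (cong suc (length-slopes m)) (ℕ.+-comm 1 _)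

  0-on-ℓ : on-ℓ 0 ≡ true
  0-on-ℓ = anyᶠ-intro n (λ i → does (γ (ℓ i) + 0ℤ * α (ℓ i) ≋? 0ℤ)) (Fin.suc Fin.zero) (dec-true (γ L₁ + 0ℤ * α L₁ ≋? 0ℤ)
    (≡⇒≋ (trans (cong (_+ 0ℤ * α L₁) L₁∙o≡0) (ℤ.*-zeroˡ (α L₁)))))
    where L₁ = ℓ (Fin.suc Fin.zero)

  slopes-kill : ∀ m x → x < m → x < p → on-ℓ x ≡ false → Any (λ s → s * + x + 1ℤ ≋ 0ℤ) (slopes m)
  slopes-kill (suc m) x x<1+m x<p off with x ℕ.≟ m
  ... | yes refl rewrite off = here (≋-trans (+-congʳ {b = 1ℤ} (≋-trans (≡⇒≋ (sym (ℤ.neg-distribˡ-* ((+ x) ⁻¹) (+ x))))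
                                                              (-‿cong (⁻¹-inverseˡ x≉0)))) (≋-refl {0ℤ}))
    where x≉0 : + x ≉ 0ℤ
          x≉0 x≋0 with ≋⇒≡-below-p x<p 0<p x≋0
          ... | refl = true≢false (trans (sym 0-on-ℓ) off)
            where true≢false : true ≢ false
                  true≢false ()
  ... | no x≢m with on-ℓ m
  ...   | true  = slopes-kill m x (ℕ.≤∧≢⇒< (ℕ.≤-pred x<1+m) x≢m) x<p off
  ...   | false = there (slopes-kill m x (ℕ.≤∧≢⇒< (ℕ.≤-pred x<1+m) x≢m) x<p off)

  α≉0 : ∀ i → α (ℓ (Fin.suc i)) ≉ 0ℤ
  α≉0 i αℓ≋0 = Fin.0≢1+n (sym (ℓ-injective {Fin.suc i} {Fin.zero} (α≋0⇒L₀ (ℓ (Fin.suc i)) (βℓ≋0 (Fin.suc i)) αℓ≋0)))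

  -- ℓ (suc i) is the vertical line x = intercept i.
  intercept : Fin (2 ℕ.+ n′) → ℕ
  intercept i = reduce (- γ (ℓ (Fin.suc i)) * α (ℓ (Fin.suc i)) ⁻¹)

  intercept<p : ∀ i → intercept i < p
  intercept<p i = reduce<p (- γ (ℓ (Fin.suc i)) * α (ℓ (Fin.suc i)) ⁻¹)

  intercept-on : ∀ i → γ (ℓ (Fin.suc i)) + + intercept i * α (ℓ (Fin.suc i)) ≋ 0ℤ
  intercept-on i = begin
    g + + intercept i * a        ≈⟨ +-congˡ {g} (*-congʳ (reduce-≋ (- g * a ⁻¹))) ⟩
    g + - g * a ⁻¹ * a           ≡⟨ regroup g a (a ⁻¹) ⟩
    g + - g * (a ⁻¹ * a)         ≈⟨ +-congˡ {g} (*-congˡ { - g} (⁻¹-inverseˡ (α≉0 i))) ⟩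
    g + - g * 1ℤ                 ≡⟨ cancel g ⟩
    0ℤ                           ∎
    where
    open ≋-Reasoning
    g = γ (ℓ (Fin.suc i))
    a = α (ℓ (Fin.suc i))
    regroup : ∀ g a i → g + - g * i * a ≡ g + - g * (i * a)
    regroup = solve-∀
    cancel : ∀ g → g + - g * 1ℤ ≡ 0ℤ
    cancel = solve-∀

  intercept-on-ℓ : ∀ i → on-ℓ (intercept i) ≡ true
  intercept-on-ℓ i = anyᶠ-intro n (λ i′ → does (γ (ℓ i′) + + intercept i * α (ℓ i′) ≋? 0ℤ)) (Fin.suc i)
    (dec-true (γ (ℓ (Fin.suc i)) + + intercept i * α (ℓ (Fin.suc i)) ≋? 0ℤ) (intercept-on i))

  intercept-injective : ∀ i i′ → intercept i ≡ intercept i′ → i ≡ i′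
  intercept-injective i i′ eq = Fin.suc-injective (ℓ-injective (same-intercept⇒≡ (ℓ (Fin.suc i)) (ℓ (Fin.suc i′)) (+ intercept i)
    (βℓ≋0 (Fin.suc i)) (βℓ≋0 (Fin.suc i′)) (intercept-on i) (subst (λ x → γ (ℓ (Fin.suc i′)) + + x * α (ℓ (Fin.suc i′)) ≋ 0ℤ) (sym eq) (intercept-on i′))))

  j : ℕ
  j = length (slopes p)

  j+2+n′≤p : j ℕ.+ (2 ℕ.+ n′) ≤ p
  j+2+n′≤p = begin
    j ℕ.+ (2 ℕ.+ n′)                                  ≤⟨ ℕ.+-mono-≤ (ℕ.≤-reflexive (length-slopes p))
                                                           (count-injective (2 ℕ.+ n′) p on-ℓ intercept intercept-injective intercept<p intercept-on-ℓ) ⟩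
    count (λ x → not (on-ℓ x)) p ℕ.+ count on-ℓ p      ≡⟨ ℕ.+-comm _ (count on-ℓ p) ⟩
    count on-ℓ p ℕ.+ count (λ x → not (on-ℓ x)) p      ≡⟨ count-complement p on-ℓ ⟩
    p                                                 ∎
    where open ℕ.≤-Reasoning

  j+n≤1+p : j ℕ.+ n ≤ suc p
  j+n≤1+p = ℕ.≤-trans (ℕ.≤-reflexive (ℕ.+-suc j (2 ℕ.+ n′))) (s≤s j+2+n′≤p)

  1+j<p : suc j < p
  1+j<p = ℕ.≤-trans (ℕ.≤-reflexive (ℕ.+-comm 2 j)) (ℕ.≤-trans (ℕ.+-monoʳ-≤ j (ℕ.m≤m+n 2 n′)) j+2+n′≤p)

  ds : List ℤ
  ds = slopes p

  cc : Fun
  cc = codeword ds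

  open MomentPolynomial (moment-polynomial j 1+j<p (codeword-∈C ds)) renaming (coefficients to f)

  moment-at-0≉0 : moment j cc 0ℤ ≉ 0ℤ
  moment-at-0≉0 m≋0 = !≉0 j (ℕ.<-trans ℕ.≤-refl 1+j<p) (≋-trans (≋-sym moment≋!) m≋0)
    where moment≋! : moment j cc 0ℤ ≋ + (j !)
          moment≋! = ≋-trans (∑-cong p (λ k → *-congˡ {falling j (+ k)} (codeword-affine ds {affine 0ℤ (+ k)} {0ℤ} {+ k} (affine-∼ 0ℤ (+ k)))))
                             (∑-falling-Λ-axis ds)

  not≡true : ∀ {b} → not b ≡ true → b ≡ false
  not≡true {b} e = trans (sym (Bool.not-involutive b)) (cong not e)

  vanishes-off-ℓ : ∀ {Q} x y → x < p → on-ℓ x ≡ false → Q ∼ affine-vec (+ x) y → + cc Q ≋ 0ℤ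
  vanishes-off-ℓ {Q} x y x<p off Q∼ = ≋-trans (codeword-affine ds {Q} {+ x} {y} Q∼) (Λ-vanishes ds (+ x) (slopes-kill p x x<p x<p off) y)

  roots-off-ℓ : ∀ {d} (g : Vec ℤ d) → (∀ x → eval g x ≋ moment j cc x) → ∀ x → x < p → not (on-ℓ x) ≡ true → is-root g x ≡ true
  roots-off-ℓ g g≋moment x x<p off = is-root-intro g x (≋-trans (g≋moment (+ x)) (∑-zero p (λ k →
    ≋-trans (*-congˡ {falling j (+ k)} (vanishes-off-ℓ {affine (+ x) (+ k)} x (+ k) x<p (not≡true off) (affine-∼ (+ x) (+ k))))
            (≡⇒≋ (ℤ.*-zeroʳ (falling j (+ k)))))))

  support : ∀ Q → InSupport cc Q → Σ (Fin n) λ i → Q ∈L ℓ i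
  support Q cQ≉0 with affine-or-on-L₀ Q
  ... | inj₁ Q∈L₀          = Fin.zero , Q∈L₀
  ... | inj₂ (x , y , Q∼) = on-some-ℓ (on-ℓ (reduce x)) refl
    where
    hit : ℕ → Fin n → Bool
    hit x i = does (γ (ℓ i) + + x * α (ℓ i) ≋? 0ℤ)
    on-some-ℓ : ∀ b → on-ℓ (reduce x) ≡ b → Σ (Fin n) λ i → Q ∈L ℓ i
    on-some-ℓ false off = ⊥-elim (cQ≉0 (≋0⇒%≡0 (≋-trans (codeword-affine ds {Q} {x} {y} Q∼)
      (≋-trans (Λ-cong ds (≋-sym (reduce-≋ x)) (≋-refl {y}))
               (Λ-vanishes ds (+ reduce x) (slopes-kill p (reduce x) (reduce<p x) (reduce<p x) off) y)))))
    on-some-ℓ true on with anyᶠ-elim n (hit (reduce x)) on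
    ... | i , on-i = i , ∈L-affine⇐ {ℓ i} {Q} {x} {y} (βℓ≋0 i) Q∼
      (≋-trans (+-congˡ {γ (ℓ i)} (*-congʳ (≋-sym (reduce-≋ x)))) (does⇒ (γ (ℓ i) + + reduce x * α (ℓ i) ≋? 0ℤ) on-i))

  private
    too-many-roots : ∀ {d} (g : Vec ℤ d) → d ≤ count (is-root g) p → eval g 0ℤ ≋ moment j cc 0ℤ → ⊥
    too-many-roots {d} g enough g≋moment = moment-at-0≉0 (≋-trans (≋-sym g≋moment) (root-bound d g enough 0ℤ))

    constant-sum : ∀ (w : ℕ → ℤ) (h : ℕ → ℕ) C → (∀ k → + h k ≋ C) → ∑ p w ≋ 0ℤ → ∑ p (λ k → w k * + h k) ≋ 0ℤ
    constant-sum w h C h≋C ∑w≋0 = ≋-trans (∑-cong p (λ k → *-congˡ {w k} (h≋C k)))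
      (≋-trans (≡⇒≋ (∑-*ʳ p w C)) (≋-trans (*-congʳ ∑w≋0) (≡⇒≋ (ℤ.*-zeroˡ C))))

  -- Constant on L₀ ∖ {P} would make the top coefficient vanish, leaving j roots for degree < j.
  odd-L₀ : ¬ ConstantOffP cc P (ℓ Fin.zero)
  odd-L₀ constant = too-many-roots (drop-top f)
    (ℕ.≤-trans (ℕ.≤-reflexive (length-slopes p)) (count-mono p (roots-off-ℓ (drop-top f) lower))) (lower 0ℤ)
    where
    on-L₀ : ∀ z → at-infinity z ∈L ℓ Fin.zero
    on-L₀ z = ∈L-at-infinity⇐ {ℓ Fin.zero} z L₀∙t≋0 (≡⇒≋ L₀∙s≡0)
    top≋0 : top f ≋ 0ℤ
    top≋0 = ≋-trans top≋at-infinity (constant-sum (λ k → (+ k) ^ j) (λ k → cc (at-infinity (+ k))) (+ cc (at-infinity 0ℤ))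
      (λ k → %≡⇒≋ (constant (at-infinity (+ k)) (at-infinity 0ℤ) (on-L₀ (+ k)) (on-L₀ 0ℤ) (at-infinity≢P (+ k)) (at-infinity≢P 0ℤ))) (∑-power≋0 j 1+j<p))
    lower : ∀ x → eval (drop-top f) x ≋ moment j cc x
    lower x = ≋-sym (≋-trans (moment≋eval x) (eval-drop-top f x top≋0))

  -- Constant on a vertical x = a would add the root a to the j roots off the lines ℓ.
  odd-vertical : ∀ i → ¬ ConstantOffP cc P (ℓ (Fin.suc i))
  odd-vertical i constant = too-many-roots f (subst (_< count (is-root f) p) (sym (length-slopes p)) more-roots) (≋-sym (moment≋eval 0ℤ))
    where
    a = intercept i
    on : ∀ y → affine (+ a) y ∈L ℓ (Fin.suc i)
    on y = ∈L-affine⇐ {ℓ (Fin.suc i)} {affine (+ a) y} {+ a} {y} (βℓ≋0 (Fin.suc i)) (affine-∼ (+ a) y) (intercept-on i)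
    moment-a≋0 : moment j cc (+ a) ≋ 0ℤ
    moment-a≋0 = constant-sum (λ k → falling j (+ k)) (λ k → cc (affine (+ a) (+ k))) (+ cc (affine (+ a) 0ℤ))
      (λ k → %≡⇒≋ (constant (affine (+ a) (+ k)) (affine (+ a) 0ℤ) (on (+ k)) (on 0ℤ) (affine≢P (+ a) (+ k)) (affine≢P (+ a) 0ℤ))) (∑-falling≋0 j 1+j<p)
    more-roots : count (λ x → not (on-ℓ x)) p < count (is-root f) p
    more-roots = count-< p (is-root f) (λ x → not (on-ℓ x)) a (intercept<p i)
      (is-root-intro f a (≋-trans (≋-sym (moment≋eval (+ a))) moment-a≋0))
      (λ x x<p off → roots-off-ℓ f (λ x → ≋-sym (moment≋eval x)) x x<p off ,
                     λ { refl → Bool.not-¬ (sym (intercept-on-ℓ i)) (sym off) })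

  odd : ∀ i → ¬ ConstantOffP cc P (ℓ i)
  odd Fin.zero    = odd-L₀
  odd (Fin.suc i) = odd-vertical i

  not-in-span : ¬ Span (CoveredByFewer n P) cc
  not-in-span cc∈span = moment-at-0≉0 (Span⇒moment≋0 j 0ℤ (λ cov → covered⇒moment≋0 j n 1+j<p j+n≤1+p cov 0ℤ) cc∈span)

  odd-codeword-not-in-span : Σ Fun λ c → OddCodeword n P ℓ c × ¬ Span (CoveredByFewer n P) c
  odd-codeword-not-in-span = cc , (codeword-∈C ds , support , odd) , not-in-span

-- Imported only here: inside the modules above, _+_ is addition on ℤ.
open import Data.Nat using (_+_; _≤_; s≤s)
open import Data.Product using (Σ; _×_)
open import Relation.Nullary using (¬_)

corollary4p9 : (p : ℕ) .{{nz : NonZero p}} → Prime p →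
    (n : ℕ) → 3 ≤ n → n ≤ p + 1 →
    (P : PG.Point p) → (ℓ : Fin n → PG.Line p) →
    Injective _≡_ _≡_ (λ i → proj₁ (ℓ i)) →
    (∀ i → PG._∈L_ p P (ℓ i)) →
    Σ (PG.Fun p) λ c →
      PG.OddCodeword p n P ℓ c
      × ¬ PG.Span p (PG.CoveredByFewer p n P) c
corollary4p9 p p-prime (suc (suc (suc n′))) (s≤s (s≤s (s≤s _))) _ P ℓ ℓ-injective P∈ℓ =
  Theorem.odd-codeword-not-in-span p p-prime n′ P ℓ ℓ-injective P∈ℓ
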